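{- (i) $w_0(t)=1$ and for all $n\geq 0$, $w_{n+1}(t)=t\sum_{k=0}^n w_k(t^{ -1})\,w_{n-k}(t^{ -1})$. (ii) The generating series $W=\sum_{n\geq 0}w_n(t)x^n\in\left(\mathbb{Q}[t,t^{ -1}]\right)[[x]]$ satisfies $t(1+tx)-tW+2tx^2W^2+x^3W^4=0$.
   Context: For $n\geq 0$ let $P_n$ be a strictly convex polygon with $n+2$ vertices and a marked boundary edge $e_*$. A triangulation of $P_n$ is a decomposition into $n$ non-overlapping triangles with vertices among those of $P_n$. For $n\geq1$, its checkerboard colouring colours each triangle black or white such that the unique triangle containing $e_*$ is black and triangles sharing an edge have different colours; $n_b(\tau),n_w(\tau)$ denote the numbers of black and white triangles of the triangulation $\tau$. Define the Laurent polynomial $w_n(t)=\sum_{\tau}t^{n_b(\tau)-n_w(\tau)}$, the sum over all triangulations $\tau$ of $P_n$; by convention $w_0(t)=1$ (the degenerate polygon $P_0$ has a unique triangulation with no triangles). -}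

module Defs where

open import Data.Bool using (Bool; true; false; _∧_; _∨_; not; if_then_else_)
open import Data.Nat using (ℕ; zero; suc; _∸_; _≤ᵇ_; _<ᵇ_; _≡ᵇ_)
import Data.Nat as ℕ
open import Data.Integer using (ℤ; +_; -_) renaming (_+_ to _+ℤ_; _*_ to _*ℤ_)
open import Data.List using (List; []; _∷_; _++_; map; foldr; upTo; concatMap; length; zip)
open import Data.Product using (_×_; _,_; proj₁; proj₂)
open import Relation.Binary.PropositionalEquality using (_≡_)

-- Laurent polynomials in t with integer coefficients, as formal sums of
-- monomials  c · t^e  (pairs (c , e)).  Two such sums denote the same
-- Laurent polynomial iff all their coefficients agree (_≈L_).
-- (w_n has integer coefficients, and Z[t,t⁻¹] ⊆ Q[t,t⁻¹].)

Laurent : Set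
Laurent = List (ℤ × ℤ)

coeff : Laurent → ℤ → ℤ
coeff [] e = + 0
coeff ((c , e') ∷ p) e = (if ⌊eq⌋ e' e then c else + 0) +ℤ coeff p e
  where
  ⌊eq⌋ : ℤ → ℤ → Bool
  ⌊eq⌋ (+ m) (+ n) = m ≡ᵇ n
  ⌊eq⌋ (ℤ.negsuc m) (ℤ.negsuc n) = m ≡ᵇ n
  ⌊eq⌋ _ _ = false
    where import Data.Integer as ℤ

_≈L_ : Laurent → Laurent → Set
p ≈L q = ∀ e → coeff p e ≡ coeff q e

infix 4 _≈L_

0L : Laurent
0L = []

mono : ℤ → ℤ → Laurent
mono c e = (c , e) ∷ []

1L : Laurent
1L = mono (+ 1) (+ 0)

tL : Laurent
tL = mono (+ 1) (+ 1)

_+L_ : Laurent → Laurent → Laurent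
p +L q = p ++ q

-L_ : Laurent → Laurent
-L p = map (λ { (c , e) → (- c , e) }) p

_*L_ : Laurent → Laurent → Laurent
p *L q = concatMap (λ { (c , e) → map (λ { (d , f) → (c *ℤ d , e +ℤ f) }) q }) p

infixl 6 _+L_
infixl 7 _*L_

invT : Laurent → Laurent
invT p = map (λ { (c , e) → (c , - e) }) p

sumL : List Laurent → Laurent
sumL = foldr _+L_ 0L

Series : Set
Series = ℕ → Laurent

_≈S_ : Series → Series → Set
F ≈S G = ∀ N → F N ≈L G N

infix 4 _≈S_

constS : Laurent → Series
constS p zero = p
constS p (suc N) = 0L

_+S_ : Series → Series → Series
(F +S G) N = F N +L G N

-S_ : Series → Series
(-S F) N = -L (F N)

_*S_ : Series → Series → Series
(F *S G) N = sumL (map (λ k → F k *L G (N ∸ k)) (upTo (suc N)))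

infixl 6 _+S_
infixl 7 _*S_

xS : Series
xS zero = 0L
xS (suc zero) = 1L
xS (suc (suc N)) = 0L

-- Vertices of P_n are 0,1,…,n+1 in cyclic (convex) order; the marked
-- edge e_* is {0, n+1}.  A triangle is a triple (a , b , c) with
-- a < b < c ≤ n+1.

Tri : Set
Tri = ℕ × ℕ × ℕ

all : {A : Set} → (A → Bool) → List A → Bool
all p [] = true
all p (x ∷ xs) = p x ∧ all p xs

any : {A : Set} → (A → Bool) → List A → Bool
any p [] = false
any p (x ∷ xs) = p x ∨ any p xs

filterB : {A : Set} → (A → Bool) → List A → List A
filterB p [] = []
filterB p (x ∷ xs) = if p x then x ∷ filterB p xs else filterB p xs

countB : {A : Set} → (A → Bool) → List A → ℕ
countB p xs = length (filterB p xs)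

-- R holds for every pair of entries at distinct positions (R symmetric)
pairwiseB : {A : Set} → (A → A → Bool) → List A → Bool
pairwiseB R [] = true
pairwiseB R (x ∷ xs) = all (R x) xs ∧ pairwiseB R xs

-- all sublists (= all subsets of a list of distinct elements)
sublists : {A : Set} → List A → List (List A)
sublists [] = [] ∷ []
sublists (x ∷ xs) = sublists xs ++ map (x ∷_) (sublists xs)

boolLists : ℕ → List (List Bool)
boolLists zero = [] ∷ []
boolLists (suc k) = map (true ∷_) (boolLists k) ++ map (false ∷_) (boolLists k)

allTris : ℕ → List Tri
allTris m = concatMap (λ a → concatMap (λ b → map (λ c → (a , b , c))
              (filterB (λ c → b <ᵇ c) (upTo m)))
              (filterB (λ b → a <ᵇ b) (upTo m))) (upTo m)

verts : Tri → List ℕ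
verts (a , b , c) = a ∷ b ∷ c ∷ []

-- closed arc from l to r (l ≤ r) going through increasing labels
inArc : ℕ → ℕ → ℕ → Bool
inArc l r v = (l ≤ᵇ v) ∧ (v ≤ᵇ r)

-- closed arc from c to a (a < c) going through the top label and 0
outArc : ℕ → ℕ → ℕ → Bool
outArc a c v = (v ≤ᵇ a) ∨ (c ≤ᵇ v)

-- T₂ lies in a closed half-plane bounded by the line through an edge of
-- T₁ and not containing the interior of T₁ (for points in convex
-- position: all vertices of T₂ lie on the closed arc cut off by that edge)
separatedBy : Tri → Tri → Bool
separatedBy (a , b , c) T₂ =
  all (inArc a b) (verts T₂) ∨ all (inArc b c) (verts T₂) ∨ all (outArc a c) (verts T₂)

-- two triangles with vertices in convex position have disjoint interiors
-- iff they are separated by the line through some edge of one of them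
nonOverlapping : Tri → Tri → Bool
nonOverlapping T₁ T₂ = separatedBy T₁ T₂ ∨ separatedBy T₂ T₁

-- two (distinct) triangles share an edge iff they have two common vertices
shareEdge : Tri → Tri → Bool
shareEdge T₁ T₂ = 2 ≤ᵇ countB (λ v → any (λ u → u ≡ᵇ v) (verts T₂)) (verts T₁)

-- A colouring assigns a Bool (true = black,
-- false = white) to each triangle of τ.

containsMarkedEdge : ℕ → Tri → Bool
containsMarkedEdge n (a , b , c) = (a ≡ᵇ 0) ∧ (c ≡ᵇ suc n)

isTriangulation : ℕ → List Tri → Bool
isTriangulation n τ = (length τ ≡ᵇ n) ∧ pairwiseB nonOverlapping τ

differentB : Bool → Bool → Bool
differentB true false = true
differentB false true = true
differentB _ _ = false

isCheckerboard : ℕ → List (Tri × Bool) → Bool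
isCheckerboard n τc =
  all (λ { (T , col) → not (containsMarkedEdge n T) ∨ col }) τc
  ∧ pairwiseB (λ { (T₁ , c₁) (T₂ , c₂) → not (shareEdge T₁ T₂) ∨ differentB c₁ c₂ }) τc

blackMinusWhite : List Bool → ℤ
blackMinusWhite cols = + countB (λ b → b) cols ℤ.- + countB not cols
  where import Data.Integer as ℤ

-- w_n(t) for n ≥ 1: sum over triangulations τ of P_n of t^(n_b − n_w),
-- implemented as a sum over pairs (τ , checkerboard colouring of τ);
-- since each triangulation has exactly one checkerboard colouring, this
-- is the sum over triangulations.
wPos : ℕ → Laurent
wPos n = sumL (map (λ τ → sumL (map (λ cols →
           if isTriangulation n τ ∧ isCheckerboard n (zip τ cols)
           then mono (+ 1) (blackMinusWhite cols) else 0L)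
           (boolLists (length τ))))
         (sublists (allTris (suc (suc n)))))

w : ℕ → Laurent
w zero = 1L
w (suc n) = wPos (suc n)

W : Series
W = w

{-# OPTIONS --safe #-}
-- The triangle of a triangulation of P_{n+1} on the marked edge {0, n + 2} is (0, j + 1, n + 2)
-- for a unique j ≤ n, and it splits the triangulation into triangulations of the polygons
-- 0, …, j + 1 and j + 1, …, n + 2, copies of P_j and P_{n−j}. In the checkerboard colouring the
-- root triangles of the two halves are adjacent to the black root, hence white: the halves
-- contribute w_j(t⁻¹) and w_{n−j}(t⁻¹), and the root itself a factor t. Writing
-- V for W with t replaced by t⁻¹, (i) says W = 1 + t x V², hence also V = 1 + t⁻¹ x W², and
-- eliminating V gives the quartic (ii).
--
-- Formally, weights are attached to all sub-polygons l, …, r, as sums over coloured lists of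
-- candidate triangles; they depend only on r − l. The root triangle exists because a triangle
-- of maximal span that does not rest on {l, r} leaves too little room for the others.
module Submission where

open import Defs
open import Relation.Binary.Definitions using (DecidableEquality)

module LaurentPolynomial where

  open import Data.Bool using (if_then_else_)
  open import Data.Integer as ℤ using (ℤ; +_; -[1+_]; -_; _+_; _*_; _-_)
  import Data.Integer.Properties as ℤP
  open import Data.Integer.Solver using (module +-*-Solver)
  open import Data.List using (List; []; _∷_; _++_; map; concatMap)
  import Data.List.Properties as ListP
  open import Data.List.Relation.Binary.Permutation.Propositional using (_↭_; prep; swap) renaming (refl to ↭refl; trans to ↭trans)
  open import Data.Product using (_×_; _,_; proj₁; proj₂)
  open import Data.Empty using (⊥-elim)
  open import Function using (_∘_)
  open import Algebra.Bundles using (CommutativeRing)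
  open import Relation.Binary using (IsEquivalence)
  open import Relation.Binary.PropositionalEquality
  open import Relation.Nullary using (does; yes; no)
  open +-*-Solver

  δ : ℤ → ℤ → ℤ → ℤ
  δ x y c = if does (x ℤ.≟ y) then c else + 0

  coeff-∷ : ∀ c e' p e → coeff ((c , e') ∷ p) e ≡ δ e' e c + coeff p e
  coeff-∷ c (+ m) p (+ n) = refl
  coeff-∷ c (+ m) p -[1+ n ] = refl
  coeff-∷ c -[1+ m ] p (+ n) = refl
  coeff-∷ c -[1+ m ] p -[1+ n ] = refl

  δ-resp-⇔ : ∀ {x y x' y'} c → (x ≡ y → x' ≡ y') → (x' ≡ y' → x ≡ y) → δ x y c ≡ δ x' y' c
  δ-resp-⇔ {x} {y} {x'} {y'} c f g with x ℤ.≟ y | x' ℤ.≟ y'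
  ... | yes p | yes q = refl
  ... | yes p | no q = ⊥-elim (q (f p))
  ... | no p | yes q = ⊥-elim (p (g q))
  ... | no p | no q = refl

  *-δ : ∀ x y c d → d * δ x y c ≡ δ x y (d * c)
  *-δ x y c d with x ℤ.≟ y
  ... | yes _ = refl
  ... | no _ = ℤP.*-zeroʳ d

  δ-neg : ∀ x y c → - δ x y c ≡ δ x y (- c)
  δ-neg x y c with x ℤ.≟ y
  ... | yes _ = refl
  ... | no _ = refl

  δ-+ : ∀ x y c d → δ x y c + δ x y d ≡ δ x y (c + d)
  δ-+ x y c d with x ℤ.≟ y
  ... | yes _ = refl
  ... | no _ = refl

  module _ {A : Set} where

    sumZ : (A → ℤ) → List A → ℤ
    sumZ f [] = + 0
    sumZ f (x ∷ xs) = f x + sumZ f xs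

    sumZ-++ : ∀ f xs ys → sumZ f (xs ++ ys) ≡ sumZ f xs + sumZ f ys
    sumZ-++ f [] ys = sym (ℤP.+-identityˡ _)
    sumZ-++ f (x ∷ xs) ys = trans (cong (_+_ (f x)) (sumZ-++ f xs ys)) (sym (ℤP.+-assoc (f x) _ _))

    sumZ-cong : ∀ {f g} xs → (∀ x → f x ≡ g x) → sumZ f xs ≡ sumZ g xs
    sumZ-cong [] h = refl
    sumZ-cong (x ∷ xs) h = cong₂ _+_ (h x) (sumZ-cong xs h)

    sumZ-+ : ∀ f g xs → sumZ (λ x → f x + g x) xs ≡ sumZ f xs + sumZ g xs
    sumZ-+ f g [] = refl
    sumZ-+ f g (x ∷ xs) rewrite sumZ-+ f g xs =
      solve 4 (λ a b c d → (a :+ b) :+ (c :+ d) := (a :+ c) :+ (b :+ d)) refl (f x) (g x) (sumZ f xs) (sumZ g xs)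

    sumZ-*ˡ : ∀ c f xs → c * sumZ f xs ≡ sumZ (λ x → c * f x) xs
    sumZ-*ˡ c f [] = ℤP.*-zeroʳ c
    sumZ-*ˡ c f (x ∷ xs) = trans (ℤP.*-distribˡ-+ c (f x) _) (cong (_+_ (c * f x)) (sumZ-*ˡ c f xs))

    sumZ-0 : ∀ xs → sumZ (λ _ → + 0) xs ≡ + 0
    sumZ-0 [] = refl
    sumZ-0 (x ∷ xs) = trans (ℤP.+-identityˡ _) (sumZ-0 xs)

  sumZ-↭ : ∀ {A : Set} (f : A → ℤ) {xs ys} → xs ↭ ys → sumZ f xs ≡ sumZ f ys
  sumZ-↭ f ↭refl = refl
  sumZ-↭ f (prep x q) = cong (_+_ (f x)) (sumZ-↭ f q)
  sumZ-↭ f {x ∷ y ∷ xs} {y ∷ x ∷ ys} (swap x y q) rewrite sumZ-↭ f q =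
    trans (sym (ℤP.+-assoc (f x) (f y) _)) (trans (cong (_+ sumZ f ys) (ℤP.+-comm (f x) (f y))) (ℤP.+-assoc (f y) (f x) _))
  sumZ-↭ f (↭trans q q') = trans (sumZ-↭ f q) (sumZ-↭ f q')

  sumZ-map : ∀ {A B : Set} (f : B → ℤ) (g : A → B) xs → sumZ f (map g xs) ≡ sumZ (f ∘ g) xs
  sumZ-map f g [] = refl
  sumZ-map f g (x ∷ xs) = cong (_+_ (f (g x))) (sumZ-map f g xs)

  sumZ-concatMap : ∀ {A B : Set} (f : B → ℤ) (g : A → List B) xs →
    sumZ f (concatMap g xs) ≡ sumZ (λ x → sumZ f (g x)) xs
  sumZ-concatMap f g [] = refl
  sumZ-concatMap f g (x ∷ xs) = trans (sumZ-++ f (g x) _) (cong (_+_ (sumZ f (g x))) (sumZ-concatMap f g xs))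

  sumZ-swap : ∀ {A B : Set} (f : A → B → ℤ) xs ys →
    sumZ (λ x → sumZ (f x) ys) xs ≡ sumZ (λ y → sumZ (λ x → f x y) xs) ys
  sumZ-swap f [] ys = sym (sumZ-0 ys)
  sumZ-swap f (x ∷ xs) ys = trans (cong (_+_ (sumZ (f x) ys)) (sumZ-swap f xs ys))
    (sym (sumZ-+ (f x) (λ y → sumZ (λ x → f x y) xs) ys))

  monoCoeff : ℤ → ℤ × ℤ → ℤ
  monoCoeff e (c , a) = δ a e c

  monoMul : ℤ × ℤ → ℤ × ℤ → ℤ × ℤ
  monoMul (c , a) (d , b) = (c * d , a + b)

  monoInv : ℤ × ℤ → ℤ × ℤ
  monoInv (c , a) = (c , - a)

  monoMul-comm : ∀ x y → monoMul x y ≡ monoMul y x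
  monoMul-comm (c , a) (d , b) = cong₂ _,_ (ℤP.*-comm c d) (ℤP.+-comm a b)

  monoMul-assoc : ∀ x y z → monoMul (monoMul x y) z ≡ monoMul x (monoMul y z)
  monoMul-assoc (c , a) (d , b) (f , g) = cong₂ _,_ (ℤP.*-assoc c d f) (ℤP.+-assoc a b g)

  coeff-sumZ : ∀ p e → coeff p e ≡ sumZ (monoCoeff e) p
  coeff-sumZ [] e = refl
  coeff-sumZ ((c , a) ∷ p) e = trans (coeff-∷ c a p e) (cong (_+_ (δ a e c)) (coeff-sumZ p e))

  coeff-++ : ∀ p q e → coeff (p ++ q) e ≡ coeff p e + coeff q e
  coeff-++ p q e = trans (coeff-sumZ (p ++ q) e)
    (trans (sumZ-++ (monoCoeff e) p q) (sym (cong₂ _+_ (coeff-sumZ p e) (coeff-sumZ q e))))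

  coeff-mono : ∀ c a e → coeff (mono c a) e ≡ δ a e c
  coeff-mono c a e = trans (coeff-∷ c a [] e) (ℤP.+-identityʳ _)

  coeff-neg : ∀ p e → coeff (-L p) e ≡ - coeff p e
  coeff-neg [] e = refl
  coeff-neg ((c , a) ∷ p) e = trans (coeff-∷ (- c) a (-L p) e)
    (trans (cong₂ _+_ (sym (δ-neg a e c)) (coeff-neg p e))
    (trans (sym (ℤP.neg-distrib-+ (δ a e c) (coeff p e))) (cong -_ (sym (coeff-∷ c a p e)))))

  coeff-invT : ∀ p e → coeff (invT p) e ≡ coeff p (- e)
  coeff-invT [] e = refl
  coeff-invT ((c , a) ∷ p) e = trans (coeff-∷ c (- a) (invT p) e)
    (trans (cong₂ _+_ (δ-resp-⇔ { - a} {e} {a} { - e} c (λ h → trans (sym (ℤP.neg-involutive a)) (cong -_ h))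
                                                         (λ h → trans (cong -_ h) (ℤP.neg-involutive e)))
                      (coeff-invT p e))
     (sym (coeff-∷ c a p (- e))))

  coeff-* : ∀ p q e → coeff (p *L q) e ≡ sumZ (λ x → sumZ (λ y → monoCoeff e (monoMul x y)) q) p
  coeff-* p q e = trans (coeff-sumZ (p *L q) e)
    (trans (sumZ-concatMap (monoCoeff e) _ p) (sumZ-cong p (λ x → sumZ-map (monoCoeff e) (monoMul x) q)))

  coeff-*-shift : ∀ p q e → coeff (p *L q) e ≡ sumZ (λ x → proj₁ x * coeff q (e - proj₂ x)) p
  coeff-*-shift p q e = trans (coeff-* p q e) (sumZ-cong p λ { (c , a) →
    trans (sumZ-cong q (λ { (d , b) → trans (δ-resp-⇔ {a + b} {e} {b} {e - a} (c * d)
           (λ h → trans (sym (+-cancelˡ a b)) (cong (_- a) h))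
           (λ h → trans (cong (_+_ (a)) h) (+-minus a e)))
           (sym (*-δ b (e - a) d c)) }))
    (trans (sym (sumZ-*ˡ c (monoCoeff (e - a)) q)) (cong (c *_) (sym (coeff-sumZ q (e - a))))) })
    where
    +-cancelˡ : ∀ a b → a + b - a ≡ b
    +-cancelˡ = solve 2 (λ a b → a :+ b :- a := b) refl
    +-minus : ∀ a e → a + (e - a) ≡ e
    +-minus = solve 2 (λ a e → a :+ (e :- a) := e) refl

  *L-comm : ∀ p q → p *L q ≈L q *L p
  *L-comm p q e = trans (coeff-* p q e) (trans (sumZ-swap (λ x y → monoCoeff e (monoMul x y)) p q)
    (trans (sumZ-cong q (λ y → sumZ-cong p (λ x → cong (monoCoeff e) (monoMul-comm x y)))) (sym (coeff-* q p e))))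

  *L-congʳ : ∀ p {q q'} → q ≈L q' → p *L q ≈L p *L q'
  *L-congʳ p {q} {q'} h e = trans (coeff-*-shift p q e)
    (trans (sumZ-cong p (λ x → cong (proj₁ x *_) (h (e - proj₂ x)))) (sym (coeff-*-shift p q' e)))

  *L-cong : ∀ {p p' q q'} → p ≈L p' → q ≈L q' → p *L q ≈L p' *L q'
  *L-cong {p} {p'} {q} {q'} h k e =
    trans (*L-congʳ p k e) (trans (*L-comm p q' e) (trans (*L-congʳ q' h e) (*L-comm q' p' e)))

  *L-assoc : ∀ p q r → (p *L q) *L r ≈L p *L (q *L r)
  *L-assoc p q r e = trans (coeff-* (p *L q) r e)
    (trans (sumZ-concatMap (λ z → sumZ (λ y → monoCoeff e (monoMul z y)) r) _ p)
    (trans (sumZ-cong p (λ x → trans (sumZ-map (λ z → sumZ (λ y → monoCoeff e (monoMul z y)) r) (monoMul x) q)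
       (trans (sumZ-cong q (λ x' → sumZ-cong r (λ y → cong (monoCoeff e) (monoMul-assoc x x' y))))
       (sym (trans (sumZ-concatMap (λ z → monoCoeff e (monoMul x z)) _ q)
         (sumZ-cong q (λ x' → sumZ-map (λ z → monoCoeff e (monoMul x z)) (monoMul x') r)))))))
    (sym (coeff-* p (q *L r) e))))

  *L-distribˡ : ∀ p q r → p *L (q +L r) ≈L p *L q +L p *L r
  *L-distribˡ p q r e = trans (coeff-*-shift p (q +L r) e)
    (trans (sumZ-cong p (λ x → trans (cong (proj₁ x *_) (coeff-++ q r (e - proj₂ x))) (ℤP.*-distribˡ-+ (proj₁ x) _ _)))
    (trans (sumZ-+ _ _ p)
    (trans (cong₂ _+_ (sym (coeff-*-shift p q e)) (sym (coeff-*-shift p r e))) (sym (coeff-++ (p *L q) (p *L r) e)))))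

  *L-identityˡ : ∀ p → 1L *L p ≈L p
  *L-identityˡ p e = trans (coeff-*-shift 1L p e)
    (trans (ℤP.+-identityʳ _) (trans (ℤP.*-identityˡ _) (cong (coeff p) (ℤP.+-identityʳ e))))

  invT-map : ∀ p → invT p ≡ map monoInv p
  invT-map [] = refl
  invT-map ((c , a) ∷ p) = cong ((c , - a) ∷_) (invT-map p)

  invT-* : ∀ p q → invT (p *L q) ≈L invT p *L invT q
  invT-* p q e rewrite invT-map p | invT-map q = trans (coeff-invT (p *L q) e) (trans (coeff-* p q (- e))
    (trans (sumZ-cong p (λ x → sumZ-cong q (λ y → monoCoeff-inv x y)))
    (sym (trans (coeff-* (map monoInv p) (map monoInv q) e)
         (trans (sumZ-map _ monoInv p) (sumZ-cong p (λ x → sumZ-map _ monoInv q)))))))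
    where
    monoCoeff-inv : ∀ x y → monoCoeff (- e) (monoMul x y) ≡ monoCoeff e (monoMul (monoInv x) (monoInv y))
    monoCoeff-inv (c , a) (d , b) = δ-resp-⇔ {a + b} { - e} { - a + - b} {e} (c * d)
      (λ h → trans (sym (ℤP.neg-distrib-+ a b)) (trans (cong -_ h) (ℤP.neg-involutive e)))
      (λ h → trans (sym (ℤP.neg-involutive _)) (cong -_ (trans (ℤP.neg-distrib-+ a b) h)))

  invT-+ : ∀ p q → invT (p +L q) ≡ invT p +L invT q
  invT-+ p q = ListP.map-++ _ p q

  -- A record rather than the bare function type p ≈L q, so that the relation
  -- stays injective and Agda can infer its arguments in ring-level reasoning.
  record _≋_ (p q : Laurent) : Set where
    constructor ⟪_⟫
    field ≋→ : p ≈L q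
  open _≋_ public

  infix 4 _≋_

  ≋-isEquivalence : IsEquivalence _≋_
  ≋-isEquivalence = record
    { refl = ⟪ (λ _ → refl) ⟫
    ; sym = λ h → ⟪ (λ e → sym (≋→ h e)) ⟫
    ; trans = λ h k → ⟪ (λ e → trans (≋→ h e) (≋→ k e)) ⟫ }

  +L-cong : ∀ {p p' q q'} → p ≋ p' → q ≋ q' → p +L q ≋ p' +L q'
  +L-cong {p} {p'} {q} {q'} h k = ⟪ (λ e →
    trans (coeff-++ p q e) (trans (cong₂ _+_ (≋→ h e) (≋→ k e)) (sym (coeff-++ p' q' e)))) ⟫

  +L-comm : ∀ p q → p +L q ≋ q +L p
  +L-comm p q = ⟪ (λ e → trans (coeff-++ p q e) (trans (ℤP.+-comm (coeff p e) (coeff q e)) (sym (coeff-++ q p e)))) ⟫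

  -L-inverseˡ : ∀ p → -L p +L p ≋ 0L
  -L-inverseˡ p = ⟪ (λ e → trans (coeff-++ (-L p) p e)
    (trans (cong (_+ coeff p e) (coeff-neg p e)) (ℤP.+-inverseˡ (coeff p e)))) ⟫

  -L-cong : ∀ {p q} → p ≋ q → -L p ≋ -L q
  -L-cong {p} {q} h = ⟪ (λ e → trans (coeff-neg p e) (trans (cong -_ (≋→ h e)) (sym (coeff-neg q e)))) ⟫

  invT-cong : ∀ {p q} → p ≋ q → invT p ≋ invT q
  invT-cong {p} {q} h = ⟪ (λ e → trans (coeff-invT p e) (trans (≋→ h (- e)) (sym (coeff-invT q e)))) ⟫

  invT-involutive : ∀ p → invT (invT p) ≋ p
  invT-involutive p = ⟪ (λ e →
    trans (coeff-invT (invT p) e) (trans (coeff-invT p (- e)) (cong (coeff p) (ℤP.neg-involutive e)))) ⟫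

  LaurentRing : CommutativeRing _ _
  LaurentRing = record
    { Carrier = Laurent ; _≈_ = _≋_ ; _+_ = _+L_ ; _*_ = _*L_ ; -_ = -L_ ; 0# = 0L ; 1# = 1L
    ; isCommutativeRing = record
      { isRing = record
        { +-isAbelianGroup = record
          { isGroup = record
            { isMonoid = record
              { isSemigroup = record
                { isMagma = record { isEquivalence = ≋-isEquivalence ; ∙-cong = +L-cong }
                ; assoc = λ p q r → ⟪ (λ e → cong (λ z → coeff z e) (ListP.++-assoc p q r)) ⟫ }
              ; identity = (λ p → ⟪ (λ e → refl) ⟫)
                         , (λ p → ⟪ (λ e → cong (λ z → coeff z e) (ListP.++-identityʳ p)) ⟫) }
            ; inverse = -L-inverseˡ , (λ p → IsEquivalence.trans ≋-isEquivalence (+L-comm p (-L p)) (-L-inverseˡ p))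
            ; ⁻¹-cong = -L-cong }
          ; comm = +L-comm }
        ; *-cong = λ {p} {p'} {q} {q'} h k → ⟪ *L-cong {p} {p'} {q} {q'} (≋→ h) (≋→ k) ⟫
        ; *-assoc = λ p q r → ⟪ *L-assoc p q r ⟫
        ; *-identity = (λ p → ⟪ *L-identityˡ p ⟫) , (λ p → ⟪ (λ e → trans (*L-comm p 1L e) (*L-identityˡ p e)) ⟫)
        ; distrib = (λ p q r → ⟪ *L-distribˡ p q r ⟫)
                  , (λ p q r → ⟪ (λ e → trans (*L-comm (q +L r) p e) (trans (*L-distribˡ p q r e)
                       (≋→ (+L-cong {p *L q} {q *L p} {p *L r} {r *L p} ⟪ *L-comm p q ⟫ ⟪ *L-comm p r ⟫) e))) ⟫) }
      ; *-comm = λ p q → ⟪ *L-comm p q ⟫ } }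


module PowerSeries where

  open LaurentPolynomial
  open import Data.Nat using (ℕ; zero; suc; _∸_; _<_; s≤s; z≤n)
  import Data.Nat.Properties as ℕP
  open import Data.List using (map; applyUpTo)
  open import Data.Maybe using (nothing)
  open import Data.Product using (_,_)
  open import Function using (_∘_; id)
  open import Relation.Binary.PropositionalEquality as P using (_≡_)
  open import Algebra.Bundles using (CommutativeRing)
  open import Tactic.RingSolver.Core.AlmostCommutativeRing using (fromCommutativeRing)
  import Tactic.RingSolver.NonReflective

  module L = CommutativeRing LaurentRing
  open L using () renaming (refl to ≈refl; sym to ≈sym; trans to ≈trans)
  module LS = Tactic.RingSolver.NonReflective (fromCommutativeRing LaurentRing (λ _ → nothing))
  open LS using (_⊕_; _⊗_; _⊜_)
  open import Relation.Binary.Reasoning.Setoid L.setoid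

  sumBelow : (ℕ → Laurent) → ℕ → Laurent
  sumBelow f zero = 0L
  sumBelow f (suc n) = f 0 +L sumBelow (f ∘ suc) n

  sumL-applyUpTo : ∀ (f : ℕ → Laurent) (g : ℕ → ℕ) n → sumL (map f (applyUpTo g n)) ≡ sumBelow (f ∘ g) n
  sumL-applyUpTo f g zero = P.refl
  sumL-applyUpTo f g (suc n) = P.cong (f (g 0) +L_) (sumL-applyUpTo f (g ∘ suc) n)

  *S-sumBelow : ∀ F G N → (F *S G) N ≡ sumBelow (λ k → F k *L G (N ∸ k)) (suc N)
  *S-sumBelow F G N = sumL-applyUpTo (λ k → F k *L G (N ∸ k)) id (suc N)

  sumBelow-cong : ∀ {f g} n → (∀ k → k < n → f k ≋ g k) → sumBelow f n ≋ sumBelow g n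
  sumBelow-cong zero h = ≈refl
  sumBelow-cong {f} {g} (suc n) h = +L-cong {f 0} {g 0} (h 0 (s≤s z≤n)) (sumBelow-cong {f ∘ suc} {g ∘ suc} n (λ k k<n → h (suc k) (s≤s k<n)))

  sumBelow-+ : ∀ f g n → sumBelow (λ k → f k +L g k) n ≋ sumBelow f n +L sumBelow g n
  sumBelow-+ f g zero = ≈sym (L.+-identityˡ 0L)
  sumBelow-+ f g (suc n) = begin
    (f 0 +L g 0) +L sumBelow (λ k → f (suc k) +L g (suc k)) n ≈⟨ +L-cong {f 0 +L g 0} ≈refl (sumBelow-+ (f ∘ suc) (g ∘ suc) n) ⟩
    (f 0 +L g 0) +L (sumBelow (f ∘ suc) n +L sumBelow (g ∘ suc) n) ≈⟨ LS.solve 4 (λ a b c d → ((a ⊕ b) ⊕ (c ⊕ d)) ⊜ ((a ⊕ c) ⊕ (b ⊕ d))) ≈refl (f 0) (g 0) (sumBelow (f ∘ suc) n) (sumBelow (g ∘ suc) n) ⟩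
    (f 0 +L sumBelow (f ∘ suc) n) +L (g 0 +L sumBelow (g ∘ suc) n) ∎

  sumBelow-*ˡ : ∀ c f n → c *L sumBelow f n ≋ sumBelow (λ k → c *L f k) n
  sumBelow-*ˡ c f zero = L.zeroʳ c
  sumBelow-*ˡ c f (suc n) = ≈trans (L.distribˡ c (f 0) (sumBelow (f ∘ suc) n)) (+L-cong {c *L f 0} ≈refl (sumBelow-*ˡ c (f ∘ suc) n))

  sumBelow-0 : ∀ f n → (∀ k → f k ≋ 0L) → sumBelow f n ≋ 0L
  sumBelow-0 f n h = ≈trans (sumBelow-cong n (λ k _ → h k)) (sumBelow-zeros n)
    where
    sumBelow-zeros : ∀ n → sumBelow (λ _ → 0L) n ≋ 0L
    sumBelow-zeros zero = ≈refl
    sumBelow-zeros (suc n) = ≈trans (L.+-identityˡ _) (sumBelow-zeros n)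

  sumBelow-suc : ∀ f n → sumBelow f (suc n) ≋ sumBelow f n +L f n
  sumBelow-suc f zero = ≈trans (L.+-identityʳ (f 0)) (≈sym (L.+-identityˡ (f 0)))
  sumBelow-suc f (suc n) = ≈trans (+L-cong {f 0} ≈refl (sumBelow-suc (f ∘ suc) n)) (≈sym (L.+-assoc (f 0) _ _))

  _⁺ : Series → Series
  (F ⁺) k = F (suc k)

  *S-at-0 : ∀ F G → (F *S G) 0 ≋ F 0 *L G 0
  *S-at-0 F G = L.+-identityʳ _

  *S-at-suc : ∀ F G N → (F *S G) (suc N) ≋ F 0 *L G (suc N) +L (F ⁺ *S G) N
  *S-at-suc F G N rewrite *S-sumBelow F G (suc N) | *S-sumBelow (F ⁺) G N = ≈refl

  *S-at-suc′ : ∀ F G N → (F *S G) (suc N) ≋ (F *S G ⁺) N +L F (suc N) *L G 0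
  *S-at-suc′ F G N rewrite *S-sumBelow F G (suc N) | *S-sumBelow F (G ⁺) N = begin
    sumBelow h (suc (suc N)) ≈⟨ sumBelow-suc h (suc N) ⟩
    sumBelow h (suc N) +L h (suc N) ≈⟨ +L-cong {sumBelow h (suc N)} (sumBelow-cong (suc N) (λ k k<n → L.reflexive (P.cong (λ z → F k *L G z) (ℕP.+-∸-assoc 1 (ℕP.≤-pred k<n)))))
                                   (L.reflexive (P.cong (λ z → F (suc N) *L G z) (ℕP.n∸n≡0 N))) ⟩
    sumBelow (λ k → F k *L G (suc (N ∸ k))) (suc N) +L F (suc N) *L G 0 ∎
    where h = λ k → F k *L G (suc N ∸ k)

  *S-cong : ∀ {F F' G G'} → (∀ k → F k ≋ F' k) → (∀ k → G k ≋ G' k) → ∀ N → (F *S G) N ≋ (F' *S G') N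
  *S-cong {F} {F'} {G} {G'} h k N rewrite *S-sumBelow F G N | *S-sumBelow F' G' N = sumBelow-cong (suc N) (λ j _ → L.*-cong {F j} {F' j} {G (N ∸ j)} {G' (N ∸ j)} (h j) (k (N ∸ j)))

  *S-distribʳ : ∀ F G H N → ((F +S G) *S H) N ≋ (F *S H +S G *S H) N
  *S-distribʳ F G H N rewrite *S-sumBelow (F +S G) H N | *S-sumBelow F H N | *S-sumBelow G H N =
    ≈trans (sumBelow-cong (suc N) (λ j _ → L.distribʳ (H (N ∸ j)) (F j) (G j))) (sumBelow-+ (λ j → F j *L H (N ∸ j)) (λ j → G j *L H (N ∸ j)) (suc N))

  *S-scal : ∀ c G H N → ((λ k → c *L G k) *S H) N ≋ c *L (G *S H) N
  *S-scal c G H N rewrite *S-sumBelow (λ k → c *L G k) H N | *S-sumBelow G H N =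
    ≈trans (sumBelow-cong (suc N) (λ j _ → L.*-assoc c (G j) (H (N ∸ j)))) (≈sym (sumBelow-*ˡ c (λ j → G j *L H (N ∸ j)) (suc N)))

  *S-comm : ∀ N F G → (F *S G) N ≋ (G *S F) N
  *S-comm zero F G = ≈trans (*S-at-0 F G) (≈trans (L.*-comm (F 0) (G 0)) (≈sym (*S-at-0 G F)))
  *S-comm (suc N) F G = begin
    (F *S G) (suc N) ≈⟨ *S-at-suc F G N ⟩
    F 0 *L G (suc N) +L (F ⁺ *S G) N ≈⟨ +L-cong {F 0 *L G (suc N)} (L.*-comm (F 0) (G (suc N))) (*S-comm N (F ⁺) G) ⟩
    G (suc N) *L F 0 +L (G *S F ⁺) N ≈⟨ L.+-comm (G (suc N) *L F 0) ((G *S F ⁺) N) ⟩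
    (G *S F ⁺) N +L G (suc N) *L F 0 ≈⟨ ≈sym (*S-at-suc′ G F N) ⟩
    (G *S F) (suc N) ∎

  *S-assoc : ∀ N F G H → ((F *S G) *S H) N ≋ (F *S (G *S H)) N
  *S-assoc zero F G H = begin
    ((F *S G) *S H) 0 ≈⟨ *S-at-0 (F *S G) H ⟩
    (F *S G) 0 *L H 0 ≈⟨ L.*-cong {(F *S G) 0} {F 0 *L G 0} {H 0} (*S-at-0 F G) ≈refl ⟩
    (F 0 *L G 0) *L H 0 ≈⟨ L.*-assoc (F 0) (G 0) (H 0) ⟩
    F 0 *L (G 0 *L H 0) ≈⟨ L.*-cong {F 0} {F 0} {G 0 *L H 0} ≈refl (≈sym (*S-at-0 G H)) ⟩
    F 0 *L (G *S H) 0 ≈⟨ ≈sym (*S-at-0 F (G *S H)) ⟩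
    (F *S (G *S H)) 0 ∎
  *S-assoc (suc N) F G H = begin
    ((F *S G) *S H) (suc N) ≈⟨ *S-at-suc (F *S G) H N ⟩
    (F *S G) 0 *L H (suc N) +L ((F *S G) ⁺ *S H) N
      ≈⟨ +L-cong {(F *S G) 0 *L H (suc N)} (L.*-cong {(F *S G) 0} {F 0 *L G 0} {H (suc N)} (*S-at-0 F G) ≈refl)
          (*S-cong {(F *S G) ⁺} {(λ k → F 0 *L G (suc k)) +S (F ⁺ *S G)} {H} {H} (λ k → *S-at-suc F G k) (λ _ → ≈refl) N) ⟩
    (F 0 *L G 0) *L H (suc N) +L (((λ k → F 0 *L G (suc k)) +S (F ⁺ *S G)) *S H) N
      ≈⟨ +L-cong {(F 0 *L G 0) *L H (suc N)} ≈refl (*S-distribʳ (λ k → F 0 *L G (suc k)) (F ⁺ *S G) H N) ⟩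
    (F 0 *L G 0) *L H (suc N) +L (((λ k → F 0 *L G (suc k)) *S H) N +L ((F ⁺ *S G) *S H) N)
      ≈⟨ +L-cong {(F 0 *L G 0) *L H (suc N)} ≈refl (+L-cong {((λ k → F 0 *L G (suc k)) *S H) N} (*S-scal (F 0) (G ⁺) H N) (*S-assoc N (F ⁺) G H)) ⟩
    (F 0 *L G 0) *L H (suc N) +L (F 0 *L (G ⁺ *S H) N +L (F ⁺ *S (G *S H)) N)
      ≈⟨ LS.solve 6 (λ a b c d e f → (((a ⊗ b) ⊗ c) ⊕ ((a ⊗ d) ⊕ f)) ⊜ ((a ⊗ ((b ⊗ c) ⊕ d)) ⊕ f)) ≈refl (F 0) (G 0) (H (suc N)) ((G ⁺ *S H) N) (F 0) ((F ⁺ *S (G *S H)) N) ⟩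
    F 0 *L (G 0 *L H (suc N) +L (G ⁺ *S H) N) +L (F ⁺ *S (G *S H)) N
      ≈⟨ +L-cong {F 0 *L (G 0 *L H (suc N) +L (G ⁺ *S H) N)} (L.*-cong {F 0} {F 0} ≈refl (≈sym (*S-at-suc G H N))) ≈refl ⟩
    F 0 *L (G *S H) (suc N) +L (F ⁺ *S (G *S H)) N ≈⟨ ≈sym (*S-at-suc F (G *S H) N) ⟩
    (F *S (G *S H)) (suc N) ∎

  *S-zeroˡ : ∀ F G N → (∀ k → F k ≋ 0L) → (F *S G) N ≋ 0L
  *S-zeroˡ F G N h rewrite *S-sumBelow F G N = sumBelow-0 _ (suc N) (λ k → ≈trans (L.*-cong {F k} {0L} {G (N ∸ k)} (h k) ≈refl) (L.zeroˡ (G (N ∸ k))))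

  *S-identityˡ : ∀ F N → (constS 1L *S F) N ≋ F N
  *S-identityˡ F zero = ≈trans (*S-at-0 (constS 1L) F) (L.*-identityˡ (F 0))
  *S-identityˡ F (suc N) = ≈trans (*S-at-suc (constS 1L) F N)
    (≈trans (+L-cong {1L *L F (suc N)} (L.*-identityˡ (F (suc N))) (*S-zeroˡ (constS 1L ⁺) F N (λ _ → ≈refl))) (L.+-identityʳ (F (suc N))))

  record _≋S_ (F G : Series) : Set where
    constructor ⟪_⟫S
    field ≋S→ : ∀ N → F N ≋ G N
  open _≋S_ public
  infix 4 _≋S_

  constS-0L : ∀ N → constS 0L N ≋ 0L
  constS-0L zero = ≈refl
  constS-0L (suc N) = ≈refl

  SeriesRing : CommutativeRing _ _
  SeriesRing = record
    { Carrier = Series ; _≈_ = _≋S_ ; _+_ = _+S_ ; _*_ = _*S_ ; -_ = -S_ ; 0# = constS 0L ; 1# = constS 1L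
    ; isCommutativeRing = record
      { isRing = record
        { +-isAbelianGroup = record
          { isGroup = record
            { isMonoid = record
              { isSemigroup = record
                { isMagma = record { isEquivalence = record { refl = ⟪ (λ _ → ≈refl) ⟫S ; sym = λ h → ⟪ (λ N → ≈sym (≋S→ h N)) ⟫S ; trans = λ h k → ⟪ (λ N → ≈trans (≋S→ h N) (≋S→ k N)) ⟫S }
                                   ; ∙-cong = λ h k → ⟪ (λ N → +L-cong (≋S→ h N) (≋S→ k N)) ⟫S }
                ; assoc = λ F G H → ⟪ (λ N → L.+-assoc (F N) (G N) (H N)) ⟫S }
              ; identity = (λ F → ⟪ (λ N → ≈trans (+L-cong (constS-0L N) ≈refl) (L.+-identityˡ (F N))) ⟫S) , (λ F → ⟪ (λ N → ≈trans (+L-cong ≈refl (constS-0L N)) (L.+-identityʳ (F N))) ⟫S) }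
            ; inverse = (λ F → ⟪ (λ N → ≈trans (L.-‿inverseˡ (F N)) (≈sym (constS-0L N))) ⟫S) , (λ F → ⟪ (λ N → ≈trans (L.-‿inverseʳ (F N)) (≈sym (constS-0L N))) ⟫S)
            ; ⁻¹-cong = λ h → ⟪ (λ N → L.-‿cong (≋S→ h N)) ⟫S }
          ; comm = λ F G → ⟪ (λ N → L.+-comm (F N) (G N)) ⟫S }
        ; *-cong = λ h k → ⟪ *S-cong (≋S→ h) (≋S→ k) ⟫S
        ; *-assoc = λ F G H → ⟪ (λ N → *S-assoc N F G H) ⟫S
        ; *-identity = (λ F → ⟪ *S-identityˡ F ⟫S) , (λ F → ⟪ (λ N → ≈trans (*S-comm N F (constS 1L)) (*S-identityˡ F N)) ⟫S)
        ; distrib = (λ F G H → ⟪ (λ N → ≈trans (*S-comm N F (G +S H)) (≈trans (*S-distribʳ G H F N) (+L-cong (*S-comm N G F) (*S-comm N H F)))) ⟫S)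
                  , (λ F G H → ⟪ *S-distribʳ G H F ⟫S) }
      ; *-comm = λ F G → ⟪ (λ N → *S-comm N F G) ⟫S } }

module FunctionalEquation where

  open LaurentPolynomial
  open PowerSeries
  open import Data.Bool using (true; false; if_then_else_)
  open import Data.Nat using (zero; suc; _∸_)
  open import Data.Integer as ℤ using (ℤ; +_; -_)
  import Data.Integer.Properties as ℤP
  open import Data.List using (map; upTo)
  open import Data.Maybe using (just; nothing)
  open import Function using (_∘_)
  open import Relation.Binary.PropositionalEquality as P using (_≡_)
  open import Relation.Binary.Definitions using (WeaklyDecidable)
  open import Relation.Nullary using (does; yes; no)
  open import Algebra.Bundles using (CommutativeRing)
  open import Algebra.Solver.Ring.AlmostCommutativeRing as ACR using (_-Raw-AlmostCommutative⟶_)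
  import Algebra.Solver.Ring as RingSolver

  open L using () renaming (refl to ≈refl; sym to ≈sym; trans to ≈trans)
  module SR = CommutativeRing SeriesRing

  constS-* : ∀ p G N → (constS p *S G) N ≋ p *L G N
  constS-* p G zero = *S-at-0 (constS p) G
  constS-* p G (suc N) = ≈trans (*S-at-suc (constS p) G N)
    (≈trans (+L-cong ≈refl (*S-zeroˡ (constS p ⁺) G N (λ _ → ≈refl))) (L.+-identityʳ _))

  xS⁺-* : ∀ G N → ((xS ⁺) *S G) N ≋ G N
  xS⁺-* G zero = ≈trans (*S-at-0 (xS ⁺) G) (L.*-identityˡ (G 0))
  xS⁺-* G (suc N) = ≈trans (*S-at-suc (xS ⁺) G N)
    (≈trans (+L-cong (L.*-identityˡ (G (suc N))) (*S-zeroˡ ((xS ⁺) ⁺) G N (λ _ → ≈refl))) (L.+-identityʳ _))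

  xS-*-at-0 : ∀ G → (xS *S G) 0 ≋ 0L
  xS-*-at-0 G = ≈trans (*S-at-0 xS G) (L.zeroˡ (G 0))

  xS-*-at-suc : ∀ G N → (xS *S G) (suc N) ≋ G N
  xS-*-at-suc G N = ≈trans (*S-at-suc xS G N) (≈trans (+L-cong (L.zeroˡ (G (suc N))) (xS⁺-* G N)) (L.+-identityˡ _))

  invT-sumBelow : ∀ f n → invT (sumBelow f n) ≡ sumBelow (invT ∘ f) n
  invT-sumBelow f zero = P.refl
  invT-sumBelow f (suc n) = P.trans (invT-+ (f 0) (sumBelow (f ∘ suc) n)) (P.cong (invT (f 0) +L_) (invT-sumBelow (f ∘ suc) n))

  invS : Series → Series
  invS F N = invT (F N)

  invS-* : ∀ F G N → invS (F *S G) N ≋ (invS F *S invS G) N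
  invS-* F G N rewrite *S-sumBelow F G N | *S-sumBelow (invS F) (invS G) N | invT-sumBelow (λ k → F k *L G (N ∸ k)) (suc N) =
    sumBelow-cong {invT ∘ (λ k → F k *L G (N ∸ k))} {λ k → invS F k *L invS G (N ∸ k)} (suc N) (λ k _ → ⟪ invT-* (F k) (G (N ∸ k)) ⟫)

  invS-+ : ∀ F G N → invS (F +S G) N ≋ (invS F +S invS G) N
  invS-+ F G N = L.reflexive (invT-+ (F N) (G N))

  invS-constS : ∀ p N → invS (constS p) N ≋ constS (invT p) N
  invS-constS p zero = ≈refl
  invS-constS p (suc N) = ≈refl

  invS-xS : ∀ N → invS xS N ≋ xS N
  invS-xS zero = ≈refl
  invS-xS (suc zero) = ≈refl
  invS-xS (suc (suc N)) = ≈refl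

  t⁻¹L : Laurent
  t⁻¹L = mono (+ 1) (- (+ 1))

  tS*t⁻¹S≈1S : ∀ N → (constS tL *S constS t⁻¹L) N ≋ constS 1L N
  tS*t⁻¹S≈1S zero = *S-at-0 (constS tL) (constS t⁻¹L)
  tS*t⁻¹S≈1S (suc N) = ≈trans (constS-* tL (constS t⁻¹L) (suc N)) (L.zeroʳ tL)

  ι : ℤ → Series
  ι c = constS (mono c (+ 0))

  ι-+ : ∀ a b N → ι (a ℤ.+ b) N ≋ (ι a +S ι b) N
  ι-+ a b zero = ⟪ (λ e → P.trans (coeff-mono (a ℤ.+ b) (+ 0) e) (P.sym (P.trans (coeff-++ (mono a (+ 0)) (mono b (+ 0)) e)
                    (P.trans (P.cong₂ ℤ._+_ (coeff-mono a (+ 0) e) (coeff-mono b (+ 0) e)) (δ-+ (+ 0) e a b))))) ⟫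
  ι-+ a b (suc N) = ≈refl

  ι-* : ∀ a b N → ι (a ℤ.* b) N ≋ (ι a *S ι b) N
  ι-* a b zero = ≈sym (*S-at-0 (ι a) (ι b))
  ι-* a b (suc N) = ≈sym (≈trans (constS-* (mono a (+ 0)) (ι b) (suc N)) (L.zeroʳ (mono a (+ 0))))

  ι-0 : ∀ N → ι (+ 0) N ≋ constS 0L N
  ι-0 zero = ⟪ (λ e → P.trans (coeff-mono (+ 0) (+ 0) e) (δ-0 (does (+ 0 ℤ.≟ e)))) ⟫
    where
    δ-0 : ∀ b → (if b then + 0 else + 0) ≡ + 0
    δ-0 true = P.refl
    δ-0 false = P.refl
  ι-0 (suc N) = ≈refl

  ι-homomorphism : CommutativeRing.rawRing ℤP.+-*-commutativeRing -Raw-AlmostCommutative⟶ ACR.fromCommutativeRing SeriesRing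
  ι-homomorphism = record
    { ⟦_⟧ = ι
    ; +-homo = λ a b → ⟪ ι-+ a b ⟫S
    ; *-homo = λ a b → ⟪ ι-* a b ⟫S
    ; -‿homo = λ a → ⟪ (λ { zero → ≈refl ; (suc N) → ≈refl }) ⟫S
    ; 0-homo = ⟪ ι-0 ⟫S
    ; 1-homo = ⟪ (λ _ → ≈refl) ⟫S }

  ι-≟ : WeaklyDecidable (ACR.Induced-equivalence ι-homomorphism)
  ι-≟ a b with a ℤ.≟ b
  ... | yes P.refl = just SR.refl
  ... | no _ = nothing

  open RingSolver (CommutativeRing.rawRing ℤP.+-*-commutativeRing) (ACR.fromCommutativeRing SeriesRing) ι-homomorphism ι-≟

  constS-2t : ∀ N → constS (mono (+ 2) (+ 1)) N ≋ (ι (+ 2) *S constS tL) N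
  constS-2t zero = ≈sym (*S-at-0 (ι (+ 2)) (constS tL))
  constS-2t (suc N) = ≈sym (≈trans (constS-* (mono (+ 2) (+ 0)) (constS tL) (suc N)) (L.zeroʳ (mono (+ 2) (+ 0))))

  -- The quartic is a combination of U = 1 + t x V², V = 1 + t⁻¹ x U² and t t⁻¹ = 1 (certificate).
  module FromRecurrence
    (U : Series)
    (U-0 : U 0 ≈L 1L)
    (U-suc : ∀ n → U (suc n) ≈L tL *L sumL (map (λ k → invT (U k) *L invT (U (n ∸ k))) (upTo (suc n)))) where

    V T S X 1S : Series
    V = invS U
    T = constS tL
    S = constS t⁻¹L
    X = xS
    1S = constS 1L

    U-fixed-point : ∀ N → U N ≋ (1S +S T *S (X *S (V *S V))) N
    U-fixed-point zero = ≈trans ⟪ U-0 ⟫ (≈sym (≈trans (+L-cong ≈refl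
      (≈trans (constS-* tL (X *S (V *S V)) 0) (≈trans (L.*-cong {tL} {tL} ≈refl (xS-*-at-0 (V *S V))) (L.zeroʳ tL)))) (L.+-identityʳ 1L)))
    U-fixed-point (suc n) = ≈trans ⟪ U-suc n ⟫ (≈sym (≈trans (L.+-identityˡ ((T *S (X *S (V *S V))) (suc n)))
      (≈trans (constS-* tL (X *S (V *S V)) (suc n)) (L.*-cong {tL} {tL} ≈refl (xS-*-at-suc (V *S V) n)))))

    V-fixed-point : ∀ N → V N ≋ (1S +S S *S (X *S (U *S U))) N
    V-fixed-point N = ≈trans (invT-cong (U-fixed-point N)) (≈trans (invS-+ 1S (T *S (X *S (V *S V))) N)
      (+L-cong (invS-constS 1L N) (≈trans (invS-* T (X *S (V *S V)) N)
        (*S-cong (invS-constS tL) (λ M → ≈trans (invS-* X (V *S V) M)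
          (*S-cong invS-xS (λ K → ≈trans (invS-* V V K)
            (*S-cong (λ j → invT-involutive (U j)) (λ j → invT-involutive (U j)) K)) M)) N))))

    U-equation : U +S -S (1S +S T *S (X *S (V *S V))) ≋S constS 0L
    U-equation = SR.trans (SR.+-cong ⟪ U-fixed-point ⟫S SR.refl) (SR.-‿inverseʳ (1S +S T *S (X *S (V *S V))))

    V-equation : V +S -S (1S +S S *S (X *S (U *S U))) ≋S constS 0L
    V-equation = SR.trans (SR.+-cong ⟪ V-fixed-point ⟫S SR.refl) (SR.-‿inverseʳ (1S +S S *S (X *S (U *S U))))

    t-inverse-equation : T *S S +S -S 1S ≋S constS 0L
    t-inverse-equation = SR.trans (SR.+-cong ⟪ tS*t⁻¹S≈1S ⟫S SR.refl) (SR.-‿inverseʳ 1S)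

    cofactorV cofactorT : Series
    cofactorV = SR.-_ (T *S T *S X *S (V +S 1S)) +S SR.-_ (T *S X *S X *S U *S U)
    cofactorT = SR.-_ (T *S X *S X *S U *S U *S (V +S 1S)) +S SR.-_ (X *S X *S X *S U *S U *S U *S U)

    certificate : T *S (1S +S T *S X) +S (-S (T *S U)) +S ι (+ 2) *S T *S X *S X *S U *S U +S X *S X *S X *S U *S U *S U *S U
        ≋S (-S T) *S (U +S -S (1S +S T *S (X *S (V *S V))))
           +S (V +S -S (1S +S S *S (X *S (U *S U)))) *S cofactorV
           +S (T *S S +S -S 1S) *S cofactorT
    certificate = solve 5 (λ T S X U V →
        T :* (con (+ 1) :+ T :* X) :+ (:- (T :* U)) :+ con (+ 2) :* T :* X :* X :* U :* U :+ X :* X :* X :* U :* U :* U :* U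
        := (:- T) :* (U :+ :- (con (+ 1) :+ T :* (X :* (V :* V))))
           :+ (V :+ :- (con (+ 1) :+ S :* (X :* (U :* U)))) :* (:- (T :* T :* X :* (V :+ con (+ 1))) :+ :- (T :* X :* X :* U :* U))
           :+ (T :* S :+ :- con (+ 1)) :* (:- (T :* X :* X :* U :* U :* (V :+ con (+ 1))) :+ :- (X :* X :* X :* U :* U :* U :* U)))
        SR.refl T S X U V

    quartic : T *S (1S +S T *S X) +S (-S (T *S U)) +S constS (mono (+ 2) (+ 1)) *S X *S X *S U *S U +S X *S X *S X *S U *S U *S U *S U
              ≋S constS 0L
    quartic = begin
      T *S (1S +S T *S X) +S (-S (T *S U)) +S C2 *S X *S X *S U *S U +S Q
        ≈⟨ SR.+-cong {_} {_} {Q} {Q} (SR.+-cong {A} {A} {C2 *S X *S X *S U *S U} {ι (+ 2) *S T *S X *S X *S U *S U} SR.refl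
             (*S-congʳ U (*S-congʳ U (*S-congʳ X (*S-congʳ X ⟪ constS-2t ⟫S))))) SR.refl ⟩
      T *S (1S +S T *S X) +S (-S (T *S U)) +S ι (+ 2) *S T *S X *S X *S U *S U +S Q
        ≈⟨ certificate ⟩
      (-S T) *S (U +S -S (1S +S T *S (X *S (V *S V))))
        +S (V +S -S (1S +S S *S (X *S (U *S U)))) *S cofactorV +S (T *S S +S -S 1S) *S cofactorT
        ≈⟨ SR.+-cong (SR.+-cong (SR.*-cong { -S T} SR.refl U-equation) (SR.*-cong {_} {_} {cofactorV} V-equation SR.refl))
                     (SR.*-cong {_} {_} {cofactorT} t-inverse-equation SR.refl) ⟩
      (-S T) *S constS 0L +S constS 0L *S cofactorV +S constS 0L *S cofactorT
        ≈⟨ SR.+-cong (SR.+-cong (SR.zeroʳ (-S T)) (SR.zeroˡ cofactorV)) (SR.zeroˡ cofactorT) ⟩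
      constS 0L +S constS 0L +S constS 0L
        ≈⟨ SR.trans (SR.+-identityʳ (constS 0L +S constS 0L)) (SR.+-identityʳ (constS 0L)) ⟩
      constS 0L ∎
      where
      open import Relation.Binary.Reasoning.Setoid SR.setoid
      C2 = constS (mono (+ 2) (+ 1))
      A = T *S (1S +S T *S X) +S (-S (T *S U))
      Q = X *S X *S X *S U *S U *S U *S U
      *S-congʳ : ∀ {F F'} G → F ≋S F' → F *S G ≋S F' *S G
      *S-congʳ {F} {F'} G h = SR.*-cong {F} {F'} {G} {G} h SR.refl

    quartic-coefficients : T *S (1S +S T *S X) +S (-S (T *S U)) +S constS (mono (+ 2) (+ 1)) *S X *S X *S U *S U
                           +S X *S X *S X *S U *S U *S U *S U ≈S constS 0L
    quartic-coefficients N = ≋→ (≋S→ quartic N)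


module BoolReflection where

  open import Data.Bool using (Bool; true; false; _∧_; _∨_; not)
  open import Data.Bool.Properties using (T-≡)
  open import Data.Nat using (_≤_; _<_; _≤ᵇ_; _<ᵇ_; _≡ᵇ_)
  import Data.Nat.Properties as ℕP
  open import Data.Product using (_×_; _,_)
  open import Data.Sum using (_⊎_; inj₁; inj₂)
  open import Data.Empty using (⊥-elim)
  open import Function using (Equivalence)
  open import Relation.Binary.PropositionalEquality
  open import Relation.Nullary using (¬_)

  ∧-elim : ∀ {a b} → a ∧ b ≡ true → a ≡ true × b ≡ true
  ∧-elim {true} {true} _ = refl , refl

  ∧-intro : ∀ {a b} → a ≡ true → b ≡ true → a ∧ b ≡ true
  ∧-intro refl refl = refl

  ∨-elim : ∀ {a b} → a ∨ b ≡ true → a ≡ true ⊎ b ≡ true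
  ∨-elim {true} _ = inj₁ refl
  ∨-elim {false} p = inj₂ p

  ∨-introˡ : ∀ {a b} → a ≡ true → a ∨ b ≡ true
  ∨-introˡ refl = refl

  ∨-introʳ : ∀ {a b} → b ≡ true → a ∨ b ≡ true
  ∨-introʳ {true} refl = refl
  ∨-introʳ {false} refl = refl

  ≢true⇒false : ∀ {b} → ¬ b ≡ true → b ≡ false
  ≢true⇒false {true} n = ⊥-elim (n refl)
  ≢true⇒false {false} _ = refl

  false⇒≢true : ∀ {b} → b ≡ false → ¬ b ≡ true
  false⇒≢true refl ()

  not-true⇒false : ∀ {b} → not b ≡ true → b ≡ false
  not-true⇒false {false} _ = refl

  ≤ᵇ-intro : ∀ {m n} → m ≤ n → (m ≤ᵇ n) ≡ true
  ≤ᵇ-intro p = Equivalence.to T-≡ (ℕP.≤⇒≤ᵇ p)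

  ≤ᵇ-elim : ∀ {m n} → (m ≤ᵇ n) ≡ true → m ≤ n
  ≤ᵇ-elim {m} {n} p = ℕP.≤ᵇ⇒≤ m n (Equivalence.from T-≡ p)

  <ᵇ-intro : ∀ {m n} → m < n → (m <ᵇ n) ≡ true
  <ᵇ-intro p = Equivalence.to T-≡ (ℕP.<⇒<ᵇ p)

  <ᵇ-elim : ∀ {m n} → (m <ᵇ n) ≡ true → m < n
  <ᵇ-elim {m} {n} p = ℕP.<ᵇ⇒< m n (Equivalence.from T-≡ p)

  ≡ᵇ-intro : ∀ {m n} → m ≡ n → (m ≡ᵇ n) ≡ true
  ≡ᵇ-intro {m} {n} p = Equivalence.to T-≡ (ℕP.≡⇒≡ᵇ m n p)

  ≡ᵇ-elim : ∀ {m n} → (m ≡ᵇ n) ≡ true → m ≡ n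
  ≡ᵇ-elim {m} {n} p = ℕP.≡ᵇ⇒≡ m n (Equivalence.from T-≡ p)

  ≡ᵇ-false : ∀ {m n} → ¬ m ≡ n → (m ≡ᵇ n) ≡ false
  ≡ᵇ-false ne = ≢true⇒false (λ h → ne (≡ᵇ-elim h))

  bool-ext : ∀ {a b : Bool} → (a ≡ true → b ≡ true) → (b ≡ true → a ≡ true) → a ≡ b
  bool-ext {true} {true} f g = refl
  bool-ext {true} {false} f g = sym (f refl)
  bool-ext {false} {true} f g = g refl
  bool-ext {false} {false} f g = refl


module LaurentSums where

  open LaurentPolynomial
  open BoolReflection using (≢true⇒false)
  open import Data.Bool using (Bool; true; if_then_else_)
  open import Data.Nat using (ℕ; zero; suc; _<_)
  import Data.Nat.Properties as ℕP
  open import Data.Integer as ℤ using (ℤ; +_)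
  import Data.Integer.Properties as ℤP
  open import Data.List using ([]; _∷_; map; upTo; [_])
  open import Data.List.Properties using (upTo-∷ʳ)
  open import Function using (_∘_)
  open import Relation.Binary.PropositionalEquality hiding ([_])
  open import Relation.Nullary using (yes; no)
  open import Algebra.Bundles using (CommutativeRing)

  private module L = CommutativeRing LaurentRing

  coeff-sumL : ∀ {A : Set} (f : A → Laurent) xs e → coeff (sumL (map f xs)) e ≡ sumZ (λ x → coeff (f x) e) xs
  coeff-sumL f [] e = refl
  coeff-sumL f (x ∷ xs) e = trans (coeff-++ (f x) _ e) (cong (ℤ._+_ (coeff (f x) e)) (coeff-sumL f xs e))

  sumL-*ʳ : ∀ {A : Set} (f : A → Laurent) xs q → sumL (map f xs) *L q ≋ sumL (map (λ x → f x *L q) xs)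
  sumL-*ʳ f [] q = L.zeroˡ q
  sumL-*ʳ f (x ∷ xs) q = L.trans (L.distribʳ q (f x) _) (L.+-cong L.refl (sumL-*ʳ f xs q))

  sumL-*ˡ : ∀ {A : Set} p (f : A → Laurent) xs → p *L sumL (map f xs) ≋ sumL (map (λ x → p *L f x) xs)
  sumL-*ˡ p f [] = L.zeroʳ p
  sumL-*ˡ p f (x ∷ xs) = L.trans (L.distribˡ p (f x) _) (L.+-cong L.refl (sumL-*ˡ p f xs))

  invT-sumL : ∀ {A : Set} (f : A → Laurent) xs → invT (sumL (map f xs)) ≡ sumL (map (invT ∘ f) xs)
  invT-sumL f [] = refl
  invT-sumL f (x ∷ xs) = trans (invT-+ (f x) _) (cong (invT (f x) +L_) (invT-sumL f xs))

  sumL-cong : ∀ {A : Set} {f g : A → Laurent} xs → (∀ x → f x ≋ g x) → sumL (map f xs) ≋ sumL (map g xs)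
  sumL-cong [] h = L.refl
  sumL-cong (x ∷ xs) h = L.+-cong (h x) (sumL-cong xs h)

  expand-product : ∀ {A B : Set} (f : A → Laurent) (g : B → Laurent) xs ys e →
    coeff (tL *L (invT (sumL (map f xs)) *L invT (sumL (map g ys)))) e ≡
    sumZ (λ x → sumZ (λ y → coeff (tL *L (invT (f x) *L invT (g y))) e) ys) xs
  expand-product f g xs ys e rewrite invT-sumL f xs | invT-sumL g ys =
    trans (≋→ step e)
    (trans (coeff-sumL _ xs e) (sumZ-cong xs (λ x → coeff-sumL _ ys e)))
    where
    step : tL *L (sumL (map (invT ∘ f) xs) *L sumL (map (invT ∘ g) ys)) ≋ sumL (map (λ x → sumL (map (λ y → tL *L (invT (f x) *L invT (g y))) ys)) xs)
    step = L.trans (L.*-cong {tL} L.refl (L.trans (sumL-*ʳ (invT ∘ f) xs _) (sumL-cong xs (λ x → sumL-*ˡ (invT (f x)) (invT ∘ g) ys))))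
                   (L.trans (sumL-*ˡ tL _ xs) (sumL-cong xs (λ x → sumL-*ˡ tL (λ y → invT (f x) *L invT (g y)) ys)))

  sumZ-upTo-cong : ∀ n {f g : ℕ → ℤ} → (∀ j → j < n → f j ≡ g j) → sumZ f (upTo n) ≡ sumZ g (upTo n)
  sumZ-upTo-cong zero h = refl
  sumZ-upTo-cong (suc n) {f} {g} h = trans (cong (sumZ f) (sym (upTo-∷ʳ n))) (trans (sumZ-++ f (upTo n) [ n ])
    (trans (cong₂ ℤ._+_ (sumZ-upTo-cong n (λ j jn → h j (ℕP.m<n⇒m<1+n jn))) (cong (ℤ._+ ℤ.+ 0) (h n ℕP.≤-refl)))
    (trans (sym (sumZ-++ g (upTo n) [ n ])) (cong (sumZ g) (upTo-∷ʳ n)))))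

  sumL-upTo-cong : ∀ n {f g : ℕ → Laurent} → (∀ j → j < n → f j ≋ g j) → sumL (map f (upTo n)) ≋ sumL (map g (upTo n))
  sumL-upTo-cong n {f} {g} h = ⟪ (λ e → trans (coeff-sumL f (upTo n) e) (trans (sumZ-upTo-cong n (λ j jn → ≋→ (h j jn) e)) (sym (coeff-sumL g (upTo n) e)))) ⟫

  sumZ-select : ∀ (f : ℕ → Bool) (X : ℤ) n j0 → j0 < n → f j0 ≡ true → (∀ j → j < n → f j ≡ true → j ≡ j0) →
            sumZ (λ j → if f j then X else ℤ.+ 0) (upTo n) ≡ X
  sumZ-select f X (suc m) j0 j0n fj0 uniq with j0 ℕP.≟ m
  ... | yes refl = trans (cong (sumZ t) (sym (upTo-∷ʳ m))) (trans (sumZ-++ t (upTo m) [ m ])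
        (trans (cong₂ ℤ._+_ (trans (sumZ-upTo-cong m (λ j jm → cong (λ b → if b then X else ℤ.+ 0) (≢true⇒false (λ fj → ℕP.<-irrefl (uniq j (ℕP.m<n⇒m<1+n jm) fj) jm)))) (sumZ-0 (upTo m)))
                             (cong (λ b → (if b then X else ℤ.+ 0) ℤ.+ ℤ.+ 0) fj0))
        (trans (ℤP.+-identityˡ _) (ℤP.+-identityʳ X))))
    where t = λ j → if f j then X else ℤ.+ 0
  ... | no ne = trans (cong (sumZ t) (sym (upTo-∷ʳ m))) (trans (sumZ-++ t (upTo m) [ m ])
        (trans (cong₂ ℤ._+_ (sumZ-select f X m j0 (ℕP.≤∧≢⇒< (ℕP.≤-pred j0n) ne) fj0 (λ j jm fj → uniq j (ℕP.m<n⇒m<1+n jm) fj))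
                             (cong (λ b → (if b then X else ℤ.+ 0) ℤ.+ ℤ.+ 0) (≢true⇒false (λ fm → ne (sym (uniq m ℕP.≤-refl fm))))))
        (ℤP.+-identityʳ X)))
    where t = λ j → if f j then X else ℤ.+ 0


module BooleanListPredicates where

  open BoolReflection
  open import Data.Bool using (Bool; true; false; _∧_; _∨_; not)
  open import Data.Bool.Properties using (∧-comm; ∧-assoc; ∨-comm; ∨-assoc)
  open import Data.Nat using (ℕ; _+_; _≤_; z≤n; s≤s)
  import Data.Nat.Properties as ℕP
  open import Data.List using ([]; _∷_; _++_; map; length)
  import Data.List.Properties as ListP
  open import Data.List.Relation.Unary.All as All using (All; []; _∷_)
  open import Data.List.Relation.Unary.Any using (here; there)
  open import Data.List.Membership.Propositional using (_∈_)
  open import Data.List.Relation.Binary.Permutation.Propositional using (_↭_; prep; swap) renaming (refl to ↭refl; trans to ↭trans)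
  import Data.List.Relation.Binary.Permutation.Propositional.Properties as PermP
  open import Data.Product using (_×_; _,_; proj₁; proj₂; Σ)
  open import Data.Sum using (_⊎_; inj₁; inj₂)
  open import Data.Empty using (⊥-elim)
  open import Function using (_∘_)
  open import Relation.Binary.PropositionalEquality
  open import Relation.Nullary using (¬_)

  module _ {A : Set} where

    filterB-partition : ∀ (p : A → Bool) xs → filterB p xs ++ filterB (not ∘ p) xs ↭ xs
    filterB-partition p [] = ↭refl
    filterB-partition p (x ∷ xs) with p x
    ... | true = prep x (filterB-partition p xs)
    ... | false = ↭trans (PermP.shift x (filterB p xs) (filterB (not ∘ p) xs)) (prep x (filterB-partition p xs))

    filterB-filterB : ∀ (p q : A → Bool) → (∀ x → p x ≡ true → q x ≡ true) → ∀ xs → filterB p (filterB q xs) ≡ filterB p xs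
    filterB-filterB p q imp [] = refl
    filterB-filterB p q imp (x ∷ xs) with q x in eq
    ... | true with p x
    ...   | true = cong (x ∷_) (filterB-filterB p q imp xs)
    ...   | false = filterB-filterB p q imp xs
    filterB-filterB p q imp (x ∷ xs) | false with p x in eq2
    ...   | true = ⊥-elim (false⇒≢true eq (imp x eq2))
    ...   | false = filterB-filterB p q imp xs

    all⇒All : ∀ (p : A → Bool) xs → all p xs ≡ true → All (λ x → p x ≡ true) xs
    all⇒All p [] _ = []
    all⇒All p (x ∷ xs) h = let (h1 , h2) = ∧-elim h in h1 ∷ all⇒All p xs h2

    All⇒all : ∀ (p : A → Bool) xs → All (λ x → p x ≡ true) xs → all p xs ≡ true
    All⇒all p [] _ = refl
    All⇒all p (x ∷ xs) (h ∷ hs) = ∧-intro h (All⇒all p xs hs)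

    all-intro : ∀ {P : A → Set} (p : A → Bool) xs → All P xs → (∀ x → P x → p x ≡ true) → all p xs ≡ true
    all-intro p [] _ f = refl
    all-intro p (x ∷ xs) (px ∷ pxs) f = ∧-intro (f x px) (all-intro p xs pxs f)

    all-mono : ∀ {P : A → Set} (p q : A → Bool) xs → All P xs → (∀ x → P x → p x ≡ true → q x ≡ true) → all p xs ≡ true → all q xs ≡ true
    all-mono p q [] _ f _ = refl
    all-mono p q (x ∷ xs) (px ∷ pxs) f h = let (h1 , h2) = ∧-elim h in ∧-intro (f x px h1) (all-mono p q xs pxs f h2)

    all-↭ : ∀ (p : A → Bool) {xs ys} → xs ↭ ys → all p xs ≡ all p ys
    all-↭ p ↭refl = refl
    all-↭ p (prep x q) = cong (p x ∧_) (all-↭ p q)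
    all-↭ p {x ∷ y ∷ xs} {y ∷ x ∷ ys} (swap x y q) rewrite all-↭ p q =
      trans (sym (∧-assoc (p x) (p y) _)) (trans (cong (_∧ all p ys) (∧-comm (p x) (p y))) (∧-assoc (p y) (p x) _))
    all-↭ p (↭trans q q') = trans (all-↭ p q) (all-↭ p q')

    all-++⁻ : ∀ (p : A → Bool) xs ys → all p (xs ++ ys) ≡ true → all p xs ≡ true × all p ys ≡ true
    all-++⁻ p [] ys h = refl , h
    all-++⁻ p (x ∷ xs) ys h = let (h1 , h2) = ∧-elim h ; (h3 , h4) = all-++⁻ p xs ys h2 in ∧-intro h1 h3 , h4

    all-++⁺ : ∀ (p : A → Bool) xs ys → all p xs ≡ true → all p ys ≡ true → all p (xs ++ ys) ≡ true
    all-++⁺ p [] ys _ h = h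
    all-++⁺ p (x ∷ xs) ys h k = let (h1 , h2) = ∧-elim h in ∧-intro h1 (all-++⁺ p xs ys h2 k)

    pairwiseB-++⁻ : ∀ (R : A → A → Bool) xs ys → pairwiseB R (xs ++ ys) ≡ true →
              pairwiseB R xs ≡ true × pairwiseB R ys ≡ true × all (λ x → all (R x) ys) xs ≡ true
    pairwiseB-++⁻ R [] ys h = refl , h , refl
    pairwiseB-++⁻ R (x ∷ xs) ys h = let (h1 , h2) = ∧-elim h ; (a1 , a2) = all-++⁻ (R x) xs ys h1 ; (p1 , p2 , p3) = pairwiseB-++⁻ R xs ys h2
      in ∧-intro a1 p1 , p2 , ∧-intro a2 p3

    pairwiseB-++⁺ : ∀ (R : A → A → Bool) xs ys → pairwiseB R xs ≡ true → pairwiseB R ys ≡ true → all (λ x → all (R x) ys) xs ≡ true →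
              pairwiseB R (xs ++ ys) ≡ true
    pairwiseB-++⁺ R [] ys _ h _ = h
    pairwiseB-++⁺ R (x ∷ xs) ys h1 h2 h3 = let (a1 , a2) = ∧-elim h1 ; (c1 , c2) = ∧-elim h3 in ∧-intro (all-++⁺ (R x) xs ys a1 c1) (pairwiseB-++⁺ R xs ys a2 h2 c2)

    pairwiseB-map : ∀ {B : Set} (R : B → B → Bool) (f : A → B) xs → pairwiseB R (map f xs) ≡ pairwiseB (λ x y → R (f x) (f y)) xs
    pairwiseB-map R f [] = refl
    pairwiseB-map R f (x ∷ xs) = cong₂ _∧_ (all-map xs) (pairwiseB-map R f xs)
      where
      all-map : ∀ ys → all (R (f x)) (map f ys) ≡ all (λ y → R (f x) (f y)) ys
      all-map [] = refl
      all-map (y ∷ ys) = cong (R (f x) (f y) ∧_) (all-map ys)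

    pairwiseB-mono : ∀ {P : A → Set} (R S : A → A → Bool) xs → All P xs → (∀ x y → P x → P y → R x y ≡ true → S x y ≡ true) →
             pairwiseB R xs ≡ true → pairwiseB S xs ≡ true
    pairwiseB-mono R S [] _ f _ = refl
    pairwiseB-mono R S (x ∷ xs) (px ∷ pxs) f h = let (h1 , h2) = ∧-elim h in
      ∧-intro (all-imp2 xs pxs h1) (pairwiseB-mono R S xs pxs f h2)
      where
      all-imp2 : ∀ ys → All _ ys → all (R x) ys ≡ true → all (S x) ys ≡ true
      all-imp2 [] _ _ = refl
      all-imp2 (y ∷ ys) (py ∷ pys) k = let (k1 , k2) = ∧-elim k in ∧-intro (f x y px py k1) (all-imp2 ys pys k2)

    pairwiseB-filterB : ∀ (R : A → A → Bool) (p : A → Bool) xs → pairwiseB R xs ≡ true → pairwiseB R (filterB p xs) ≡ true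
    pairwiseB-filterB R p [] h = refl
    pairwiseB-filterB R p (x ∷ xs) h with p x | ∧-elim h
    ... | true | h1 , h2 = ∧-intro (all-sub (R x) xs h1) (pairwiseB-filterB R p xs h2)
      where
      all-sub : ∀ q ys → all q ys ≡ true → all q (filterB p ys) ≡ true
      all-sub q [] _ = refl
      all-sub q (y ∷ ys) k with p y | ∧-elim k
      ... | true | k1 , k2 = ∧-intro k1 (all-sub q ys k2)
      ... | false | k1 , k2 = all-sub q ys k2
    ... | false | h1 , h2 = pairwiseB-filterB R p xs h2

    pairwiseB-↭ : ∀ (P : A → Set) (R : A → A → Bool) → (∀ x y → P x → P y → R x y ≡ R y x) →
           ∀ {xs ys} → All P xs → xs ↭ ys → pairwiseB R xs ≡ pairwiseB R ys
    pairwiseB-↭ P R s _ ↭refl = refl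
    pairwiseB-↭ P R s (px ∷ pxs) (prep x q) = cong₂ _∧_ (all-↭ (R x) q) (pairwiseB-↭ P R s pxs q)
    pairwiseB-↭ P R s {x ∷ y ∷ xs} {y ∷ x ∷ ys} (px ∷ py ∷ pxs) (swap x y q)
      rewrite all-↭ (R x) q | all-↭ (R y) q | pairwiseB-↭ P R s pxs q | s x y px py = ∧-medial (R y x) (all (R x) ys) (all (R y) ys) (pairwiseB R ys)
      where
      ∧-medial : ∀ a b c d → (a ∧ b) ∧ (c ∧ d) ≡ (a ∧ c) ∧ (b ∧ d)
      ∧-medial true true c d = refl
      ∧-medial true false true d = refl
      ∧-medial true false false d = refl
      ∧-medial false b c d = refl
    pairwiseB-↭ P R s pxs (↭trans q q') = trans (pairwiseB-↭ P R s pxs q) (pairwiseB-↭ P R s (PermP.All-resp-↭ q pxs) q')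

    All-filterB : ∀ {P : A → Set} (p : A → Bool) xs → All P xs → All P (filterB p xs)
    All-filterB p [] _ = []
    All-filterB p (x ∷ xs) (px ∷ pxs) with p x
    ... | true = px ∷ All-filterB p xs pxs
    ... | false = All-filterB p xs pxs

    filterB-sound : ∀ (p : A → Bool) xs → All (λ x → p x ≡ true) (filterB p xs)
    filterB-sound p [] = []
    filterB-sound p (x ∷ xs) with p x in e
    ... | true = e ∷ filterB-sound p xs
    ... | false = filterB-sound p xs

    length-filterB-partition : ∀ (p : A → Bool) xs → length (filterB p xs) + length (filterB (not ∘ p) xs) ≡ length xs
    length-filterB-partition p xs = trans (sym (ListP.length-++ (filterB p xs))) (PermP.↭-length (filterB-partition p xs))

  ind : Bool → ℕ
  ind true = 1
  ind false = 0

  countB-∷ : ∀ {A : Set} (p : A → Bool) x xs → countB p (x ∷ xs) ≡ ind (p x) + countB p xs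
  countB-∷ p x xs with p x
  ... | true = refl
  ... | false = refl

  all-cong : ∀ {A : Set} {p q : A → Bool} xs → (∀ x → p x ≡ q x) → all p xs ≡ all q xs
  all-cong [] h = refl
  all-cong (x ∷ xs) h = cong₂ _∧_ (h x) (all-cong xs h)

  pairwiseB-cong : ∀ {A : Set} {R S : A → A → Bool} xs → (∀ x y → R x y ≡ S x y) → pairwiseB R xs ≡ pairwiseB S xs
  pairwiseB-cong [] h = refl
  pairwiseB-cong (x ∷ xs) h = cong₂ _∧_ (all-cong xs (h x)) (pairwiseB-cong xs h)

  filterB-all : ∀ {A : Set} (p : A → Bool) xs → All (λ x → p x ≡ true) xs → filterB p xs ≡ xs
  filterB-all p [] _ = refl
  filterB-all p (x ∷ xs) (h ∷ hs) rewrite h = cong (x ∷_) (filterB-all p xs hs)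

  All-filterB⁺ : ∀ {A : Set} {P : A → Set} (p : A → Bool) xs → All P xs → All (λ x → P x × p x ≡ true) (filterB p xs)
  All-filterB⁺ p [] _ = []
  All-filterB⁺ p (x ∷ xs) (px ∷ pxs) with p x in e
  ... | true = (px , e) ∷ All-filterB⁺ p xs pxs
  ... | false = All-filterB⁺ p xs pxs

  any-↭ : ∀ {A : Set} (p : A → Bool) {xs ys} → xs ↭ ys → any p xs ≡ any p ys
  any-↭ p ↭refl = refl
  any-↭ p (prep x q) = cong (p x ∨_) (any-↭ p q)
  any-↭ p {x ∷ y ∷ xs} {y ∷ x ∷ ys} (swap x y q) rewrite any-↭ p q =
    trans (sym (∨-assoc (p x) (p y) _)) (trans (cong (_∨ any p ys) (∨-comm (p x) (p y))) (∨-assoc (p y) (p x) _))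
  any-↭ p (↭trans q q') = trans (any-↭ p q) (any-↭ p q')

  any-++ : ∀ {A : Set} (p : A → Bool) xs ys → any p (xs ++ ys) ≡ (any p xs ∨ any p ys)
  any-++ p [] ys = refl
  any-++ p (x ∷ xs) ys = trans (cong (p x ∨_) (any-++ p xs ys)) (sym (∨-assoc (p x) _ _))

  any-false : ∀ {A : Set} {P : A → Set} (p : A → Bool) xs → All P xs → (∀ x → P x → p x ≡ false) → any p xs ≡ false
  any-false p [] _ _ = refl
  any-false p (x ∷ xs) (px ∷ pxs) f rewrite f x px = any-false p xs pxs f

  any-elim : ∀ {A : Set} (p : A → Bool) xs → any p xs ≡ true → Σ A λ x → x ∈ xs × p x ≡ true
  any-elim p (x ∷ xs) h with p x in e
  ... | true = x , here refl , e
  ... | false with any-elim p xs h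
  ...   | y , m , q = y , there m , q

  any-intro : ∀ {A : Set} (p : A → Bool) xs {x} → x ∈ xs → p x ≡ true → any p xs ≡ true
  any-intro p (u ∷ us) (here refl) h = ∨-introˡ h
  any-intro p (u ∷ us) (there m) h = ∨-introʳ {p u} (any-intro p us m h)

  pairwiseB-pair : ∀ {A : Set} (R : A → A → Bool) xs {x y} → pairwiseB R xs ≡ true → x ∈ xs → y ∈ xs → ¬ x ≡ y → R x y ≡ true ⊎ R y x ≡ true
  pairwiseB-pair R (u ∷ us) h (here refl) (here refl) ne = ⊥-elim (ne refl)
  pairwiseB-pair R (u ∷ us) h (here refl) (there my) ne = inj₁ (All.lookup (all⇒All (R u) us (proj₁ (∧-elim h))) my)
  pairwiseB-pair R (u ∷ us) h (there mx) (here refl) ne = inj₂ (All.lookup (all⇒All (R u) us (proj₁ (∧-elim h))) mx)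
  pairwiseB-pair R (u ∷ us) h (there mx) (there my) ne = pairwiseB-pair R us (proj₂ (∧-elim {all (R u) us} h)) mx my ne

  one≤indicators : ∀ a b c d → (a ∨ (b ∨ (c ∨ d))) ≡ true → 1 ≤ ind a + (ind b + (ind c + ind d))
  one≤indicators true b c d _ = s≤s z≤n
  one≤indicators false true c d _ = s≤s z≤n
  one≤indicators false false true d _ = s≤s z≤n
  one≤indicators false false false true _ = s≤s z≤n

  length≤count-cover : ∀ {A : Set} (q1 q2 q3 q4 : A → Bool) xs → All (λ x → (q1 x ∨ (q2 x ∨ (q3 x ∨ q4 x))) ≡ true) xs →
    length xs ≤ countB q1 xs + (countB q2 xs + (countB q3 xs + countB q4 xs))
  length≤count-cover q1 q2 q3 q4 [] _ = z≤n
  length≤count-cover q1 q2 q3 q4 (x ∷ xs) (h ∷ hs)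
    rewrite countB-∷ q1 x xs | countB-∷ q2 x xs | countB-∷ q3 x xs | countB-∷ q4 x xs =
    ℕP.≤-trans (ℕP.+-mono-≤ (one≤indicators (q1 x) (q2 x) (q3 x) (q4 x) h) (length≤count-cover q1 q2 q3 q4 xs hs))
      (ℕP.≤-reflexive (+-medial₄ (ind (q1 x)) (ind (q2 x)) (ind (q3 x)) (ind (q4 x)) (countB q1 xs) (countB q2 xs) (countB q3 xs) (countB q4 xs)))
    where
    open import Data.Nat.Solver using (module +-*-Solver)
    open +-*-Solver
    +-medial₄ : ∀ a b c d e f g h → (a + (b + (c + d))) + (e + (f + (g + h))) ≡ (a + e) + ((b + f) + ((c + g) + (d + h)))
    +-medial₄ = solve 8 (λ a b c d e f g h → (a :+ (b :+ (c :+ d))) :+ (e :+ (f :+ (g :+ h))) := (a :+ e) :+ ((b :+ f) :+ ((c :+ g) :+ (d :+ h)))) refl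


module Multiplicity {A : Set} (_≟_ : DecidableEquality A) where

  open BoolReflection using (false⇒≢true)
  open import Data.Bool using (Bool; true; false; if_then_else_)
  open import Data.Nat using (ℕ; suc; _+_)
  import Data.Nat.Properties as ℕP
  open import Data.List using (List; []; _∷_; _++_)
  open import Data.List.Relation.Binary.Permutation.Propositional using (_↭_; prep; ↭-sym) renaming (refl to ↭refl; trans to ↭trans)
  import Data.List.Relation.Binary.Permutation.Propositional.Properties as PermP
  open import Data.Product using (_,_; ∃₂)
  open import Data.Empty using (⊥-elim)
  open import Relation.Binary.PropositionalEquality
  open import Relation.Nullary using (¬_; does; yes; no)

  count : A → List A → ℕ
  count x [] = 0
  count x (y ∷ ys) = (if does (x ≟ y) then 1 else 0) + count x ys

  count-++ : ∀ x xs ys → count x (xs ++ ys) ≡ count x xs + count x ys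
  count-++ x [] ys = refl
  count-++ x (y ∷ xs) ys = trans (cong ((if does (x ≟ y) then 1 else 0) +_) (count-++ x xs ys)) (sym (ℕP.+-assoc (if does (x ≟ y) then 1 else 0) (count x xs) (count x ys)))

  split : ∀ x ys → ¬ count x ys ≡ 0 → ∃₂ λ ys1 ys2 → ys ≡ ys1 ++ x ∷ ys2
  split x [] ne = ⊥-elim (ne refl)
  split x (y ∷ ys) ne with x ≟ y
  ... | yes refl = [] , ys , refl
  ... | no _ with split x ys ne
  ...   | ys1 , ys2 , eq = y ∷ ys1 , ys2 , cong (y ∷_) eq

  count-self : ∀ x xs → count x (x ∷ xs) ≡ suc (count x xs)
  count-self x xs with x ≟ x
  ... | yes _ = refl
  ... | no n = ⊥-elim (n refl)

  count⇒↭ : ∀ xs ys → (∀ x → count x xs ≡ count x ys) → xs ↭ ys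
  count⇒↭ [] [] h = ↭refl
  count⇒↭ [] (y ∷ ys) h = ⊥-elim (ℕP.0≢1+n (trans (h y) (count-self y ys)))
  count⇒↭ (x ∷ xs) ys h with split x ys (λ e → ℕP.0≢1+n (trans (sym e) (trans (sym (h x)) (count-self x xs))))
  ... | ys1 , ys2 , refl = ↭trans (prep x (count⇒↭ xs (ys1 ++ ys2) h'))
                                  (↭-sym (PermP.shift x ys1 ys2))
    where
    h' : ∀ y → count y xs ≡ count y (ys1 ++ ys2)
    h' y = ℕP.+-cancelˡ-≡ (if does (y ≟ x) then 1 else 0) _ _
      (trans (h y) (trans (count-++ y ys1 (x ∷ ys2))
        (trans (ℕP.+-comm (count y ys1) _) (trans (ℕP.+-assoc (if does (y ≟ x) then 1 else 0) (count y ys2) (count y ys1))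
        (cong ((if does (y ≟ x) then 1 else 0) +_) (trans (ℕP.+-comm (count y ys2) (count y ys1)) (sym (count-++ y ys1 ys2))))))))

  count-filter-true : ∀ (p : A → Bool) x xs → p x ≡ true → count x (filterB p xs) ≡ count x xs
  count-filter-true p x [] px = refl
  count-filter-true p x (y ∷ ys) px with p y in py
  ... | true = cong (_ +_) (count-filter-true p x ys px)
  ... | false with x ≟ y
  ...   | yes refl = ⊥-elim (false⇒≢true py px)
  ...   | no _ = count-filter-true p x ys px

  count-filter-false : ∀ (p : A → Bool) x xs → p x ≡ false → count x (filterB p xs) ≡ 0
  count-filter-false p x [] px = refl
  count-filter-false p x (y ∷ ys) px with p y in py
  ... | false = count-filter-false p x ys px
  ... | true with x ≟ y
  ...   | yes refl = ⊥-elim (false⇒≢true px py)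
  ...   | no _ = count-filter-false p x ys px


module TriangleGeometry where

  open BoolReflection
  open BooleanListPredicates
  open import Data.Bool using (Bool; true; false; _∧_)
  open import Data.Bool.Properties using (∨-comm)
  open import Data.Nat using (ℕ; zero; suc; _≤_; _<_; _≤ᵇ_; _<ᵇ_; _≡ᵇ_; _+_)
  import Data.Nat.Properties as ℕP
  open import Data.Product using (_×_; _,_; proj₁; proj₂)
  open import Data.Sum using (_⊎_; inj₁; inj₂; [_,_]′)
  open import Data.Empty using (⊥-elim)
  open import Data.Nat.Solver using (module +-*-Solver)
  open import Data.List using ([]; _∷_)
  open import Relation.Binary.PropositionalEquality
  open import Relation.Nullary using (¬_; yes; no)
  open ℕP using (≤-trans; <-trans; <⇒≤; ≤-<-trans; <-≤-trans; <⇒≱; <⇒≢; >⇒≢)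

  Ordered : Tri → Set
  Ordered (a , b , c) = a < b × b < c

  OnOuterArc : ℕ → ℕ → ℕ → Set
  OnOuterArc a c v = v ≤ a ⊎ c ≤ v

  Separated : Tri → Tri → Set
  Separated (a , b , c) (x , y , z) = (a ≤ x × z ≤ b) ⊎ (b ≤ x × z ≤ c) ⊎ (OnOuterArc a c x × OnOuterArc a c y × OnOuterArc a c z)

  inArc-elim : ∀ l r v → inArc l r v ≡ true → l ≤ v × v ≤ r
  inArc-elim l r v p = let (p1 , p2) = ∧-elim p in ≤ᵇ-elim p1 , ≤ᵇ-elim p2

  inArc-intro : ∀ {l r v} → l ≤ v → v ≤ r → inArc l r v ≡ true
  inArc-intro p q = ∧-intro (≤ᵇ-intro p) (≤ᵇ-intro q)

  outArc-elim : ∀ a c v → outArc a c v ≡ true → OnOuterArc a c v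
  outArc-elim a c v p with ∨-elim p
  ... | inj₁ q = inj₁ (≤ᵇ-elim q)
  ... | inj₂ q = inj₂ (≤ᵇ-elim q)

  outArc-intro : ∀ {a c v} → OnOuterArc a c v → outArc a c v ≡ true
  outArc-intro (inj₁ q) = ∨-introˡ (≤ᵇ-intro q)
  outArc-intro (inj₂ q) = ∨-introʳ (≤ᵇ-intro q)

  all-verts-elim : ∀ (p : ℕ → Bool) x y z → all p (verts (x , y , z)) ≡ true → p x ≡ true × p y ≡ true × p z ≡ true
  all-verts-elim p x y z h = let (h1 , h2) = ∧-elim h ; (h3 , h4) = ∧-elim h2 ; (h5 , _) = ∧-elim h4 in h1 , h3 , h5

  all-verts-intro : ∀ (p : ℕ → Bool) x y z → p x ≡ true → p y ≡ true → p z ≡ true → all p (verts (x , y , z)) ≡ true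
  all-verts-intro p x y z h1 h2 h3 = ∧-intro h1 (∧-intro h2 (∧-intro h3 refl))

  separatedBy-elim : ∀ T T' → separatedBy T T' ≡ true → Separated T T'
  separatedBy-elim (a , b , c) (x , y , z) h with ∨-elim h
  ... | inj₁ q = let (q1 , q2 , q3) = all-verts-elim (inArc a b) x y z q in inj₁ (proj₁ (inArc-elim a b x q1) , proj₂ (inArc-elim a b z q3))
  ... | inj₂ q with ∨-elim q
  ...   | inj₁ s = let (q1 , q2 , q3) = all-verts-elim (inArc b c) x y z s in inj₂ (inj₁ (proj₁ (inArc-elim b c x q1) , proj₂ (inArc-elim b c z q3)))
  ...   | inj₂ s = let (q1 , q2 , q3) = all-verts-elim (outArc a c) x y z s in inj₂ (inj₂ (outArc-elim a c x q1 , outArc-elim a c y q2 , outArc-elim a c z q3))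

  separatedBy-intro : ∀ T T' → Ordered T' → Separated T T' → separatedBy T T' ≡ true
  separatedBy-intro (a , b , c) (x , y , z) (xy , yz) (inj₁ (p , q)) =
    ∨-introˡ (all-verts-intro (inArc a b) x y z (inArc-intro p (ℕP.≤-trans (ℕP.<⇒≤ (ℕP.<-trans xy yz)) q)) (inArc-intro (ℕP.≤-trans p (ℕP.<⇒≤ xy)) (ℕP.≤-trans (ℕP.<⇒≤ yz) q)) (inArc-intro (ℕP.≤-trans p (ℕP.<⇒≤ (ℕP.<-trans xy yz))) q))
  separatedBy-intro (a , b , c) (x , y , z) (xy , yz) (inj₂ (inj₁ (p , q))) = ∨-introʳ {all (inArc a b) (verts (x , y , z))} (∨-introˡ
    (all-verts-intro (inArc b c) x y z (inArc-intro p (ℕP.≤-trans (ℕP.<⇒≤ (ℕP.<-trans xy yz)) q)) (inArc-intro (ℕP.≤-trans p (ℕP.<⇒≤ xy)) (ℕP.≤-trans (ℕP.<⇒≤ yz) q)) (inArc-intro (ℕP.≤-trans p (ℕP.<⇒≤ (ℕP.<-trans xy yz))) q)))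
  separatedBy-intro (a , b , c) (x , y , z) _ (inj₂ (inj₂ (p , q , r))) = ∨-introʳ {all (inArc a b) (verts (x , y , z))} (∨-introʳ {all (inArc b c) (verts (x , y , z))}
    (all-verts-intro (outArc a c) x y z (outArc-intro p) (outArc-intro q) (outArc-intro r)))


  nonOverlapping-elim : ∀ T T' → nonOverlapping T T' ≡ true → Separated T T' ⊎ Separated T' T
  nonOverlapping-elim T T' h with ∨-elim h
  ... | inj₁ q = inj₁ (separatedBy-elim T T' q)
  ... | inj₂ q = inj₂ (separatedBy-elim T' T q)

  nonOverlapping-introˡ : ∀ T T' → Ordered T' → Separated T T' → nonOverlapping T T' ≡ true
  nonOverlapping-introˡ T T' t s = ∨-introˡ (separatedBy-intro T T' t s)

  nonOverlapping-introʳ : ∀ T T' → Ordered T → Separated T' T → nonOverlapping T T' ≡ true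
  nonOverlapping-introʳ T T' t s = ∨-introʳ {separatedBy T T'} (separatedBy-intro T' T t s)

  overlapping-intro : ∀ T T' → ¬ Separated T T' → ¬ Separated T' T → nonOverlapping T T' ≡ false
  overlapping-intro T T' n1 n2 = ≢true⇒false (λ h → [ n1 , n2 ]′ (nonOverlapping-elim T T' h))

  nonOverlapping-sym : ∀ T T' → nonOverlapping T T' ≡ nonOverlapping T' T
  nonOverlapping-sym T T' = ∨-comm (separatedBy T T') _

  Separated-flip : ∀ T T' → Ordered T → Ordered T' → Separated T' T → Separated T T'
  Separated-flip (a , b , c) (x , y , z) (ab , bc) (xy , yz) (inj₁ (p , q)) =
    inj₂ (inj₂ (inj₁ p , inj₂ q , inj₂ (≤-trans q (<⇒≤ yz))))
  Separated-flip (a , b , c) (x , y , z) (ab , bc) (xy , yz) (inj₂ (inj₁ (p , q))) =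
    inj₂ (inj₂ (inj₁ (≤-trans (<⇒≤ xy) p) , inj₁ p , inj₂ q))
  Separated-flip (a , b , c) (x , y , z) (ab , bc) (xy , yz) (inj₂ (inj₂ (oa , ob , oc))) with oa | oc
  ... | inj₂ za | _ = inj₂ (inj₂ (inj₁ (≤-trans (<⇒≤ (<-trans xy yz)) za) , inj₁ (≤-trans (<⇒≤ yz) za) , inj₁ za))
  ... | inj₁ ax | inj₁ cx = inj₂ (inj₂ (inj₂ cx , inj₂ (≤-trans cx (<⇒≤ xy)) , inj₂ (≤-trans cx (<⇒≤ (<-trans xy yz)))))
  ... | inj₁ ax | inj₂ zc with ob
  ...   | inj₁ bx = inj₂ (inj₁ (bx , zc))
  ...   | inj₂ zb = inj₁ (ax , zb)

  nonOverlapping⇒Separated : ∀ T T' → Ordered T → Ordered T' → nonOverlapping T T' ≡ true → Separated T T'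
  nonOverlapping⇒Separated T T' t t' h with nonOverlapping-elim T T' h
  ... | inj₁ s = s
  ... | inj₂ s = Separated-flip T T' t t' s

  ¬Separated-common-apex : ∀ a b c x z → a < b → b < c → x < b → b < z → ¬ Separated (a , b , c) (x , b , z)
  ¬Separated-common-apex a b c x z ab bc xb bz (inj₁ (_ , zb)) = <⇒≱ bz zb
  ¬Separated-common-apex a b c x z ab bc xb bz (inj₂ (inj₁ (bx , _))) = <⇒≱ xb bx
  ¬Separated-common-apex a b c x z ab bc xb bz (inj₂ (inj₂ (_ , inj₁ ba , _))) = <⇒≱ ab ba
  ¬Separated-common-apex a b c x z ab bc xb bz (inj₂ (inj₂ (_ , inj₂ cb , _))) = <⇒≱ bc cb

  common-apex-overlap : ∀ a b c x z → a < b → b < c → x < b → b < z → nonOverlapping (a , b , c) (x , b , z) ≡ false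
  common-apex-overlap a b c x z ab bc xb bz = overlapping-intro (a , b , c) (x , b , z) (¬Separated-common-apex a b c x z ab bc xb bz) (¬Separated-common-apex x b z a c xb bz ab bc)

  Inside : ℕ → ℕ → Tri → Set
  Inside l r (a , b , c) = l ≤ a × a < b × b < c × c ≤ r

  insideᵇ : ℕ → ℕ → Tri → Bool
  insideᵇ l r (a , b , c) = (l ≤ᵇ a) ∧ ((a <ᵇ b) ∧ ((b <ᵇ c) ∧ (c ≤ᵇ r)))

  insideᵇ-elim : ∀ l r T → insideᵇ l r T ≡ true → Inside l r T
  insideᵇ-elim l r (a , b , c) h = let (h1 , h2) = ∧-elim h ; (h3 , h4) = ∧-elim h2 ; (h5 , h6) = ∧-elim h4 in ≤ᵇ-elim h1 , <ᵇ-elim h3 , <ᵇ-elim h5 , ≤ᵇ-elim h6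

  insideᵇ-intro : ∀ l r T → Inside l r T → insideᵇ l r T ≡ true
  insideᵇ-intro l r (a , b , c) (p1 , p2 , p3 , p4) = ∧-intro (≤ᵇ-intro p1) (∧-intro (<ᵇ-intro p2) (∧-intro (<ᵇ-intro p3) (≤ᵇ-intro p4)))

  Inside⇒Ordered : ∀ {l r T} → Inside l r T → Ordered T
  Inside⇒Ordered {T = a , b , c} (_ , p , q , _) = p , q

  Inside-widenʳ : ∀ {l k r T} → k ≤ r → Inside l k T → Inside l r T
  Inside-widenʳ {T = a , b , c} kr (la , ab , bc , ck) = la , ab , bc , ℕP.≤-trans ck kr

  Inside-widenˡ : ∀ {l k r T} → l ≤ k → Inside k r T → Inside l r T
  Inside-widenˡ {T = a , b , c} lk (ka , ab , bc , cr) = ℕP.≤-trans lk ka , ab , bc , cr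

  isRoot : ℕ → ℕ → Tri → Bool
  isRoot l r (a , b , c) = (a ≡ᵇ l) ∧ (c ≡ᵇ r)

  roots-overlap : ∀ l k k' r → l < k → k < r → l < k' → k' < r → nonOverlapping (l , k , r) (l , k' , r) ≡ false
  roots-overlap l k k' r lk kr lk' k'r = overlapping-intro _ _ (¬separated k k' lk kr lk' k'r) (¬separated k' k lk' k'r lk kr)
    where
    ¬separated : ∀ k k' → l < k → k < r → l < k' → k' < r → ¬ Separated (l , k , r) (l , k' , r)
    ¬separated k k' lk kr lk' k'r (inj₁ (_ , rk)) = <⇒≱ kr rk
    ¬separated k k' lk kr lk' k'r (inj₂ (inj₁ (kl , _))) = <⇒≱ lk kl
    ¬separated k k' lk kr lk' k'r (inj₂ (inj₂ (_ , inj₁ k'l , _))) = <⇒≱ lk' k'l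
    ¬separated k k' lk kr lk' k'r (inj₂ (inj₂ (_ , inj₂ rk' , _))) = <⇒≱ k'r rk'

  ≡ᵇ-sym : ∀ m n → (m ≡ᵇ n) ≡ (n ≡ᵇ m)
  ≡ᵇ-sym zero zero = refl
  ≡ᵇ-sym zero (suc n) = refl
  ≡ᵇ-sym (suc m) zero = refl
  ≡ᵇ-sym (suc m) (suc n) = ≡ᵇ-sym m n

  module AroundRoot (l k r : ℕ) (lk : l < k) (kr : k < r) where
    root : Tri
    root = (l , k , r)

    left-right-nonOverlapping : ∀ T T' → Inside l k T → Inside k r T' → nonOverlapping T T' ≡ true
    left-right-nonOverlapping (a , b , c) (x , y , z) (la , ab , bc , ck) (kx , xy , yz , zr) =
      nonOverlapping-introˡ (a , b , c) (x , y , z) (xy , yz)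
        (inj₂ (inj₂ (inj₂ (≤-trans ck kx) , inj₂ (≤-trans ck (≤-trans kx (<⇒≤ xy))) , inj₂ (≤-trans ck (≤-trans kx (<⇒≤ (<-trans xy yz)))))))

    left-root-nonOverlapping : ∀ T → Inside l k T → nonOverlapping T root ≡ true
    left-root-nonOverlapping (a , b , c) (la , ab , bc , ck) = nonOverlapping-introʳ (a , b , c) root (ab , bc) (inj₁ (la , ck))

    right-root-nonOverlapping : ∀ T → Inside k r T → nonOverlapping T root ≡ true
    right-root-nonOverlapping (a , b , c) (ka , ab , bc , cr) = nonOverlapping-introʳ (a , b , c) root (ab , bc) (inj₂ (inj₁ (ka , cr)))

    left-not-root : ∀ T → Inside l k T → isRoot l r T ≡ false
    left-not-root (a , b , c) (la , ab , bc , ck) = ≢true⇒false (λ h → <⇒≢ (≤-<-trans ck kr) (≡ᵇ-elim (proj₂ (∧-elim h))))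

    right-not-root : ∀ T → Inside k r T → isRoot l r T ≡ false
    right-not-root (a , b , c) (ka , ab , bc , cr) = ≢true⇒false (λ h → >⇒≢ (<-≤-trans lk ka) (≡ᵇ-elim (proj₁ (∧-elim h))))

    root-isRoot : isRoot l r root ≡ true
    root-isRoot = ∧-intro (≡ᵇ-intro {l} refl) (≡ᵇ-intro {r} refl)

    outside-overlaps-root : ∀ T → Inside l r T → insideᵇ l k T ≡ false → insideᵇ k r T ≡ false → nonOverlapping root T ≡ false
    outside-overlaps-root (a , b , c) (la , ab , bc , cr) nA nB = overlapping-intro root (a , b , c) n1 n2
      where
      kc : k < c
      kc = ℕP.≰⇒> (λ ck → false⇒≢true nA (insideᵇ-intro l k (a , b , c) (la , ab , bc , ck)))
      ak : a < k
      ak = ℕP.≰⇒> (λ ka → false⇒≢true nB (insideᵇ-intro k r (a , b , c) (ka , ab , bc , cr)))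
      n1 : ¬ Separated root (a , b , c)
      n1 (inj₁ (_ , ck)) = <⇒≱ kc ck
      n1 (inj₂ (inj₁ (ka , _))) = <⇒≱ ak ka
      n1 (inj₂ (inj₂ (_ , inj₁ bl , _))) = <⇒≱ (≤-<-trans la ab) bl
      n1 (inj₂ (inj₂ (_ , inj₂ rb , _))) = <⇒≱ (<-≤-trans bc cr) rb
      n2 : ¬ Separated (a , b , c) root
      n2 (inj₁ (_ , rb)) = <⇒≱ (<-≤-trans bc cr) rb
      n2 (inj₂ (inj₁ (bl , _))) = <⇒≱ (≤-<-trans la ab) bl
      n2 (inj₂ (inj₂ (_ , inj₁ ka , _))) = <⇒≱ ak ka
      n2 (inj₂ (inj₂ (_ , inj₂ ck , _))) = <⇒≱ kc ck

  isVertex : ℕ → Tri → Bool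
  isVertex v T2 = any (λ u → u ≡ᵇ v) (verts T2)

  shareEdge-count : ∀ a b c T2 → shareEdge (a , b , c) T2 ≡ (2 ≤ᵇ (ind (isVertex a T2) + (ind (isVertex b T2) + (ind (isVertex c T2) + 0))))
  shareEdge-count a b c T2 = cong (2 ≤ᵇ_) (trans (countB-∷ (λ v → isVertex v T2) a (b ∷ c ∷ [])) (cong (ind (isVertex a T2) +_) (trans (countB-∷ (λ v → isVertex v T2) b (c ∷ []))
     (cong (ind (isVertex b T2) +_) (countB-∷ (λ v → isVertex v T2) c [])))))

  two-misses : ∀ pa pb pc → (pa ≡ false × pb ≡ false) ⊎ (pa ≡ false × pc ≡ false) ⊎ (pb ≡ false × pc ≡ false) →
          (2 ≤ᵇ (ind pa + (ind pb + (ind pc + 0)))) ≡ false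
  two-misses _ _ true (inj₁ (refl , refl)) = refl
  two-misses _ _ false (inj₁ (refl , refl)) = refl
  two-misses _ true _ (inj₂ (inj₁ (refl , refl))) = refl
  two-misses _ false _ (inj₂ (inj₁ (refl , refl))) = refl
  two-misses true _ _ (inj₂ (inj₂ (refl , refl))) = refl
  two-misses false _ _ (inj₂ (inj₂ (refl , refl))) = refl

  two-hits : ∀ pa pb pc → pa ≡ true → pc ≡ true → (2 ≤ᵇ (ind pa + (ind pb + (ind pc + 0)))) ≡ true
  two-hits _ true _ refl refl = refl
  two-hits _ false _ refl refl = refl

  isVertex-none : ∀ v x y z → ¬ x ≡ v → ¬ y ≡ v → ¬ z ≡ v → isVertex v (x , y , z) ≡ false
  isVertex-none v x y z n1 n2 n3 rewrite ≡ᵇ-false n1 | ≡ᵇ-false n2 | ≡ᵇ-false n3 = refl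

  isVertex-1st : ∀ v x y z → x ≡ v → isVertex v (x , y , z) ≡ true
  isVertex-1st v x y z e = ∨-introˡ (≡ᵇ-intro e)
  isVertex-2nd : ∀ v x y z → y ≡ v → isVertex v (x , y , z) ≡ true
  isVertex-2nd v x y z e = ∨-introʳ {x ≡ᵇ v} (∨-introˡ (≡ᵇ-intro e))
  isVertex-3rd : ∀ v x y z → z ≡ v → isVertex v (x , y , z) ≡ true
  isVertex-3rd v x y z e = ∨-introʳ {x ≡ᵇ v} (∨-introʳ {y ≡ᵇ v} (∨-introˡ (≡ᵇ-intro e)))

  ≡-via-false : ∀ {x z w : Bool} → z ≡ false → x ≡ w → w ≡ false → x ≡ z
  ≡-via-false zf e wf = trans e (trans wf (sym zf))

  isVertex-count : ∀ v x y z → x < y → y < z → ind (isVertex v (x , y , z)) ≡ ind (x ≡ᵇ v) + (ind (y ≡ᵇ v) + ind (z ≡ᵇ v))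
  isVertex-count v x y z xy yz with x ≡ᵇ v in e1 | y ≡ᵇ v in e2 | z ≡ᵇ v in e3
  ... | false | false | false = refl
  ... | true | false | false = refl
  ... | false | true | false = refl
  ... | false | false | true = refl
  ... | true | true | _ = ⊥-elim (<⇒≢ xy (trans (≡ᵇ-elim e1) (sym (≡ᵇ-elim e2))))
  ... | true | false | true = ⊥-elim (<⇒≢ (ℕP.<-trans xy yz) (trans (≡ᵇ-elim e1) (sym (≡ᵇ-elim e3))))
  ... | false | true | true = ⊥-elim (<⇒≢ yz (trans (≡ᵇ-elim e2) (sym (≡ᵇ-elim e3))))

  shareEdge-sym : ∀ T1 T2 → Ordered T1 → Ordered T2 → shareEdge T1 T2 ≡ shareEdge T2 T1
  shareEdge-sym (a , b , c) (x , y , z) (ab , bc) (xy , yz) =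
    trans (shareEdge-count a b c (x , y , z)) (trans (cong (2 ≤ᵇ_) vertex-counts-agree) (sym (shareEdge-count x y z (a , b , c))))
    where
    open +-*-Solver
    i : ℕ → ℕ → ℕ
    i u v = ind (u ≡ᵇ v)
    isym : ∀ u v → i u v ≡ i v u
    isym u v = cong ind (≡ᵇ-sym u v)
    vertex-counts-agree : ind (isVertex a (x , y , z)) + (ind (isVertex b (x , y , z)) + (ind (isVertex c (x , y , z)) + 0))
        ≡ ind (isVertex x (a , b , c)) + (ind (isVertex y (a , b , c)) + (ind (isVertex z (a , b , c)) + 0))
    vertex-counts-agree rewrite isVertex-count a x y z xy yz | isVertex-count b x y z xy yz | isVertex-count c x y z xy yz
              | isVertex-count x a b c ab bc | isVertex-count y a b c ab bc | isVertex-count z a b c ab bc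
              | isym x a | isym y a | isym z a | isym x b | isym y b | isym z b | isym x c | isym y c | isym z c =
      solve 9 (λ p1 p2 p3 q1 q2 q3 r1 r2 r3 →
        (p1 :+ (p2 :+ p3)) :+ ((q1 :+ (q2 :+ q3)) :+ ((r1 :+ (r2 :+ r3)) :+ con 0))
        := (p1 :+ (q1 :+ r1)) :+ ((p2 :+ (q2 :+ r2)) :+ ((p3 :+ (q3 :+ r3)) :+ con 0))) refl
        (i a x) (i a y) (i a z) (i b x) (i b y) (i b z) (i c x) (i c y) (i c z)

  module AdjacentToRoot (l k r : ℕ) (lk : l < k) (kr : k < r) where
    open AroundRoot l k r lk kr

    left-right-no-edge : ∀ T T' → Inside l k T → Inside k r T' → shareEdge T T' ≡ false
    left-right-no-edge (a , b , c) (x , y , z) (la , ab , bc , ck) (kx , xy , yz , zr) =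
      trans (shareEdge-count a b c (x , y , z)) (two-misses (isVertex a (x , y , z)) (isVertex b (x , y , z)) (isVertex c (x , y , z)) (inj₁ (isVertex-none a x y z (>⇒≢ ax) (>⇒≢ (<-trans ax xy)) (>⇒≢ (<-trans (<-trans ax xy) yz)) ,
                                                       isVertex-none b x y z (>⇒≢ bx) (>⇒≢ (<-trans bx xy)) (>⇒≢ (<-trans (<-trans bx xy) yz)))))
      where
      bx : b < x
      bx = <-≤-trans bc (≤-trans ck kx)
      ax : a < x
      ax = <-trans ab bx

    left-edge-root : ∀ T → Inside l k T → shareEdge T root ≡ isRoot l k T
    left-edge-root (a , b , c) (la , ab , bc , ck) with a Data.Nat.≟ l | c Data.Nat.≟ k
    ... | yes refl | yes refl =
          trans (trans (shareEdge-count a b c root) (two-hits (isVertex a root) (isVertex b root) (isVertex c root) (isVertex-1st a a c r refl) (isVertex-2nd c a c r refl))) (sym (∧-intro (≡ᵇ-intro {a} refl) (≡ᵇ-intro {c} refl)))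
    ... | no ne | _ = ≡-via-false (cong (_∧ (c ≡ᵇ k)) (≡ᵇ-false ne)) (shareEdge-count a b c root) (two-misses (isVertex a root) (isVertex b root) (isVertex c root) (inj₁ (
          isVertex-none a l k r (λ e → ne (sym e)) (>⇒≢ (<-≤-trans (<-trans ab bc) ck)) (>⇒≢ (<-trans (<-≤-trans (<-trans ab bc) ck) kr)) ,
          isVertex-none b l k r (<⇒≢ (≤-<-trans la ab)) (>⇒≢ (<-≤-trans bc ck)) (>⇒≢ (<-trans (<-≤-trans bc ck) kr)))))
    ... | yes refl | no ne = ≡-via-false (cong₂ _∧_ (≡ᵇ-intro {a} refl) (≡ᵇ-false ne)) (shareEdge-count a b c root) (two-misses (isVertex a root) (isVertex b root) (isVertex c root) (inj₂ (inj₂ (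
          isVertex-none b a k r (<⇒≢ ab) (>⇒≢ (<-≤-trans bc ck)) (>⇒≢ (<-trans (<-≤-trans bc ck) kr)) ,
          isVertex-none c a k r (<⇒≢ (<-trans ab bc)) (λ e → ne (sym e)) (>⇒≢ (≤-<-trans ck kr))))))

    right-edge-root : ∀ T → Inside k r T → shareEdge T root ≡ isRoot k r T
    right-edge-root (a , b , c) (ka , ab , bc , cr) with a Data.Nat.≟ k | c Data.Nat.≟ r
    ... | yes refl | yes refl =
          trans (trans (shareEdge-count a b c root) (two-hits (isVertex a root) (isVertex b root) (isVertex c root) (isVertex-2nd a l a c refl) (isVertex-3rd c l a c refl))) (sym (∧-intro (≡ᵇ-intro {a} refl) (≡ᵇ-intro {c} refl)))
    ... | no ne | _ = ≡-via-false (cong (_∧ (c ≡ᵇ r)) (≡ᵇ-false ne)) (shareEdge-count a b c root) (two-misses (isVertex a root) (isVertex b root) (isVertex c root) (inj₁ (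
          isVertex-none a l k r (<⇒≢ (<-≤-trans lk ka)) (λ e → ne (sym e)) (>⇒≢ (<-≤-trans (<-trans ab bc) cr)) ,
          isVertex-none b l k r (<⇒≢ (<-trans (<-≤-trans lk ka) ab)) (<⇒≢ (≤-<-trans ka ab)) (>⇒≢ (<-≤-trans bc cr)))))
    ... | yes refl | no ne = ≡-via-false (cong₂ _∧_ (≡ᵇ-intro {a} refl) (≡ᵇ-false ne)) (shareEdge-count a b c root) (two-misses (isVertex a root) (isVertex b root) (isVertex c root) (inj₂ (inj₂ (
          isVertex-none b l a r (<⇒≢ (<-trans lk ab)) (<⇒≢ ab) (>⇒≢ (<-≤-trans bc cr)) ,
          isVertex-none c l a r (<⇒≢ (<-trans lk (<-trans ab bc))) (<⇒≢ (<-trans ab bc)) (λ e → ne (sym e))))))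


module ColouredSublists where

  open LaurentPolynomial using (sumZ; sumZ-++; sumZ-map; sumZ-cong; sumZ-0; sumZ-+)
  open import Data.Bool using (Bool; true; false)
  import Data.Nat.Properties as ℕP
  open import Data.Integer as ℤ using (ℤ; +_; _+_)
  import Data.Integer.Properties as ℤP
  open import Data.List using (List; []; _∷_; _++_; map; length)
  open import Data.List.Relation.Unary.All using (All; []; _∷_)
  open import Data.Product using (_×_; _,_; proj₁; proj₂)
  open import Function using (_∘_)
  open import Relation.Binary.PropositionalEquality
  open import Relation.Nullary using (¬_)
  open import Data.List.Relation.Binary.Permutation.Propositional using (_↭_; prep; swap) renaming (refl to ↭refl; trans to ↭trans)
  import Data.List.Relation.Binary.Permutation.Propositional.Properties as PermP
  open import Data.Integer.Solver using (module +-*-Solver)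
  open +-*-Solver

  module _ {A : Set} where

    colouredSublists : List A → List (List (A × Bool))
    colouredSublists [] = [] ∷ []
    colouredSublists (x ∷ xs) = colouredSublists xs ++ map ((x , true) ∷_) (colouredSublists xs) ++ map ((x , false) ∷_) (colouredSublists xs)

    colouredSublists-∷ : ∀ h x xs → sumZ h (colouredSublists (x ∷ xs)) ≡
       sumZ h (colouredSublists xs) + (sumZ (h ∘ ((x , true) ∷_)) (colouredSublists xs) + sumZ (h ∘ ((x , false) ∷_)) (colouredSublists xs))
    colouredSublists-∷ h x xs = trans (sumZ-++ h (colouredSublists xs) _) (cong (_+_ (sumZ h (colouredSublists xs)))
      (trans (sumZ-++ h (map ((x , true) ∷_) (colouredSublists xs)) _) (cong₂ _+_ (sumZ-map h _ (colouredSublists xs)) (sumZ-map h _ (colouredSublists xs)))))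

    PermInvariant : (A → Set) → (List (A × Bool) → ℤ) → Set
    PermInvariant P h = ∀ {z z'} → All (P ∘ proj₁) z → z ↭ z' → h z ≡ h z'

    colouredSublists-cong : ∀ {P : A → Set} L → All P L → ∀ h h' → (∀ z → All (P ∘ proj₁) z → h z ≡ h' z) → sumZ h (colouredSublists L) ≡ sumZ h' (colouredSublists L)
    colouredSublists-cong [] [] h h' e = cong (_+ + 0) (e [] [])
    colouredSublists-cong (x ∷ L) (px ∷ pL) h h' e = trans (colouredSublists-∷ h x L) (trans
      (cong₂ _+_ (colouredSublists-cong L pL h h' e) (cong₂ _+_ (colouredSublists-cong L pL _ _ (λ z a → e _ (px ∷ a))) (colouredSublists-cong L pL _ _ (λ z a → e _ (px ∷ a)))))
      (sym (colouredSublists-∷ h' x L)))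

    colouredSublists-↭ : ∀ {P : A → Set} {xs ys} → xs ↭ ys → All P xs → ∀ h → PermInvariant P h → sumZ h (colouredSublists xs) ≡ sumZ h (colouredSublists ys)
    colouredSublists-↭ ↭refl _ h inv = refl
    colouredSublists-↭ {P} {x ∷ xs} {x ∷ ys} (prep x p) (px ∷ pxs) h inv = trans (colouredSublists-∷ h x xs) (trans
      (cong₂ _+_ (colouredSublists-↭ p pxs h inv) (cong₂ _+_ (colouredSublists-↭ p pxs (λ z → h ((x , true) ∷ z)) (λ a q → inv (px ∷ a) (prep _ q))) (colouredSublists-↭ p pxs (λ z → h ((x , false) ∷ z)) (λ a q → inv (px ∷ a) (prep _ q)))))
      (sym (colouredSublists-∷ h x ys)))
    colouredSublists-↭ {P} {x ∷ y ∷ xs} {y ∷ x ∷ ys} (swap x y p) (px ∷ py ∷ pxs) h inv =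
      trans (colouredSublists-∷ h x (y ∷ xs))
      (trans (cong₂ _+_ (colouredSublists-∷ h y xs) (cong₂ _+_ (colouredSublists-∷ _ y xs) (colouredSublists-∷ _ y xs)))
      (trans (+-regroup₉ (sumZ h (colouredSublists xs)) (S (y , true)) (S (y , false)) (S (x , true)) (S2 (x , true) (y , true)) (S2 (x , true) (y , false))
                  (S (x , false)) (S2 (x , false) (y , true)) (S2 (x , false) (y , false)))
      (trans (cong₂ _+_ (cong₂ _+_ (colouredSublists-↭ p pxs h inv) (cong₂ _+_ (P1 (x , true) px) (P1 (x , false) px)))
              (cong₂ _+_ (cong₂ _+_ (P1 (y , true) py) (cong₂ _+_ (P2 (x , true) (y , true) px py) (P2 (x , false) (y , true) px py)))
                         (cong₂ _+_ (P1 (y , false) py) (cong₂ _+_ (P2 (x , true) (y , false) px py) (P2 (x , false) (y , false) px py)))))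
      (sym (trans (colouredSublists-∷ h y (x ∷ ys))
           (cong₂ _+_ (colouredSublists-∷ h x ys) (cong₂ _+_ (colouredSublists-∷ _ x ys) (colouredSublists-∷ _ x ys))))))))
      where
      pys : All P ys
      pys = PermP.All-resp-↭ p pxs
      S : A × Bool → ℤ
      S u = sumZ (λ z → h (u ∷ z)) (colouredSublists xs)
      S2 : A × Bool → A × Bool → ℤ
      S2 u v = sumZ (λ z → h (u ∷ v ∷ z)) (colouredSublists xs)
      P1 : ∀ u → P (proj₁ u) → S u ≡ sumZ (λ z → h (u ∷ z)) (colouredSublists ys)
      P1 u pu = colouredSublists-↭ p pxs (λ z → h (u ∷ z)) (λ a q → inv (pu ∷ a) (prep u q))
      P2 : ∀ u v → P (proj₁ u) → P (proj₁ v) → S2 u v ≡ sumZ (λ z → h (v ∷ u ∷ z)) (colouredSublists ys)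
      P2 u v pu pv = trans (colouredSublists-↭ p pxs (λ z → h (u ∷ v ∷ z)) (λ a q → inv (pu ∷ pv ∷ a) (prep u (prep v q))))
                     (colouredSublists-cong ys pys _ _ (λ z a → inv (pu ∷ pv ∷ a) (swap u v ↭refl)))
      +-regroup₉ : ∀ a b c d e f g i j →
        (a + (b + c)) + ((d + (e + f)) + (g + (i + j))) ≡ (a + (d + g)) + ((b + (e + i)) + (c + (f + j)))
      +-regroup₉ = solve 9 (λ a b c d e f g i j →
        (a :+ (b :+ c)) :+ ((d :+ (e :+ f)) :+ (g :+ (i :+ j))) := (a :+ (d :+ g)) :+ ((b :+ (e :+ i)) :+ (c :+ (f :+ j)))) refl
    colouredSublists-↭ (↭trans p q) pxs h inv = trans (colouredSublists-↭ p pxs h inv) (colouredSublists-↭ q (PermP.All-resp-↭ p pxs) h inv)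

    colouredSublists-++ : ∀ h xs ys → sumZ h (colouredSublists (xs ++ ys)) ≡ sumZ (λ zA → sumZ (λ zB → h (zA ++ zB)) (colouredSublists ys)) (colouredSublists xs)
    colouredSublists-++ h [] ys = sym (ℤP.+-identityʳ _)
    colouredSublists-++ h (x ∷ xs) ys = trans (colouredSublists-∷ h x (xs ++ ys))
      (trans (cong₂ _+_ (colouredSublists-++ h xs ys) (cong₂ _+_ (colouredSublists-++ _ xs ys) (colouredSublists-++ _ xs ys)))
      (sym (colouredSublists-∷ (λ zA → sumZ (λ zB → h (zA ++ zB)) (colouredSublists ys)) x xs)))

    colouredSublists-only-[] : ∀ {P : A → Set} L → All P L → ∀ h → (∀ z → All (P ∘ proj₁) z → ¬ z ≡ [] → h z ≡ + 0) → sumZ h (colouredSublists L) ≡ h []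
    colouredSublists-only-[] [] [] h e = ℤP.+-identityʳ _
    colouredSublists-only-[] (x ∷ L) (px ∷ pL) h e = trans (colouredSublists-∷ h x L) (trans
      (cong₂ _+_ (colouredSublists-only-[] L pL h e) (cong₂ _+_ (trans (colouredSublists-cong L pL _ (λ _ → + 0) (λ z a → e _ (px ∷ a) (λ ()))) (sumZ-0 (colouredSublists L)))
                                                (trans (colouredSublists-cong L pL _ (λ _ → + 0) (λ z a → e _ (px ∷ a) (λ ()))) (sumZ-0 (colouredSublists L)))))
      (ℤP.+-identityʳ _))

    sublists-colourings : ∀ (H : List A → List Bool → ℤ) L →
      sumZ (λ S → sumZ (H S) (boolLists (length S))) (sublists L) ≡ sumZ (λ z → H (map proj₁ z) (map proj₂ z)) (colouredSublists L)
    sublists-colourings H [] = ℤP.+-identityʳ _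
    sublists-colourings H (x ∷ L) = trans (sumZ-++ _ (sublists L) _)
      (trans (cong₂ _+_ (sublists-colourings H L) (trans (sumZ-map _ (x ∷_) (sublists L))
         (trans (sumZ-cong (sublists L) (λ S → trans (sumZ-++ (H (x ∷ S)) (map (true ∷_) (boolLists (length S))) _)
                    (cong₂ _+_ (sumZ-map (H (x ∷ S)) _ (boolLists (length S))) (sumZ-map (H (x ∷ S)) _ (boolLists (length S))))))
         (trans (sumZ-+ _ _ (sublists L))
           (cong₂ _+_ (sublists-colourings (λ S cs → H (x ∷ S) (true ∷ cs)) L) (sublists-colourings (λ S cs → H (x ∷ S) (false ∷ cs)) L))))))
      (sym (colouredSublists-∷ _ x L)))

module ColouredTriangulation where

  import Data.List.Relation.Unary.All as All
  open LaurentPolynomial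
  open BooleanListPredicates
  open TriangleGeometry
  open ColouredSublists
  open import Data.Bool using (Bool; true; false; _∧_; _∨_; not; if_then_else_)
  open import Data.Nat as ℕ using (ℕ; _≡ᵇ_; _∸_)
  import Data.Nat.Properties as ℕP
  open import Data.Integer as ℤ using (ℤ; +_; -_; -[1+_])
  import Data.Integer.Properties as ℤP
  open import Data.List using (List; length)
  open import Data.List.Relation.Unary.All using (All)
  open import Data.Product using (_×_; proj₁; proj₂)
  open import Function using (_∘_)
  open import Relation.Binary.PropositionalEquality
  open import Data.List.Relation.Binary.Permutation.Propositional using (_↭_) renaming (refl to ↭refl; trans to ↭trans)
  import Data.List.Relation.Binary.Permutation.Propositional.Properties as PermP

  module _ {A : Set} where
  CTri : Set
  CTri = Tri × Bool

  nonOverlappingᶜ : CTri → CTri → Bool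
  nonOverlappingᶜ x y = nonOverlapping (proj₁ x) (proj₁ y)

  compatible : CTri → CTri → Bool
  compatible x y = not (shareEdge (proj₁ x) (proj₁ y)) ∨ differentB (proj₂ x) (proj₂ y)

  hasColour : Bool → Bool → Bool
  hasColour c b = if c then b else not b

  hasColour-self : ∀ c → hasColour c c ≡ true
  hasColour-self true = refl
  hasColour-self false = refl

  hasColour-not : ∀ c b → hasColour (not c) b ≡ true → differentB b c ≡ true
  hasColour-not true false _ = refl
  hasColour-not false true _ = refl

  differentB⇒hasColour-not : ∀ c b → differentB b c ≡ true → hasColour (not c) b ≡ true
  differentB⇒hasColour-not true false _ = refl
  differentB⇒hasColour-not false true _ = refl

  rootColour : ℕ → ℕ → Bool → CTri → Bool
  rootColour l r c x = not (isRoot l r (proj₁ x)) ∨ hasColour c (proj₂ x)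

  -- z is a checkerboard-coloured triangulation of the polygon with vertices l, …, r whose
  -- triangle on the edge {l, r} (the root) has colour c.
  isColouredTriangulation : ℕ → ℕ → Bool → List CTri → Bool
  isColouredTriangulation l r c z = (length z ≡ᵇ (r ∸ l ∸ 1)) ∧ (pairwiseB nonOverlappingᶜ z ∧ (all (rootColour l r c) z ∧ (pairwiseB compatible z ∧ all (insideᵇ l r ∘ proj₁) z)))

  sgn : Bool → ℤ
  sgn true = + 1
  sgn false = -[1+ 0 ]

  blackMinusWhiteᶜ : List CTri → ℤ
  blackMinusWhiteᶜ z = sumZ (sgn ∘ proj₂) z

  -- n_b − n_w, with the root colour c playing the role of black.
  exponent : Bool → List CTri → ℤ
  exponent true z = blackMinusWhiteᶜ z
  exponent false z = - blackMinusWhiteᶜ z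

  colouredWeight : ℕ → ℕ → Bool → List CTri → Laurent
  colouredWeight l r c z = if isColouredTriangulation l r c z then mono (+ 1) (exponent c z) else 0L

  nonOverlappingᶜ-sym : ∀ x y → nonOverlappingᶜ x y ≡ nonOverlappingᶜ y x
  nonOverlappingᶜ-sym x y = nonOverlapping-sym (proj₁ x) (proj₁ y)

  differentB-sym : ∀ a b → differentB a b ≡ differentB b a
  differentB-sym true true = refl
  differentB-sym true false = refl
  differentB-sym false true = refl
  differentB-sym false false = refl

  compatible-sym : ∀ x y → Ordered (proj₁ x) → Ordered (proj₁ y) → compatible x y ≡ compatible y x
  compatible-sym x y tx ty = cong₂ _∨_ (cong not (shareEdge-sym (proj₁ x) (proj₁ y) tx ty)) (differentB-sym (proj₂ x) (proj₂ y))

  isColouredTriangulation-↭ : ∀ l r c {z z'} → All (Ordered ∘ proj₁) z → z ↭ z' → isColouredTriangulation l r c z ≡ isColouredTriangulation l r c z'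
  isColouredTriangulation-↭ l r c pz q = cong₂ _∧_ (cong (_≡ᵇ (r ∸ l ∸ 1)) (PermP.↭-length q))
    (cong₂ _∧_ (pairwiseB-↭ (λ _ → ⊤) nonOverlappingᶜ (λ x y _ _ → nonOverlappingᶜ-sym x y) (All.universal (λ _ → tt) _) q)
    (cong₂ _∧_ (all-↭ (rootColour l r c) q) (cong₂ _∧_ (pairwiseB-↭ (Ordered ∘ proj₁) compatible compatible-sym pz q) (all-↭ (insideᵇ l r ∘ proj₁) q))))
    where
    open import Data.Unit using (⊤; tt)
  exponent-↭ : ∀ c {z z'} → z ↭ z' → exponent c z ≡ exponent c z'
  exponent-↭ true q = sumZ-↭ (sgn ∘ proj₂) q
  exponent-↭ false q = cong -_ (sumZ-↭ (sgn ∘ proj₂) q)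

  colouredWeight-↭ : ∀ l r c e → PermInvariant (Ordered) (λ z → coeff (colouredWeight l r c z) e)
  colouredWeight-↭ l r c e {z} {z'} pz q = cong (λ z → coeff z e) (cong₂ (λ b x → if b then mono (+ 1) x else 0L) (isColouredTriangulation-↭ l r c pz q) (exponent-↭ c q))


module TriangleMultiplicity where

  open BoolReflection
  open BooleanListPredicates
  open TriangleGeometry
  open ColouredSublists
  open import Data.Bool using (Bool; true; false; _∧_; if_then_else_; T)
  open import Data.Nat as ℕ using (ℕ; zero; suc; _≤_; _<_; _<ᵇ_; _≡ᵇ_; _+_; _*_)
  import Data.Nat.Properties as ℕP
  open ℕP using (>⇒≢)
  open import Data.List using (List; []; _∷_; map; upTo; concatMap; [_])
  open import Data.List.Properties using (upTo-∷ʳ)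
  open import Data.Product using (_,_)
  open import Relation.Binary.PropositionalEquality hiding ([_])
  open import Relation.Nullary using (¬_; yes; no)
  open import Relation.Nullary.Decidable using (map′; T?)
  open import Relation.Binary.Definitions using (DecidableEquality)
  open import Data.Bool.Properties using (T-≡)
  open import Function using (Equivalence)

  eqTri : Tri → Tri → Bool
  eqTri (a , b , c) (x , y , z) = (a ≡ᵇ x) ∧ ((b ≡ᵇ y) ∧ (c ≡ᵇ z))

  eqTri-sound : ∀ s t → T (eqTri s t) → s ≡ t
  eqTri-sound (a , b , c) (x , y , z) h with ∧-elim (Equivalence.to T-≡ h)
  ... | e1 , e23 with ∧-elim e23
  ...   | e2 , e3 = cong₂ _,_ (≡ᵇ-elim e1) (cong₂ _,_ (≡ᵇ-elim e2) (≡ᵇ-elim e3))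

  eqTri-refl : ∀ s → eqTri s s ≡ true
  eqTri-refl (a , b , c) = ∧-intro (≡ᵇ-intro {a} refl) (∧-intro (≡ᵇ-intro {b} refl) (≡ᵇ-intro {c} refl))

  eqTri-complete : ∀ s t → s ≡ t → T (eqTri s t)
  eqTri-complete s .s refl = Equivalence.from T-≡ (eqTri-refl s)

  eqTri-elim : ∀ s t → eqTri s t ≡ true → s ≡ t
  eqTri-elim s t h = eqTri-sound s t (Equivalence.from T-≡ h)

  tri≟ : DecidableEquality Tri
  tri≟ s t = map′ (eqTri-sound s t) (eqTri-complete s t) (T? (eqTri s t))

  module TriMult = Multiplicity tri≟
  module ℕMult = Multiplicity ℕP._≟_

  sumN : ∀ {A : Set} → (A → ℕ) → List A → ℕ
  sumN g [] = 0
  sumN g (x ∷ xs) = g x + sumN g xs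

  count-concatMap : ∀ {B : Set} x (f : B → List Tri) xs → TriMult.count x (concatMap f xs) ≡ sumN (λ y → TriMult.count x (f y)) xs
  count-concatMap x f [] = refl
  count-concatMap x f (y ∷ ys) = trans (TriMult.count-++ x (f y) _) (cong (TriMult.count x (f y) +_) (count-concatMap x f ys))

  oneIf : Bool → ℕ
  oneIf b = if b then 1 else 0

  sumN-select : ∀ y0 (g : ℕ → ℕ) ys → sumN (λ y → oneIf (y0 ≡ᵇ y) * g y) ys ≡ ℕMult.count y0 ys * g y0
  sumN-select y0 g [] = refl
  sumN-select y0 g (y ∷ ys) with y0 ℕP.≟ y
  ... | yes refl = trans (cong₂ _+_ (trans (cong (λ b → oneIf b * g y0) (≡ᵇ-intro {y0} refl)) (ℕP.+-identityʳ (g y0))) (sumN-select y0 g ys)) (sym (cong (_* g y0) (ℕMult.count-self y0 ys)))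
  ... | no ne = trans (cong₂ _+_ (cong (λ b → oneIf b * g y) (≡ᵇ-false ne)) (sumN-select y0 g ys)) (cong (λ b → (oneIf b + ℕMult.count y0 ys) * g y0) (sym (≡ᵇ-false ne)))

  count-map-triple : ∀ a b c a' b' cs → TriMult.count (a , b , c) (map (λ c' → (a' , b' , c')) cs) ≡ oneIf (a ≡ᵇ a') * (oneIf (b ≡ᵇ b') * ℕMult.count c cs)
  count-map-triple a b c a' b' [] = sym (trans (cong (oneIf (a ≡ᵇ a') *_) (ℕP.*-zeroʳ (oneIf (b ≡ᵇ b')))) (ℕP.*-zeroʳ (oneIf (a ≡ᵇ a'))))
  count-map-triple a b c a' b' (c' ∷ cs) rewrite count-map-triple a b c a' b' cs with a ≡ᵇ a' | b ≡ᵇ b'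
  ... | true | true = +-unit-factors (oneIf (c ≡ᵇ c')) (ℕMult.count c cs)
    where
    +-unit-factors : ∀ x y → x + 1 * (1 * y) ≡ 1 * (1 * (x + y))
    +-unit-factors x y = trans (cong (x +_) (trans (ℕP.*-identityˡ _) (ℕP.*-identityˡ y))) (sym (trans (ℕP.*-identityˡ _) (ℕP.*-identityˡ _)))
  ... | true | false = refl
  ... | false | true = refl
  ... | false | false = refl

  count-upTo-suc : ∀ y n → ℕMult.count y (upTo (suc n)) ≡ ℕMult.count y (upTo n) + ℕMult.count y [ n ]
  count-upTo-suc y n = trans (cong (ℕMult.count y) (sym (upTo-∷ʳ n))) (ℕMult.count-++ y (upTo n) [ n ])

  count-[]-≢ : ∀ y n → ¬ y ≡ n → ℕMult.count y [ n ] ≡ 0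
  count-[]-≢ y n ne = cong (λ b → oneIf b + 0) (≡ᵇ-false ne)

  count-upTo-≥ : ∀ y n → n ≤ y → ℕMult.count y (upTo n) ≡ 0
  count-upTo-≥ y zero _ = refl
  count-upTo-≥ y (suc n) le = trans (count-upTo-suc y n) (cong₂ _+_ (count-upTo-≥ y n (ℕP.<⇒≤ le)) (count-[]-≢ y n (>⇒≢ le)))

  count-upTo-< : ∀ y n → y < n → ℕMult.count y (upTo n) ≡ 1
  count-upTo-< y (suc n) lt with y ℕP.≟ n
  ... | yes refl = trans (count-upTo-suc y y) (cong₂ _+_ (count-upTo-≥ y y ℕP.≤-refl) (ℕMult.count-self y []))
  ... | no ne = trans (count-upTo-suc y n) (cong₂ _+_ (count-upTo-< y n (ℕP.≤∧≢⇒< (ℕP.≤-pred lt) ne)) (count-[]-≢ y n ne))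

  count-filter-upTo : ∀ (q : ℕ → Bool) y n → q y ≡ true → y < n → ℕMult.count y (filterB q (upTo n)) ≡ 1
  count-filter-upTo q y n qy lt = trans (ℕMult.count-filter-true q y (upTo n) qy) (count-upTo-< y n lt)

  sumN-cong : ∀ {A : Set} {f g : A → ℕ} xs → (∀ x → f x ≡ g x) → sumN f xs ≡ sumN g xs
  sumN-cong [] h = refl
  sumN-cong (x ∷ xs) h = cong₂ _+_ (h x) (sumN-cong xs h)

  sumN-*ˡ : ∀ {A : Set} s (f : A → ℕ) xs → sumN (λ x → s * f x) xs ≡ s * sumN f xs
  sumN-*ˡ s f [] = sym (ℕP.*-zeroʳ s)
  sumN-*ˡ s f (x ∷ xs) = trans (cong (s * f x +_) (sumN-*ˡ s f xs)) (sym (ℕP.*-distribˡ-+ s (f x) _))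

  count-allTris : ∀ a b c N → a < b → b < c → c < N → TriMult.count (a , b , c) (allTris N) ≡ 1
  count-allTris a b c N ab bc cN =
    trans (count-concatMap (a , b , c) _ (upTo N))
    (trans (sumN-cong (upTo N) (λ a' → trans (count-concatMap (a , b , c) _ (filterB (λ b' → a' <ᵇ b') (upTo N)))
       (trans (sumN-cong (filterB (λ b' → a' <ᵇ b') (upTo N)) (λ b' → count-map-triple a b c a' b' (filterB (λ c' → b' <ᵇ c') (upTo N))))
       (trans (sumN-*ˡ (oneIf (a ≡ᵇ a')) (λ b' → oneIf (b ≡ᵇ b') * ℕMult.count c (filterB (λ c' → b' <ᵇ c') (upTo N))) (filterB (λ b' → a' <ᵇ b') (upTo N)))
              (cong (oneIf (a ≡ᵇ a') *_) (sumN-select b (λ b' → ℕMult.count c (filterB (λ c' → b' <ᵇ c') (upTo N))) (filterB (λ b' → a' <ᵇ b') (upTo N))))))))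
    (trans (sumN-select a (λ a' → ℕMult.count b (filterB (λ b' → a' <ᵇ b') (upTo N)) * ℕMult.count c (filterB (λ c' → b <ᵇ c') (upTo N))) (upTo N))
    (trans (cong₂ _*_ (count-upTo-< a N (ℕP.<-trans ab (ℕP.<-trans bc cN)))
            (cong₂ _*_ (count-filter-upTo (λ b' → a <ᵇ b') b N (<ᵇ-intro ab) (ℕP.<-trans bc cN)) (count-filter-upTo (λ c' → b <ᵇ c') c N (<ᵇ-intro bc) cN)))
     refl)))


module TriangulationSize where

  open BoolReflection
  open BooleanListPredicates
  open TriangleGeometry
  open import Data.Bool using (true; false; not)
  open import Data.Nat as ℕ using (ℕ; zero; suc; _≤_; _<_; _+_; _∸_)
  import Data.Nat.Properties as ℕP
  open import Data.List using (List; []; _∷_; map; length)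
  import Data.List.Properties as ListP
  open import Data.List.Relation.Unary.All using (All; []; _∷_)
  open import Data.Product using (_×_; _,_; proj₁)
  open import Data.Empty using (⊥-elim)
  open import Function using (_∘_)
  open import Relation.Binary.PropositionalEquality
  open import Relation.Nullary using (yes; no)

  Distinct : List ℕ → Set
  Distinct xs = pairwiseB (λ x y → not (x ℕ.≡ᵇ y)) xs ≡ true

  pigeonhole : ∀ n lo (xs : List ℕ) → Distinct xs → All (λ x → lo ≤ x × x < lo + n) xs → length xs ≤ n
  pigeonhole zero lo [] _ _ = ℕP.≤-refl
  pigeonhole zero lo (x ∷ xs) _ ((p , q) ∷ _) = ⊥-elim (ℕP.<-irrefl refl (ℕP.≤-<-trans p (subst (x <_) (ℕP.+-identityʳ lo) q)))
  pigeonhole (suc m) lo xs dist rng = subst (_≤ suc m) (length-filterB-partition (λ x → x ℕ.≡ᵇ top) xs)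
      (ℕP.+-mono-≤ {length ys} {1} (one ys (pairwiseB-filterB _ _ xs dist) (filterB-sound (λ x → x ℕ.≡ᵇ top) xs))
         (pigeonhole m lo zs (pairwiseB-filterB _ _ xs dist) (rng' xs rng)))
    where
    top = lo + m
    ys = filterB (λ x → x ℕ.≡ᵇ top) xs
    zs = filterB (not ∘ (λ x → x ℕ.≡ᵇ top)) xs
    one : ∀ us → Distinct us → All (λ x → (x ℕ.≡ᵇ top) ≡ true) us → length us ≤ 1
    one [] _ _ = ℕ.z≤n
    one (u ∷ []) _ _ = ℕP.≤-refl
    one (u ∷ v ∷ us) d (eu ∷ ev ∷ _) = ⊥-elim (false⇒≢true (not-true⇒false (proj₁ (∧-elim {not (u ℕ.≡ᵇ v)} (proj₁ (∧-elim {all (λ y → not (u ℕ.≡ᵇ y)) (v ∷ us)} d)))))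
                                                       (≡ᵇ-intro {u} {v} (trans (≡ᵇ-elim {u} {top} eu) (sym (≡ᵇ-elim {v} {top} ev)))))
    rng' : ∀ us → All (λ x → lo ≤ x × x < lo + suc m) us → All (λ x → lo ≤ x × x < lo + m) (filterB (not ∘ (λ x → x ℕ.≡ᵇ top)) us)
    rng' [] _ = []
    rng' (u ∷ us) ((p , q) ∷ rest) with u ℕ.≡ᵇ top in e
    ... | true = rng' us rest
    ... | false = (p , ℕP.≤∧≢⇒< (ℕP.≤-pred (subst (u <_) (ℕP.+-suc lo m) q)) (λ eq → false⇒≢true e (≡ᵇ-intro eq))) ∷ rng' us rest

  -- the number of triangles in a triangulation of the polygon with vertices l, …, r
  size : ℕ → ℕ → ℕ
  size l r = r ∸ l ∸ 1

  size≡ : ∀ l r → size l r ≡ r ∸ suc l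
  size≡ l r = trans (ℕP.∸-+-assoc r l 1) (cong (r ∸_) (ℕP.+-comm l 1))

  size-+ : ∀ l r → suc l ≤ r → suc l + size l r ≡ r
  size-+ l r le = trans (cong (suc l +_) (size≡ l r)) (ℕP.m+[n∸m]≡n le)

  size-split : ∀ l k r → l < k → k < r → size l k + (size k r + 1) ≡ size l r
  size-split l k r lk kr = ℕP.+-cancelˡ-≡ (suc l) _ _ (trans (sym (ℕP.+-assoc (suc l) (size l k) _))
    (trans (cong (_+ (size k r + 1)) (size-+ l k lk))
    (trans (trans (cong (k +_) (ℕP.+-comm (size k r) 1)) (trans (ℕP.+-suc k (size k r)) (size-+ k r kr))) (sym (size-+ l r (ℕP.<-trans lk kr))))))

  apex : Tri → ℕ
  apex (a , b , c) = b

  -- Non-overlapping triangles have distinct apices, all strictly between l and r.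
  size-bound : ∀ l r (z : List Tri) → pairwiseB nonOverlapping z ≡ true → All (Inside l r) z → length z ≤ size l r
  size-bound l r [] _ _ = ℕ.z≤n
  size-bound l r z@((a , b , c) ∷ _) pw vz@((la , ab , bc , cr) ∷ _) =
    subst (_≤ size l r) (ListP.length-map apex z)
      (pigeonhole (size l r) (suc l) (map apex z)
        (trans (pairwiseB-map _ apex z) (pairwiseB-mono nonOverlapping _ z vz step pw))
        (rng z vz))
    where
    top : suc l + size l r ≡ r
    top = size-+ l r (ℕP.≤-trans (ℕP.≤-<-trans la ab) (ℕP.<⇒≤ (ℕP.<-≤-trans bc cr)))
    step : ∀ T T' → Inside l r T → Inside l r T' → nonOverlapping T T' ≡ true → not (apex T ℕ.≡ᵇ apex T') ≡ true
    step (a , b , c) (x , y , w) (_ , ab , bc , _) (_ , xy , yw , _) h with b ℕP.≟ y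
    ... | yes refl = ⊥-elim (false⇒≢true (common-apex-overlap a b c x w ab bc xy yw) h)
    ... | no ne = cong not (≡ᵇ-false ne)
    rng : ∀ us → All (Inside l r) us → All (λ x → suc l ≤ x × x < suc l + size l r) (map apex us)
    rng [] _ = []
    rng ((a , b , c) ∷ us) ((la , ab , bc , cr) ∷ vs) = (ℕP.≤-<-trans la ab , subst (b <_) (sym top) (ℕP.<-≤-trans bc cr)) ∷ rng us vs


module RootTriangle where

  open BoolReflection
  open BooleanListPredicates
  open TriangleGeometry
  open TriangulationSize
  open import Data.Bool using (true; _∨_)
  open import Data.Nat as ℕ using (ℕ; suc; _≤_; _<_; _+_; _∸_; s≤s)
  import Data.Nat.Properties as ℕP
  open import Data.List using (List; []; _∷_; _++_; map; length)
  open import Data.List.Relation.Unary.All using (All; []; _∷_)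
  import Data.List.Relation.Unary.All as All
  open import Data.List.Relation.Unary.Any using (here; there)
  open import Data.List.Membership.Propositional using (_∈_)
  open import Data.List.Membership.Propositional.Properties using (∈-∃++)
  open import Data.Product using (_×_; _,_; proj₁; proj₂; Σ)
  open import Data.Sum using (_⊎_; inj₁; inj₂)
  open import Data.Empty using (⊥; ⊥-elim)
  open import Data.Unit using (⊤; tt)
  open import Relation.Binary.PropositionalEquality
  open import Relation.Nullary using (¬_; Dec; yes; no)
  open import Data.List.Relation.Binary.Permutation.Propositional using (_↭_) renaming (refl to ↭refl; trans to ↭trans)
  import Data.List.Relation.Binary.Permutation.Propositional.Properties as PermP

  span : Tri → ℕ
  span (a , b , c) = c ∸ a

  argmax : ∀ (f : Tri → ℕ) x xs → Σ Tri λ T → T ∈ (x ∷ xs) × All (λ T' → f T' ≤ f T) (x ∷ xs)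
  argmax f x [] = x , here refl , (ℕP.≤-refl ∷ [])
  argmax f x (y ∷ ys) with argmax f y ys
  ... | T , T∈ , al with f x ℕP.≤? f T
  ...   | yes le = T , there T∈ , (le ∷ al)
  ...   | no nle = x , here refl , (ℕP.≤-refl ∷ All.map (λ p → ℕP.≤-trans p (ℕP.<⇒≤ (ℕP.≰⇒> nle))) al)

  open ℕP.≤-Reasoning

  parts-size< : ∀ l a b c r → l ≤ a → a < b → b < c → c ≤ r → (¬ a ≡ l ⊎ ¬ c ≡ r) →
       suc (size l a + (size a b + (size b c + size c r))) < size l r
  parts-size< l a b c r la ab bc cr ne = ℕP.+-cancelˡ-≤ (suc l) _ _ (ℕP.≤-trans (main ne) (ℕP.≤-reflexive (sym e3)))
    where
    open import Data.Nat.Solver using (module +-*-Solver)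
    open +-*-Solver
    DA = size l a ; DB = size a b ; DC = size b c ; DR = size c r
    e1 : suc a + DB ≡ b
    e1 = size-+ a b ab
    e2 : suc b + DC ≡ c
    e2 = size-+ b c bc
    e3 : suc l + size l r ≡ r
    e3 = size-+ l r (ℕP.≤-<-trans la (ℕP.<-≤-trans (ℕP.<-trans ab bc) cr))
    main : (¬ a ≡ l ⊎ ¬ c ≡ r) → suc l + suc (suc (DA + (DB + (DC + DR)))) ≤ r
    main (inj₁ nal) = begin
      suc l + suc (suc (DA + (DB + (DC + DR))))
        ≡⟨ solve 5 (λ l DA DB DC DR → con 1 :+ l :+ (con 2 :+ (DA :+ (DB :+ (DC :+ DR)))) := (con 1 :+ (con 1 :+ (con 1 :+ l :+ DA) :+ DB) :+ DC) :+ DR) refl l DA DB DC DR ⟩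
      (suc (suc (suc l + DA) + DB) + DC) + DR
        ≡⟨ cong (λ x → (suc (suc x + DB) + DC) + DR) (size-+ l a (ℕP.≤∧≢⇒< la (λ e → nal (sym e)))) ⟩
      (suc (suc a + DB) + DC) + DR ≡⟨ cong (λ x → (suc x + DC) + DR) e1 ⟩
      (suc b + DC) + DR ≡⟨ cong (_+ DR) e2 ⟩
      c + DR ≤⟨ ℕP.+-monoʳ-≤ c (ℕP.m∸n≤m (r ∸ c) 1) ⟩
      c + (r ∸ c) ≡⟨ ℕP.m+[n∸m]≡n cr ⟩
      r ∎
    main (inj₂ ncr) = begin
      suc l + suc (suc (DA + (DB + (DC + DR))))
        ≡⟨ solve 5 (λ l DA DB DC DR → con 1 :+ l :+ (con 2 :+ (DA :+ (DB :+ (DC :+ DR)))) := con 1 :+ (con 1 :+ (con 1 :+ (l :+ DA) :+ DB) :+ DC) :+ DR) refl l DA DB DC DR ⟩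
      suc (suc (suc (l + DA) + DB) + DC) + DR
        ≤⟨ ℕP.+-monoˡ-≤ DR (s≤s (ℕP.+-monoˡ-≤ DC (s≤s (ℕP.+-monoˡ-≤ DB (s≤s lDA))))) ⟩
      suc (suc (suc a + DB) + DC) + DR ≡⟨ cong (λ x → suc (suc x + DC) + DR) e1 ⟩
      suc (suc b + DC) + DR ≡⟨ cong (λ x → suc x + DR) e2 ⟩
      suc c + DR ≡⟨ size-+ c r (ℕP.≤∧≢⇒< cr ncr) ⟩
      r ∎
      where
      lDA : l + DA ≤ a
      lDA = ℕP.≤-trans (ℕP.+-monoʳ-≤ l (ℕP.m∸n≤m (a ∸ l) 1)) (ℕP.≤-reflexive (ℕP.m+[n∸m]≡n la))

  maxSpan-cover : ∀ l r a b c T' → Inside l r (a , b , c) → Inside l r T' → nonOverlapping (a , b , c) T' ≡ true → span T' ≤ span (a , b , c) →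
        (insideᵇ l a T' ∨ (insideᵇ a b T' ∨ (insideᵇ b c T' ∨ insideᵇ c r T'))) ≡ true
  maxSpan-cover l r a b c (x , y , w) (la , ab , bc , cr) (lx , xy , yw , wr) h sp with nonOverlapping⇒Separated (a , b , c) (x , y , w) (ab , bc) (xy , yw) h
  ... | inj₁ (ax , wb) = ∨-introʳ {insideᵇ l a (x , y , w)} (∨-introˡ (insideᵇ-intro a b (x , y , w) (ax , xy , yw , wb)))
  ... | inj₂ (inj₁ (bx , wc)) = ∨-introʳ {insideᵇ l a (x , y , w)} (∨-introʳ {insideᵇ a b (x , y , w)} (∨-introˡ (insideᵇ-intro b c (x , y , w) (bx , xy , yw , wc))))
  ... | inj₂ (inj₂ (inj₂ cx , _ , _)) = ∨-introʳ {insideᵇ l a (x , y , w)} (∨-introʳ {insideᵇ a b (x , y , w)} (∨-introʳ {insideᵇ b c (x , y , w)} (insideᵇ-intro c r (x , y , w) (cx , xy , yw , wr))))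
  ... | inj₂ (inj₂ (inj₁ xa , _ , inj₁ wa)) = ∨-introˡ (insideᵇ-intro l a (x , y , w) (lx , xy , yw , wa))
  ... | inj₂ (inj₂ (inj₁ xa , inj₁ ya , inj₂ cw)) =
    ⊥-elim (ℕP.<⇒≱ (ℕP.<-≤-trans (ℕP.∸-monoʳ-< (ℕP.<-≤-trans xy ya) (ℕP.<⇒≤ (ℕP.<-trans ab bc))) (ℕP.∸-monoˡ-≤ x cw)) sp)
  ... | inj₂ (inj₂ (inj₁ xa , inj₂ cy , inj₂ cw)) =
    ⊥-elim (ℕP.<⇒≱ (ℕP.≤-<-trans (ℕP.∸-monoʳ-≤ c xa) (ℕP.∸-monoˡ-< (ℕP.≤-<-trans cy yw) (ℕP.≤-trans xa (ℕP.<⇒≤ (ℕP.<-trans ab bc))))) sp)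

  All-filter-inside : ∀ lo hi (xs : List Tri) → All (Inside lo hi) (filterB (insideᵇ lo hi) xs)
  All-filter-inside lo hi xs = All.map (λ {T} h → insideᵇ-elim lo hi T h) (filterB-sound (insideᵇ lo hi) xs)

  maxSpan-length-bound : ∀ l r a b c z → Inside l r (a , b , c) → All (Inside l r) z →
    all (nonOverlapping (a , b , c)) z ≡ true → pairwiseB nonOverlapping z ≡ true →
    All (λ T → span T ≤ span (a , b , c)) z → length z ≤ size l a + (size a b + (size b c + size c r))
  maxSpan-length-bound l r a b c z inside-abc inside disjoint-abc disjoint maximal =
    ℕP.≤-trans (length≤count-cover (insideᵇ l a) (insideᵇ a b) (insideᵇ b c) (insideᵇ c r) z (covered z inside disjoint-abc maximal))
      (ℕP.+-mono-≤ (piece l a) (ℕP.+-mono-≤ (piece a b) (ℕP.+-mono-≤ (piece b c) (piece c r))))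
    where
    covered : ∀ us → All (Inside l r) us → all (nonOverlapping (a , b , c)) us ≡ true → All (λ T → span T ≤ span (a , b , c)) us →
              All (λ T → (insideᵇ l a T ∨ (insideᵇ a b T ∨ (insideᵇ b c T ∨ insideᵇ c r T))) ≡ true) us
    covered [] _ _ _ = []
    covered (u ∷ us) (vu ∷ vus) k (su ∷ sus) =
      maxSpan-cover l r a b c u inside-abc vu (proj₁ (∧-elim k)) su ∷ covered us vus (proj₂ (∧-elim k)) sus
    piece : ∀ lo hi → countB (insideᵇ lo hi) z ≤ size lo hi
    piece lo hi = size-bound lo hi (filterB (insideᵇ lo hi) z)
      (pairwiseB-filterB nonOverlapping (insideᵇ lo hi) z disjoint) (All-filter-inside lo hi z)

  -- A triangle of maximal span leaves all other triangles in the four pieces it cuts off;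
  -- unless it rests on the edge {l, r} these pieces are too small to hold them.
  root-exists : ∀ l r z → suc (suc l) ≤ r → pairwiseB nonOverlapping z ≡ true → All (Inside l r) z → length z ≡ size l r →
       Σ ℕ λ k → (l , k , r) ∈ z
  root-exists l r [] lr pw vz len = ⊥-elim (ℕP.<-irrefl refl (ℕP.≤-trans lr (ℕP.≤-reflexive
         (trans (sym (size-+ l r (ℕP.<⇒≤ lr))) (trans (cong (suc l +_) (sym len)) (ℕP.+-identityʳ (suc l)))))))
  root-exists l r z@(x ∷ xs) lr pw vz len with argmax span x xs
  ... | (a , b , c) , T∈z , maximal = root-or-absurd (a ℕP.≟ l) (c ℕP.≟ r)
    where
    T = (a , b , c)
    split = ∈-∃++ T∈z
    rest = proj₁ split ++ proj₁ (proj₂ split)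
    z↭T∷rest : z ↭ T ∷ rest
    z↭T∷rest = subst (_↭ T ∷ rest) (sym (proj₂ (proj₂ split))) (PermP.shift T (proj₁ split) (proj₁ (proj₂ split)))
    disjoint : pairwiseB nonOverlapping (T ∷ rest) ≡ true
    disjoint = trans (sym (pairwiseB-↭ (λ _ → ⊤) nonOverlapping (λ x y _ _ → nonOverlapping-sym x y) (All.universal (λ _ → tt) z) z↭T∷rest)) pw
    inside : All (Inside l r) (T ∷ rest)
    inside = PermP.All-resp-↭ z↭T∷rest vz
    la = proj₁ (All.head inside)
    ab = proj₁ (proj₂ (All.head inside))
    bc = proj₁ (proj₂ (proj₂ (All.head inside)))
    cr = proj₂ (proj₂ (proj₂ (All.head inside)))
    rest-bound : length rest ≤ size l a + (size a b + (size b c + size c r))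
    rest-bound = maxSpan-length-bound l r a b c rest (All.head inside) (All.tail inside)
      (proj₁ (∧-elim disjoint)) (proj₂ (∧-elim disjoint)) (All.tail (PermP.All-resp-↭ z↭T∷rest maximal))
    not-root : (¬ a ≡ l ⊎ ¬ c ≡ r) → ⊥
    not-root ne = ℕP.<-irrefl refl (ℕP.≤-<-trans (ℕP.≤-trans (ℕP.≤-reflexive (trans (sym len) (PermP.↭-length z↭T∷rest))) (s≤s rest-bound))
      (parts-size< l a b c r la ab bc cr ne))
    root-or-absurd : Dec (a ≡ l) → Dec (c ≡ r) → Σ ℕ λ k → (l , k , r) ∈ z
    root-or-absurd (yes refl) (yes refl) = b , T∈z
    root-or-absurd (no a≢l) _ = ⊥-elim (not-root (inj₁ a≢l))
    root-or-absurd (yes _) (no c≢r) = ⊥-elim (not-root (inj₂ c≢r))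


module RootDecomposition where

  open LaurentPolynomial
  open LaurentSums
  open BoolReflection
  open BooleanListPredicates
  open TriangleGeometry
  open ColouredSublists
  open ColouredTriangulation
  open TriangulationSize
  open import Data.Bool using (Bool; true; false; _∧_; _∨_; not)
  open import Data.Nat as ℕ using (ℕ; _≤_; _<_; _+_)
  import Data.Nat.Properties as ℕP
  import Data.Integer.Properties as ℤP
  import Data.List.Properties as ListP
  import Data.List.Relation.Unary.All.Properties as AllP
  open import Data.List using (List; []; _∷_; _++_; map; length)
  open import Data.List.Relation.Unary.All using (All; []; _∷_)
  import Data.List.Relation.Unary.All as All
  open import Data.Product using (_×_; _,_; proj₁; proj₂)
  open import Function using (_∘_)
  open import Relation.Binary.PropositionalEquality
  open import Data.List.Relation.Binary.Permutation.Propositional using () renaming (refl to ↭refl; trans to ↭trans)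
  import Data.List.Relation.Binary.Permutation.Propositional.Properties as PermP
  open import Algebra.Bundles using (CommutativeRing)

  private module L = CommutativeRing LaurentRing

  +-bounded-equal : ∀ {a b A B} → a ≤ A → b ≤ B → a + b ≡ A + B → a ≡ A × b ≡ B
  +-bounded-equal {a} {b} {A} {B} aA bB e = ea , trans (ℕP.+-cancelˡ-≡ a b B (trans e (cong (_+ B) (sym ea)))) refl
    where
    ea : a ≡ A
    ea = ℕP.≤-antisym aA (ℕP.+-cancelʳ-≤ B A a (ℕP.≤-trans (ℕP.≤-reflexive (sym e)) (ℕP.+-monoʳ-≤ a bB)))

  pairwiseB-nonOverlappingᶜ : ∀ z → pairwiseB nonOverlappingᶜ z ≡ pairwiseB nonOverlapping (map proj₁ z)
  pairwiseB-nonOverlappingᶜ z = sym (pairwiseB-map nonOverlapping proj₁ z)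

  module RootColouring (l k r : ℕ) (lk : l < k) (kr : k < r) (c : Bool) where
    open AroundRoot l k r lk kr
    open AdjacentToRoot l k r lk kr

    rootᶜ : CTri
    rootᶜ = (root , c)

    root-Inside : Inside l r root
    root-Inside = ℕP.≤-refl , lk , kr , ℕP.≤-refl

    left-rootColour : ∀ T col → Inside l k T → compatible (T , col) rootᶜ ≡ true → rootColour l k (not c) (T , col) ≡ true
    left-rootColour T col v h with isRoot l k T in e
    ... | false = refl
    ... | true = differentB⇒hasColour-not c col (subst (λ s → not s ∨ differentB col c ≡ true) (trans (left-edge-root T v) e) h)

    right-rootColour : ∀ T col → Inside k r T → compatible (T , col) rootᶜ ≡ true → rootColour k r (not c) (T , col) ≡ true
    right-rootColour T col v h with isRoot k r T in e
    ... | false = refl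
    ... | true = differentB⇒hasColour-not c col (subst (λ s → not s ∨ differentB col c ≡ true) (trans (right-edge-root T v) e) h)

    left-compatible : ∀ T col → Inside l k T → rootColour l k (not c) (T , col) ≡ true → compatible (T , col) rootᶜ ≡ true
    left-compatible T col v h with isRoot l k T in e
    ... | false = subst (λ s → not s ∨ differentB col c ≡ true) (sym (trans (left-edge-root T v) e)) refl
    ... | true = subst (λ s → not s ∨ differentB col c ≡ true) (sym (trans (left-edge-root T v) e)) (hasColour-not c col h)

    right-compatible : ∀ T col → Inside k r T → rootColour k r (not c) (T , col) ≡ true → compatible (T , col) rootᶜ ≡ true
    right-compatible T col v h with isRoot k r T in e
    ... | false = subst (λ s → not s ∨ differentB col c ≡ true) (sym (trans (right-edge-root T v) e)) refl
    ... | true = subst (λ s → not s ∨ differentB col c ≡ true) (sym (trans (right-edge-root T v) e)) (hasColour-not c col h)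

  isColouredTriangulation-elim : ∀ l r c z → isColouredTriangulation l r c z ≡ true →
    length z ≡ size l r × pairwiseB nonOverlappingᶜ z ≡ true × all (rootColour l r c) z ≡ true ×
    pairwiseB compatible z ≡ true × all (insideᵇ l r ∘ proj₁) z ≡ true
  isColouredTriangulation-elim l r c z h = let (h1 , h2) = ∧-elim h ; (h3 , h4) = ∧-elim h2 ; (h5 , h6) = ∧-elim h4 ; (h7 , h8) = ∧-elim h6 in ≡ᵇ-elim h1 , h3 , h5 , h7 , h8

  isColouredTriangulation-intro : ∀ l r c z → length z ≡ size l r → pairwiseB nonOverlappingᶜ z ≡ true →
    all (rootColour l r c) z ≡ true → pairwiseB compatible z ≡ true → all (insideᵇ l r ∘ proj₁) z ≡ true →
    isColouredTriangulation l r c z ≡ true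
  isColouredTriangulation-intro l r c z h1 h2 h3 h4 h5 = ∧-intro (≡ᵇ-intro h1) (∧-intro h2 (∧-intro h3 (∧-intro h4 h5)))

  module RootSplit (l k r : ℕ) (lk : l < k) (kr : k < r) (c : Bool) where
    open AroundRoot l k r lk kr
    open AdjacentToRoot l k r lk kr
    open RootColouring l k r lk kr c

    module _ (zA zB : List CTri) (vA : All (Inside l k ∘ proj₁) zA) (vB : All (Inside k r ∘ proj₁) zB) where
      z = zA ++ (zB ++ (rootᶜ ∷ []))

      lenz : length z ≡ length zA + (length zB + 1)
      lenz = trans (ListP.length-++ zA) (cong (length zA +_) (ListP.length-++ zB))

      restrict : isColouredTriangulation l r c z ≡ true → isColouredTriangulation l k (not c) zA ≡ true × isColouredTriangulation k r (not c) zB ≡ true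
      restrict h = isColouredTriangulation-intro l k (not c) zA (proj₁ eqs) pA rA aA (all-intro _ zA vA (λ x v → insideᵇ-intro l k (proj₁ x) v))
            , isColouredTriangulation-intro k r (not c) zB (proj₂ eqs) pB rB aB (all-intro _ zB vB (λ x v → insideᵇ-intro k r (proj₁ x) v))
        where
        parts = isColouredTriangulation-elim l r c z h
        len = proj₁ parts
        pw = proj₁ (proj₂ parts)
        adj = proj₁ (proj₂ (proj₂ (proj₂ parts)))
        pw1 = pairwiseB-++⁻ nonOverlappingᶜ zA (zB ++ (rootᶜ ∷ [])) pw
        pA = proj₁ pw1
        pw2 = pairwiseB-++⁻ nonOverlappingᶜ zB (rootᶜ ∷ []) (proj₁ (proj₂ pw1))
        pB = proj₁ pw2
        ad1 = pairwiseB-++⁻ compatible zA (zB ++ (rootᶜ ∷ [])) adj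
        aA = proj₁ ad1
        ad2 = pairwiseB-++⁻ compatible zB (rootᶜ ∷ []) (proj₁ (proj₂ ad1))
        aB = proj₁ ad2
        rA : all (rootColour l k (not c)) zA ≡ true
        rA = all-mono (λ x → all (compatible x) (zB ++ (rootᶜ ∷ []))) _ zA vA
               (λ x v q → left-rootColour (proj₁ x) (proj₂ x) v (proj₁ (∧-elim (proj₂ (all-++⁻ (compatible x) zB (rootᶜ ∷ []) q))))) (proj₂ (proj₂ ad1))
        rB : all (rootColour k r (not c)) zB ≡ true
        rB = all-mono (λ x → all (compatible x) (rootᶜ ∷ [])) _ zB vB (λ x v q → right-rootColour (proj₁ x) (proj₂ x) v (proj₁ (∧-elim q))) (proj₂ (proj₂ ad2))
        bA : length zA ≤ size l k
        bA = subst (_≤ size l k) (ListP.length-map proj₁ zA) (size-bound l k (map proj₁ zA) (trans (sym (pairwiseB-nonOverlappingᶜ zA)) pA) (AllP.map⁺ vA))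
        bB : length zB ≤ size k r
        bB = subst (_≤ size k r) (ListP.length-map proj₁ zB) (size-bound k r (map proj₁ zB) (trans (sym (pairwiseB-nonOverlappingᶜ zB)) pB) (AllP.map⁺ vB))
        eqs : length zA ≡ size l k × length zB ≡ size k r
        eqs = let e = ℕP.+-cancelʳ-≡ 1 (length zA + length zB) (size l k + size k r)
                        (trans (ℕP.+-assoc (length zA) (length zB) 1) (trans (sym lenz) (trans len (trans (sym (size-split l k r lk kr)) (sym (ℕP.+-assoc (size l k) (size k r) 1))))))
              in +-bounded-equal bA bB e

      glue : isColouredTriangulation l k (not c) zA ≡ true → isColouredTriangulation k r (not c) zB ≡ true → isColouredTriangulation l r c z ≡ true
      glue hA hB = isColouredTriangulation-intro l r c z len pw rt adj vl
        where
        hhA = isColouredTriangulation-elim l k (not c) zA hA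
        hhB = isColouredTriangulation-elim k r (not c) zB hB
        len : length z ≡ size l r
        len = trans lenz (trans (cong₂ (λ u v → u + (v + 1)) (proj₁ hhA) (proj₁ hhB)) (size-split l k r lk kr))
        crossB : all (λ x → all (nonOverlappingᶜ x) (rootᶜ ∷ [])) zB ≡ true
        crossB = all-intro _ zB vB (λ x v → ∧-intro (right-root-nonOverlapping (proj₁ x) v) refl)
        crossA : all (λ x → all (nonOverlappingᶜ x) (zB ++ (rootᶜ ∷ []))) zA ≡ true
        crossA = all-intro _ zA vA (λ x v → all-++⁺ (nonOverlappingᶜ x) zB (rootᶜ ∷ [])
                   (all-intro _ zB vB (λ y w → left-right-nonOverlapping (proj₁ x) (proj₁ y) v w)) (∧-intro (left-root-nonOverlapping (proj₁ x) v) refl))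
        pw : pairwiseB nonOverlappingᶜ z ≡ true
        pw = pairwiseB-++⁺ nonOverlappingᶜ zA _ (proj₁ (proj₂ hhA)) (pairwiseB-++⁺ nonOverlappingᶜ zB (rootᶜ ∷ []) (proj₁ (proj₂ hhB)) refl crossB) crossA
        rt : all (rootColour l r c) z ≡ true
        rt = all-++⁺ _ zA _ (all-intro _ zA vA (λ x v → cong (λ s → not s ∨ hasColour c (proj₂ x)) (left-not-root (proj₁ x) v)))
               (all-++⁺ _ zB _ (all-intro _ zB vB (λ x v → cong (λ s → not s ∨ hasColour c (proj₂ x)) (right-not-root (proj₁ x) v)))
                 (∧-intro (subst (λ s → not s ∨ hasColour c c ≡ true) (sym root-isRoot) (hasColour-self c)) refl))
        adjBt : all (λ x → all (compatible x) (rootᶜ ∷ [])) zB ≡ true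
        adjBt = all-mono (rootColour k r (not c)) _ zB vB (λ x v q → ∧-intro (right-compatible (proj₁ x) (proj₂ x) v q) refl) (proj₁ (proj₂ (proj₂ hhB)))
        adjAt : all (λ x → all (compatible x) (zB ++ (rootᶜ ∷ []))) zA ≡ true
        adjAt = all-mono (rootColour l k (not c)) _ zA vA (λ x v q → all-++⁺ (compatible x) zB (rootᶜ ∷ [])
                  (all-intro _ zB vB (λ y w → cong (λ s → not s ∨ differentB (proj₂ x) (proj₂ y)) (left-right-no-edge (proj₁ x) (proj₁ y) v w)))
                  (∧-intro (left-compatible (proj₁ x) (proj₂ x) v q) refl)) (proj₁ (proj₂ (proj₂ hhA)))
        adj : pairwiseB compatible z ≡ true
        adj = pairwiseB-++⁺ compatible zA _ (proj₁ (proj₂ (proj₂ (proj₂ hhA)))) (pairwiseB-++⁺ compatible zB (rootᶜ ∷ []) (proj₁ (proj₂ (proj₂ (proj₂ hhB)))) refl adjBt) adjAt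
        vl : all (insideᵇ l r ∘ proj₁) z ≡ true
        vl = all-++⁺ _ zA _ (all-intro _ zA vA (λ x v → insideᵇ-intro l r (proj₁ x) (Inside-widenʳ (ℕP.<⇒≤ kr) v)))
               (all-++⁺ _ zB _ (all-intro _ zB vB (λ x v → insideᵇ-intro l r (proj₁ x) (Inside-widenˡ (ℕP.<⇒≤ lk) v))) (∧-intro (insideᵇ-intro l r root root-Inside) refl))

      isColouredTriangulation-split : isColouredTriangulation l r c z ≡ (isColouredTriangulation l k (not c) zA ∧ isColouredTriangulation k r (not c) zB)
      isColouredTriangulation-split = bool-ext
        (λ h → ∧-intro (proj₁ (restrict h)) (proj₂ (restrict h)))
        (λ h → glue (proj₁ (∧-elim {isColouredTriangulation l k (not c) zA} h)) (proj₂ (∧-elim {isColouredTriangulation l k (not c) zA} h)))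


module RootSplitting where

  open LaurentPolynomial
  open LaurentSums
  open BoolReflection
  open BooleanListPredicates
  open TriangleGeometry
  open ColouredSublists
  open ColouredTriangulation
  open TriangleMultiplicity
  open TriangulationSize
  open RootTriangle
  open RootDecomposition
  open import Data.Bool using (Bool; true; false; _∧_; not; if_then_else_)
  open import Data.Bool.Properties using (∨-identityʳ; ∧-zeroʳ; ∧-identityʳ)
  open import Data.Nat as ℕ using (ℕ; _<_; _+_)
  import Data.Nat.Properties as ℕP
  open ℕP using (<⇒≢; >⇒≢)
  open import Data.Integer as ℤ using (ℤ; -_; -[1+_])
  import Data.Integer.Properties as ℤP
  open import Data.List using (List; []; _∷_; _++_; map)
  open import Data.List.Relation.Unary.All using (All; []; _∷_)
  import Data.List.Relation.Unary.All as All
  open import Data.Product using (_×_; _,_; proj₁; proj₂)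
  open import Data.Sum using (_⊎_; inj₁; inj₂)
  open import Data.Empty using (⊥-elim)
  open import Function using (_∘_)
  open import Relation.Binary.PropositionalEquality
  open import Relation.Nullary using (¬_)
  open import Data.List.Relation.Binary.Permutation.Propositional using (_↭_; ↭-sym) renaming (refl to ↭refl; trans to ↭trans)
  import Data.List.Relation.Binary.Permutation.Propositional.Properties as PermP

  trianglesInside : ℕ → ℕ → ℕ → List Tri
  trianglesInside N l r = filterB (insideᵇ l r) (allTris N)

  hasRoot : ℕ → ℕ → ℕ → Bool → List CTri → Bool
  hasRoot l k r c z = any (λ x → eqTri (proj₁ x) (l , k , r) ∧ hasColour c (proj₂ x)) z

  rootedWeight : ℕ → ℕ → ℕ → Bool → List CTri → Laurent
  rootedWeight l k r c z = if isColouredTriangulation l r c z ∧ hasRoot l k r c z then mono (ℤ.+ 1) (exponent c z) else 0L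

  rootedWeight-↭ : ∀ l k r c e → PermInvariant Ordered (λ z → coeff (rootedWeight l k r c z) e)
  rootedWeight-↭ l k r c e {z} {z'} pz q = cong (λ z → coeff z e)
    (cong₂ (λ b x → if b then mono (ℤ.+ 1) x else 0L) (cong₂ _∧_ (isColouredTriangulation-↭ l r c pz q) (any-↭ _ q)) (exponent-↭ c q))

  coeff-if : ∀ b p e → coeff (if b then p else 0L) e ≡ (if b then coeff p e else ℤ.+ 0)
  coeff-if true p e = refl
  coeff-if false p e = refl

  blackMinusWhiteᶜ-++ : ∀ xs ys → blackMinusWhiteᶜ (xs ++ ys) ≡ blackMinusWhiteᶜ xs ℤ.+ blackMinusWhiteᶜ ys
  blackMinusWhiteᶜ-++ xs ys = sumZ-++ (sgn ∘ proj₂) xs ys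

  exponent-split : ∀ c T zA zB → exponent c (zA ++ (zB ++ ((T , c) ∷ []))) ≡ ℤ.+ 1 ℤ.+ (- exponent (not c) zA ℤ.+ - exponent (not c) zB)
  exponent-split true T zA zB rewrite blackMinusWhiteᶜ-++ zA (zB ++ ((T , true) ∷ [])) | blackMinusWhiteᶜ-++ zB ((T , true) ∷ []) =
    solve 2 (λ a b → a :+ (b :+ (con (ℤ.+ 1) :+ con (ℤ.+ 0))) := con (ℤ.+ 1) :+ (:- (:- a) :+ :- (:- b))) refl (blackMinusWhiteᶜ zA) (blackMinusWhiteᶜ zB)
    where open import Data.Integer.Solver using (module +-*-Solver)
          open +-*-Solver
  exponent-split false T zA zB rewrite blackMinusWhiteᶜ-++ zA (zB ++ ((T , false) ∷ [])) | blackMinusWhiteᶜ-++ zB ((T , false) ∷ []) =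
    solve 2 (λ a b → :- (a :+ (b :+ (con -[1+ 0 ] :+ con (ℤ.+ 0)))) := con (ℤ.+ 1) :+ (:- a :+ :- b)) refl (blackMinusWhiteᶜ zA) (blackMinusWhiteᶜ zB)
    where open import Data.Integer.Solver using (module +-*-Solver)
          open +-*-Solver

  -- The triangles inside l, …, r: those inside l, …, k, those inside k, …, r, the root triangle
  -- (l, k, r), and a rest Trest whose members all overlap the root triangle.
  module RootPartition (N l k r : ℕ) (lk : l < k) (kr : k < r) (rN : r < N) where
    open AroundRoot l k r lk kr

    Tlr = trianglesInside N l r
    Tlk = trianglesInside N l k
    Tkr = trianglesInside N k r
    T¬lk = filterB (not ∘ insideᵇ l k) Tlr
    T¬lk¬kr = filterB (not ∘ insideᵇ k r) T¬lk
    Troot = filterB (λ T → eqTri T root) T¬lk¬kr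
    Trest = filterB (not ∘ (λ T → eqTri T root)) T¬lk¬kr

    left⇒inside : ∀ T → insideᵇ l k T ≡ true → insideᵇ l r T ≡ true
    left⇒inside T h = insideᵇ-intro l r T (Inside-widenʳ (ℕP.<⇒≤ kr) (insideᵇ-elim l k T h))
    right⇒inside : ∀ T → insideᵇ k r T ≡ true → insideᵇ l r T ≡ true
    right⇒inside T h = insideᵇ-intro l r T (Inside-widenˡ (ℕP.<⇒≤ lk) (insideᵇ-elim k r T h))
    right⇒¬left : ∀ T → insideᵇ k r T ≡ true → not (insideᵇ l k T) ≡ true
    right⇒¬left (a , b , c) h with insideᵇ-elim k r (a , b , c) h
    ... | (ka , ab , bc , cr) = cong not (≢true⇒false (λ h' → ℕP.<-irrefl refl (ℕP.<-≤-trans (ℕP.<-≤-trans (ℕP.<-trans ab bc) (proj₂ (proj₂ (proj₂ (insideᵇ-elim l k (a , b , c) h'))))) ka)))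

    filter-left : filterB (insideᵇ l k) Tlr ≡ Tlk
    filter-left = filterB-filterB (insideᵇ l k) (insideᵇ l r) left⇒inside (allTris N)

    filter-right : filterB (insideᵇ k r) T¬lk ≡ Tkr
    filter-right = trans (filterB-filterB (insideᵇ k r) (not ∘ insideᵇ l k) right⇒¬left Tlr) (filterB-filterB (insideᵇ k r) (insideᵇ l r) right⇒inside (allTris N))

    left-or-right⇒≢root : ∀ T → insideᵇ l k T ≡ true ⊎ insideᵇ k r T ≡ true → eqTri T root ≡ false
    left-or-right⇒≢root (a , b , c) (inj₁ h) with insideᵇ-elim l k (a , b , c) h
    ... | (_ , _ , _ , ck) = ≢true⇒false (λ h' → <⇒≢ (ℕP.≤-<-trans ck kr) (cong (proj₂ ∘ proj₂) (eqTri-elim (a , b , c) root h')))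
    left-or-right⇒≢root (a , b , c) (inj₂ h) with insideᵇ-elim k r (a , b , c) h
    ... | (ka , _ , _ , _) = ≢true⇒false (λ h' → >⇒≢ (ℕP.<-≤-trans lk ka) (cong proj₁ (eqTri-elim (a , b , c) root h')))

    Troot↭root : Troot ↭ (root ∷ [])
    Troot↭root = TriMult.count⇒↭ Troot (root ∷ []) cnts
      where
      cnts : ∀ x → TriMult.count x Troot ≡ TriMult.count x (root ∷ [])
      cnts x with eqTri x root in eq
      ... | false = TriMult.count-filter-false (λ T → eqTri T root) x T¬lk¬kr eq
      ... | true with eqTri-elim x root eq
      ... | refl = trans (TriMult.count-filter-true (λ T → eqTri T root) root T¬lk¬kr eq)
                   (trans (TriMult.count-filter-true (not ∘ insideᵇ k r) root T¬lk (cong not (≢true⇒false (λ h → ℕP.<-irrefl refl (ℕP.<-≤-trans lk (proj₁ (insideᵇ-elim k r root h)))))))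
                   (trans (TriMult.count-filter-true (not ∘ insideᵇ l k) root Tlr (cong not (≢true⇒false (λ h → ℕP.<-irrefl refl (ℕP.<-≤-trans kr (proj₂ (proj₂ (proj₂ (insideᵇ-elim l k root h)))))))))
                   (trans (TriMult.count-filter-true (insideᵇ l r) root (allTris N) (insideᵇ-intro l r root (ℕP.≤-refl , lk , kr , ℕP.≤-refl)))
                   (count-allTris l k r N lk kr rN))))

    Tlr-partition : Tlr ↭ Tlk ++ (Tkr ++ (root ∷ Trest))
    Tlr-partition = ↭-sym (↭trans (subst (λ u → u ++ (Tkr ++ (root ∷ Trest)) ↭ filterB (insideᵇ l k) Tlr ++ T¬lk) filter-left
              (PermP.++⁺ˡ (filterB (insideᵇ l k) Tlr)
                (↭trans (subst (λ u → u ++ (root ∷ Trest) ↭ filterB (insideᵇ k r) T¬lk ++ T¬lk¬kr) filter-right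
                   (PermP.++⁺ˡ (filterB (insideᵇ k r) T¬lk) (↭trans (PermP.++⁺ʳ Trest (↭-sym Troot↭root)) (filterB-partition (λ T → eqTri T root) T¬lk¬kr))))
                   (filterB-partition (insideᵇ k r) T¬lk))))
            (filterB-partition (insideᵇ l k) Tlr))

    Outside : Tri → Set
    Outside T = Inside l r T × insideᵇ l k T ≡ false × insideᵇ k r T ≡ false × eqTri T root ≡ false

    All-Outside-Trest : All Outside Trest
    All-Outside-Trest = All.map (λ { (((v , a) , b) , c) → insideᵇ-elim l r _ v , not-true⇒false a , not-true⇒false b , not-true⇒false c })
      (All-filterB⁺ _ T¬lk¬kr (All-filterB⁺ _ T¬lk (All-filterB⁺ _ Tlr (filterB-sound (insideᵇ l r) (allTris N)))))

    All-Ordered-Tlr : All Ordered Tlr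
    All-Ordered-Tlr = All.map (λ {T} h → Inside⇒Ordered (insideᵇ-elim l r T h)) (filterB-sound (insideᵇ l r) (allTris N))

    All-Inside-Tlk : All (Inside l k) Tlk
    All-Inside-Tlk = All-filter-inside l k (allTris N)
    All-Inside-Tkr : All (Inside k r) Tkr
    All-Inside-Tkr = All-filter-inside k r (allTris N)

    module RootSum (c : Bool) (e : ℤ) where
      open RootSplit l k r lk kr c

      h : List CTri → ℤ
      h z = coeff (rootedWeight l k r c z) e

      glued : List CTri → List CTri → Laurent
      glued zA zB = tL *L (invT (colouredWeight l k (not c) zA) *L invT (colouredWeight k r (not c) zB))

      isRootᶜ : CTri → Bool
      isRootᶜ x = eqTri (proj₁ x) (l , k , r) ∧ hasColour c (proj₂ x)

      left-isRootᶜ : ∀ x → Inside l k (proj₁ x) → isRootᶜ x ≡ false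
      left-isRootᶜ x v = cong (_∧ hasColour c (proj₂ x)) (left-or-right⇒≢root (proj₁ x) (inj₁ (insideᵇ-intro l k (proj₁ x) v)))
      right-isRootᶜ : ∀ x → Inside k r (proj₁ x) → isRootᶜ x ≡ false
      right-isRootᶜ x v = cong (_∧ hasColour c (proj₂ x)) (left-or-right⇒≢root (proj₁ x) (inj₂ (insideᵇ-intro k r (proj₁ x) v)))
      rest-isRootᶜ : ∀ x → Outside (proj₁ x) → isRootᶜ x ≡ false
      rest-isRootᶜ x (_ , _ , _ , q) = cong (_∧ hasColour c (proj₂ x)) q

      hasRoot-glued : ∀ zA zB b → All (Inside l k ∘ proj₁) zA → All (Inside k r ∘ proj₁) zB →
               hasRoot l k r c (zA ++ (zB ++ ((root , b) ∷ []))) ≡ hasColour c b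
      hasRoot-glued zA zB b vA vB rewrite any-++ isRootᶜ zA (zB ++ ((root , b) ∷ [])) | any-++ isRootᶜ zB ((root , b) ∷ [])
        | any-false isRootᶜ zA vA left-isRootᶜ | any-false isRootᶜ zB vB right-isRootᶜ | eqTri-refl root = ∨-identityʳ (hasColour c b)

      glued-weight : ∀ zA zB bA bB → exponent c (zA ++ (zB ++ ((root , c) ∷ []))) ≡ ℤ.+ 1 ℤ.+ (- exponent (not c) zA ℤ.+ - exponent (not c) zB) →
        coeff (if bA ∧ bB then mono (ℤ.+ 1) (exponent c (zA ++ (zB ++ ((root , c) ∷ [])))) else 0L) e ≡
        coeff (tL *L (invT (if bA then mono (ℤ.+ 1) (exponent (not c) zA) else 0L) *L invT (if bB then mono (ℤ.+ 1) (exponent (not c) zB) else 0L))) e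
      glued-weight zA zB true true eq = cong (λ x → coeff (mono (ℤ.+ 1) x) e) eq
      glued-weight zA zB true false _ = refl
      glued-weight zA zB false _ _ = refl

      rootedWeight-glued : ∀ zA zB → All (Inside l k ∘ proj₁) zA → All (Inside k r ∘ proj₁) zB →
               h (zA ++ (zB ++ ((root , c) ∷ []))) ≡ coeff (glued zA zB) e
      rootedWeight-glued zA zB vA vB = trans (cong (λ b → coeff (if b then mono (ℤ.+ 1) (exponent c (zA ++ (zB ++ ((root , c) ∷ [])))) else 0L) e)
          (trans (cong₂ _∧_ (isColouredTriangulation-split zA zB vA vB) (trans (hasRoot-glued zA zB c vA vB) (hasColour-self c))) (∧-identityʳ _)))
        (glued-weight zA zB (isColouredTriangulation l k (not c) zA) (isColouredTriangulation k r (not c) zB) (exponent-split c root zA zB))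

      rootedWeight-no-root : ∀ z → hasRoot l k r c z ≡ false → h z ≡ ℤ.+ 0
      rootedWeight-no-root z hf = cong (λ b → coeff (if b then mono (ℤ.+ 1) (exponent c z) else 0L) e) (trans (cong (isColouredTriangulation l r c z ∧_) hf) (∧-zeroʳ _))

      rootedWeight-invalid : ∀ z → isColouredTriangulation l r c z ≡ false → h z ≡ ℤ.+ 0
      rootedWeight-invalid z vf = cong (λ b → coeff (if b then mono (ℤ.+ 1) (exponent c z) else 0L) e) (cong (_∧ hasRoot l k r c z) vf)

      sum-without-root : ∀ zA zB → All (Inside l k ∘ proj₁) zA → All (Inside k r ∘ proj₁) zB →
              sumZ (λ zR → h (zA ++ (zB ++ zR))) (colouredSublists Trest) ≡ ℤ.+ 0
      sum-without-root zA zB vA vB = trans (colouredSublists-cong Trest All-Outside-Trest _ (λ _ → ℤ.+ 0) (λ zR aR → rootedWeight-no-root (zA ++ (zB ++ zR)) (hf zR aR))) (sumZ-0 (colouredSublists Trest))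
        where
        hf : ∀ zR → All (Outside ∘ proj₁) zR → hasRoot l k r c (zA ++ (zB ++ zR)) ≡ false
        hf zR aR rewrite any-++ isRootᶜ zA (zB ++ zR) | any-++ isRootᶜ zB zR | any-false isRootᶜ zA vA left-isRootᶜ | any-false isRootᶜ zB vB right-isRootᶜ = any-false isRootᶜ zR aR rest-isRootᶜ

      sum-with-root : ∀ zA zB b → sumZ (λ zR → h (zA ++ (zB ++ ((root , b) ∷ zR)))) (colouredSublists Trest) ≡ h (zA ++ (zB ++ ((root , b) ∷ [])))
      sum-with-root zA zB b = colouredSublists-only-[] Trest All-Outside-Trest _ step
        where
        step : ∀ zR → All (Outside ∘ proj₁) zR → ¬ zR ≡ [] → h (zA ++ (zB ++ ((root , b) ∷ zR))) ≡ ℤ.+ 0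
        step [] _ ne = ⊥-elim (ne refl)
        step (y ∷ zR') ((vy , nA , nB , _) ∷ _) _ = rootedWeight-invalid (zA ++ (zB ++ ((root , b) ∷ y ∷ zR'))) (≢true⇒false λ hv →
          let pw = proj₁ (proj₂ (isColouredTriangulation-elim l r c (zA ++ (zB ++ ((root , b) ∷ y ∷ zR'))) hv))
              pw1 = proj₁ (proj₂ (pairwiseB-++⁻ nonOverlappingᶜ zA (zB ++ ((root , b) ∷ y ∷ zR')) pw))
              pw2 = proj₁ (proj₂ (pairwiseB-++⁻ nonOverlappingᶜ zB ((root , b) ∷ y ∷ zR') pw1))
          in false⇒≢true (outside-overlaps-root (proj₁ y) vy nA nB) (proj₁ (∧-elim (proj₁ (∧-elim pw2)))))

      root-wrong-colour : ∀ zA zB b → All (Inside l k ∘ proj₁) zA → All (Inside k r ∘ proj₁) zB → hasColour c b ≡ false →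
              h (zA ++ (zB ++ ((root , b) ∷ []))) ≡ ℤ.+ 0
      root-wrong-colour zA zB b vA vB wrong = rootedWeight-no-root (zA ++ (zB ++ ((root , b) ∷ []))) (trans (hasRoot-glued zA zB b vA vB) wrong)

      sum-over-root-and-rest : ∀ zA zB → All (Inside l k ∘ proj₁) zA → All (Inside k r ∘ proj₁) zB →
              sumZ (λ w → h (zA ++ (zB ++ w))) (colouredSublists (root ∷ Trest)) ≡ coeff (glued zA zB) e
      sum-over-root-and-rest zA zB vA vB = trans (colouredSublists-∷ (λ w → h (zA ++ (zB ++ w))) root Trest)
        (trans (cong₂ ℤ._+_ (sum-without-root zA zB vA vB) (cong₂ ℤ._+_ (sum-with-root zA zB true) (sum-with-root zA zB false)))
        (by-root-colour c refl))
        where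
        by-root-colour : ∀ c' → c' ≡ c → ℤ.+ 0 ℤ.+ (h (zA ++ (zB ++ ((root , true) ∷ []))) ℤ.+ h (zA ++ (zB ++ ((root , false) ∷ [])))) ≡ coeff (glued zA zB) e
        by-root-colour true refl = trans (ℤP.+-identityˡ _) (trans (cong₂ ℤ._+_ (rootedWeight-glued zA zB vA vB) (root-wrong-colour zA zB false vA vB refl)) (ℤP.+-identityʳ _))
        by-root-colour false refl = trans (ℤP.+-identityˡ _) (trans (cong₂ ℤ._+_ (root-wrong-colour zA zB true vA vB refl) (rootedWeight-glued zA zB vA vB)) (ℤP.+-identityˡ _))

      -- Only coloured sublists avoiding Trest and containing the root with colour c contribute,
      -- and for those the weight factorises.
      rootedWeight-sum : sumZ h (colouredSublists Tlr) ≡ sumZ (λ zA → sumZ (λ zB → coeff (glued zA zB) e) (colouredSublists Tkr)) (colouredSublists Tlk)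
      rootedWeight-sum = trans (colouredSublists-↭ Tlr-partition All-Ordered-Tlr h (rootedWeight-↭ l k r c e))
        (trans (colouredSublists-++ h Tlk (Tkr ++ (root ∷ Trest)))
        (colouredSublists-cong Tlk All-Inside-Tlk _ _ (λ zA vA → trans (colouredSublists-++ (λ w → h (zA ++ w)) Tkr (root ∷ Trest))
           (colouredSublists-cong Tkr All-Inside-Tkr _ _ (λ zB vB → sum-over-root-and-rest zA zB vA vB)))))


module RootSelection where

  open LaurentPolynomial
  open LaurentSums
  open BoolReflection
  open BooleanListPredicates
  open TriangleGeometry
  open ColouredSublists
  open ColouredTriangulation
  open TriangleMultiplicity
  open TriangulationSize
  open RootTriangle
  open RootDecomposition
  open RootSplitting
  open import Data.Bool using (Bool; true; false; _∧_; _∨_; not; if_then_else_)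
  open import Data.Nat as ℕ using (ℕ; suc; _≤_; _<_; _+_; _∸_; s≤s)
  import Data.Nat.Properties as ℕP
  open import Data.Integer as ℤ using (ℤ)
  import Data.Integer.Properties as ℤP
  import Data.List.Properties as ListP
  import Data.List.Relation.Unary.All.Properties as AllP
  open import Data.List using (map; upTo)
  open import Data.List.Relation.Unary.All using (All)
  import Data.List.Relation.Unary.All as All
  open import Data.List.Membership.Propositional using (_∈_)
  open import Data.Product using (_×_; _,_; proj₁; proj₂; Σ)
  open import Data.Sum using (_⊎_; inj₁; inj₂)
  open import Data.Empty using (⊥; ⊥-elim)
  open import Function using (_∘_)
  open import Relation.Binary.PropositionalEquality hiding ([_])
  open import Relation.Nullary using (¬_; yes; no)

  open import Data.List.Membership.Propositional.Properties using (∈-map⁻)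

  hasRoot-exists : ∀ l r c z → suc (suc l) ≤ r → isColouredTriangulation l r c z ≡ true →
    Σ ℕ λ k → l < k × k < r × hasRoot l k r c z ≡ true
  hasRoot-exists l r c z lr valid = k , lk , kr , any-intro _ z x∈z (∧-intro (eqTri-resp-root (eqTri-refl (l , k , r))) x-colour)
    where
    parts = isColouredTriangulation-elim l r c z valid
    inside : All (Inside l r ∘ proj₁) z
    inside = All.map (λ {x} h → insideᵇ-elim l r (proj₁ x) h) (all⇒All (insideᵇ l r ∘ proj₁) z (proj₂ (proj₂ (proj₂ (proj₂ parts)))))
    root∈ = root-exists l r (map proj₁ z) lr (trans (sym (pairwiseB-nonOverlappingᶜ z) ) (proj₁ (proj₂ parts)))
      (AllP.map⁺ inside) (trans (ListP.length-map proj₁ z) (proj₁ parts))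
    k = proj₁ root∈
    x = proj₁ (∈-map⁻ proj₁ (proj₂ root∈))
    x∈z : x ∈ z
    x∈z = proj₁ (proj₂ (∈-map⁻ proj₁ (proj₂ root∈)))
    root≡x : (l , k , r) ≡ proj₁ x
    root≡x = proj₂ (proj₂ (∈-map⁻ proj₁ (proj₂ root∈)))
    eqTri-resp-root : eqTri (l , k , r) (l , k , r) ≡ true → eqTri (proj₁ x) (l , k , r) ≡ true
    eqTri-resp-root = subst (λ t → eqTri t (l , k , r) ≡ true) root≡x
    lk : l < k
    lk = proj₁ (proj₂ (subst (Inside l r) (sym root≡x) (All.lookup inside x∈z)))
    kr : k < r
    kr = proj₁ (proj₂ (proj₂ (subst (Inside l r) (sym root≡x) (All.lookup inside x∈z))))
    x-colour : hasColour c (proj₂ x) ≡ true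
    x-colour = subst (λ s → not s ∨ hasColour c (proj₂ x) ≡ true)
      (trans (cong (isRoot l r) (sym root≡x)) (∧-intro (≡ᵇ-intro {l} refl) (≡ᵇ-intro {r} refl)))
      (All.lookup (all⇒All (rootColour l r c) z (proj₁ (proj₂ (proj₂ parts)))) x∈z)

  hasRoot-unique : ∀ l k k' r c z → pairwiseB nonOverlappingᶜ z ≡ true → l < k → k < r → l < k' → k' < r →
    hasRoot l k r c z ≡ true → hasRoot l k' r c z ≡ true → k ≡ k'
  hasRoot-unique l k k' r c z disjoint lk kr lk' k'r hk hk' with any-elim _ z hk | any-elim _ z hk'
  ... | x , x∈z , px | y , y∈z , py with k ℕP.≟ k'
  ...   | yes k≡k' = k≡k'
  ...   | no k≢k' = ⊥-elim (overlapping (pairwiseB-pair nonOverlappingᶜ z disjoint x∈z y∈z x≢y))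
    where
    x≡root : proj₁ x ≡ (l , k , r)
    x≡root = eqTri-elim (proj₁ x) _ (proj₁ (∧-elim px))
    y≡root : proj₁ y ≡ (l , k' , r)
    y≡root = eqTri-elim (proj₁ y) _ (proj₁ (∧-elim py))
    x≢y : ¬ x ≡ y
    x≢y x≡y = k≢k' (cong (proj₁ ∘ proj₂) (trans (sym x≡root) (trans (cong proj₁ x≡y) y≡root)))
    roots-overlap' : nonOverlapping (l , k , r) (l , k' , r) ≡ false
    roots-overlap' = roots-overlap l k k' r lk kr lk' k'r
    overlapping : nonOverlappingᶜ x y ≡ true ⊎ nonOverlappingᶜ y x ≡ true → ⊥
    overlapping (inj₁ h) = false⇒≢true roots-overlap' (subst₂ (λ s t → nonOverlapping s t ≡ true) x≡root y≡root h)
    overlapping (inj₂ h) = false⇒≢true roots-overlap'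
      (trans (nonOverlapping-sym (l , k , r) _) (subst₂ (λ s t → nonOverlapping s t ≡ true) y≡root x≡root h))

  -- A coloured triangulation has exactly one root triangle (l, k, r).
  colouredWeight-rootSum : ∀ l r c z e → suc (suc l) ≤ r →
    coeff (colouredWeight l r c z) e ≡ sumZ (λ j → coeff (rootedWeight l (suc l + j) r c z) e) (upTo (size l r))
  colouredWeight-rootSum l r c z e lr = by-validity (isColouredTriangulation l r c z) refl
    where
    term : Bool → ℤ
    term b = coeff (if b then mono (ℤ.+ 1) (exponent c z) else 0L) e
    rooted : Bool → ℕ → ℤ
    rooted b j = coeff (if b ∧ hasRoot l (suc l + j) r c z then mono (ℤ.+ 1) (exponent c z) else 0L) e
    by-validity : ∀ b → isColouredTriangulation l r c z ≡ b → term b ≡ sumZ (rooted b) (upTo (size l r))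
    by-validity false _ = sym (sumZ-0 (upTo (size l r)))
    by-validity true valid = sym (trans (sumZ-cong (upTo (size l r)) (λ j → coeff-if (hasRoot l (suc l + j) r c z) _ e))
      (sumZ-select (λ j → hasRoot l (suc l + j) r c z) _ (size l r) j₀ j₀<size (subst (λ m → hasRoot l m r c z ≡ true) (sym l+j₀≡k) hk) unique))
      where
      root = hasRoot-exists l r c z lr valid
      k = proj₁ root
      lk = proj₁ (proj₂ root)
      kr = proj₁ (proj₂ (proj₂ root))
      hk = proj₂ (proj₂ (proj₂ root))
      j₀ = k ∸ suc l
      l+j₀≡k : suc l + j₀ ≡ k
      l+j₀≡k = ℕP.m+[n∸m]≡n lk
      r≡ : suc l + size l r ≡ r
      r≡ = size-+ l r (ℕP.<-trans lk kr)
      j₀<size : j₀ < size l r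
      j₀<size = ℕP.+-cancelˡ-< (suc l) j₀ (size l r) (subst₂ _<_ (sym l+j₀≡k) (sym r≡) kr)
      unique : ∀ j → j < size l r → hasRoot l (suc l + j) r c z ≡ true → j ≡ j₀
      unique j j<size hj = ℕP.+-cancelˡ-≡ (suc l) j j₀ (trans
        (hasRoot-unique l (suc l + j) k r c z (proj₁ (proj₂ (isColouredTriangulation-elim l r c z valid)))
          (s≤s (ℕP.m≤m+n l j)) (subst (suc l + j <_) r≡ (ℕP.+-monoʳ-< (suc l) j<size)) lk kr hj hk)
        (sym l+j₀≡k))


module PolygonWeight where

  open LaurentPolynomial
  open LaurentSums
  open BooleanListPredicates
  open TriangleGeometry
  open ColouredSublists
  open ColouredTriangulation
  open TriangleMultiplicity
  open TriangulationSize
  open RootDecomposition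
  open RootSplitting
  open RootSelection
  open import Data.Bool using (Bool; true; false; _∧_; not; if_then_else_)
  open import Data.Nat as ℕ using (ℕ; zero; suc; _≤_; _<_; _+_; _∸_; z≤n; s≤s; _≡ᵇ_)
  import Data.Nat.Properties as ℕP
  open import Data.Integer as ℤ using (ℤ)
  import Data.Integer.Properties as ℤP
  open import Data.List using ([]; _∷_; map; length; upTo)
  open import Data.List.Relation.Unary.All using (All; []; _∷_)
  import Data.List.Relation.Unary.All as All
  open import Data.Product using (_,_; proj₁)
  open import Data.Empty using (⊥-elim)
  open import Data.Unit using (⊤; tt)
  open import Function using (_∘_)
  open import Relation.Binary.PropositionalEquality hiding ([_])
  open import Relation.Nullary using (¬_)
  open import Algebra.Bundles using (CommutativeRing)

  -- N only bounds the vertex labels of the candidate triangles (polygonWeight-ambient).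
  polygonWeight : ℕ → ℕ → ℕ → Bool → Laurent
  polygonWeight N l r c = sumL (map (colouredWeight l r c) (colouredSublists (trianglesInside N l r)))

  polygonWeight-recurrence : ∀ N l r c → suc (suc l) ≤ r → r < N →
    polygonWeight N l r c ≋ tL *L sumL (map (λ j → invT (polygonWeight N l (suc l + j) (not c)) *L invT (polygonWeight N (suc l + j) r (not c))) (upTo (size l r)))
  polygonWeight-recurrence N l r c lr rN = ⟪ (λ e →
    trans (coeff-sumL (colouredWeight l r c) (colouredSublists (trianglesInside N l r)) e)
    (trans (sumZ-cong (colouredSublists (trianglesInside N l r)) (λ z → colouredWeight-rootSum l r c z e lr))
    (trans (sumZ-swap (λ z j → coeff (rootedWeight l (suc l + j) r c z) e) (colouredSublists (trianglesInside N l r)) (upTo (size l r)))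
    (trans (sumZ-upTo-cong (size l r) (λ j jD → step j jD e))
    (sym (trans (≋→ (sumL-*ˡ tL f (upTo (size l r))) e) (coeff-sumL (λ j → tL *L f j) (upTo (size l r)) e))))))) ⟫
    where
    f : ℕ → Laurent
    f j = invT (polygonWeight N l (suc l + j) (not c)) *L invT (polygonWeight N (suc l + j) r (not c))
    step : ∀ j → j < size l r → ∀ e → sumZ (λ z → coeff (rootedWeight l (suc l + j) r c z) e) (colouredSublists (trianglesInside N l r)) ≡ coeff (tL *L f j) e
    step j jD e = trans (RootPartition.RootSum.rootedWeight-sum N l (suc l + j) r (s≤s (ℕP.m≤m+n l j)) kr rN c e)
                        (sym (expand-product (colouredWeight l (suc l + j) (not c)) (colouredWeight (suc l + j) r (not c)) (colouredSublists (trianglesInside N l (suc l + j))) (colouredSublists (trianglesInside N (suc l + j) r)) e))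
      where
      kr : suc l + j < r
      kr = subst (suc l + j <_) (size-+ l r (ℕP.<⇒≤ lr)) (ℕP.+-monoʳ-< (suc l) jD)

  size-edge : ∀ l → size l (suc l) ≡ 0
  size-edge l = trans (size≡ l (suc l)) (ℕP.n∸n≡0 (suc l))

  polygonWeight-edge : ∀ N l c → polygonWeight N l (suc l) c ≋ 1L
  polygonWeight-edge N l c = ⟪ coeff-edge ⟫
    where
    empty-valid : isColouredTriangulation l (suc l) c [] ≡ true
    empty-valid = cong (λ d → (0 ℕ.≡ᵇ d) ∧ true) (size-edge l)
    nonempty-invalid : ∀ y z → isColouredTriangulation l (suc l) c (y ∷ z) ≡ false
    nonempty-invalid y z = cong (λ d → (suc (length z) ℕ.≡ᵇ d) ∧ rest) (size-edge l)
      where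
      rest = pairwiseB nonOverlappingᶜ (y ∷ z) ∧ (all (rootColour l (suc l) c) (y ∷ z)
        ∧ (pairwiseB compatible (y ∷ z) ∧ all (insideᵇ l (suc l) ∘ proj₁) (y ∷ z)))
    mono-exponent-[] : ∀ c e → coeff (mono (ℤ.+ 1) (exponent c [])) e ≡ coeff 1L e
    mono-exponent-[] true e = refl
    mono-exponent-[] false e = refl
    only-[] : ∀ e z → All (λ _ → ⊤) z → ¬ z ≡ [] → coeff (colouredWeight l (suc l) c z) e ≡ ℤ.+ 0
    only-[] e [] _ z≢[] = ⊥-elim (z≢[] refl)
    only-[] e (y ∷ z) _ _ = cong (λ b → coeff (if b then mono (ℤ.+ 1) (exponent c (y ∷ z)) else 0L) e) (nonempty-invalid y z)
    coeff-edge : ∀ e → coeff (polygonWeight N l (suc l) c) e ≡ coeff 1L e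
    coeff-edge e = trans (coeff-sumL (colouredWeight l (suc l) c) (colouredSublists (trianglesInside N l (suc l))) e)
      (trans (colouredSublists-only-[] (trianglesInside N l (suc l)) (All.universal (λ _ → tt) _) (λ z → coeff (colouredWeight l (suc l) c z) e) (only-[] e))
      (trans (cong (λ b → coeff (if b then mono (ℤ.+ 1) (exponent c []) else 0L) e) empty-valid) (mono-exponent-[] c e)))

  All-Ordered-trianglesInside : ∀ N l r → All Ordered (trianglesInside N l r)
  All-Ordered-trianglesInside N l r = All.map (λ {T} h → Inside⇒Ordered (insideᵇ-elim l r T h)) (filterB-sound (insideᵇ l r) (allTris N))

  polygonWeight-ambient : ∀ N N' l r c → r < N → r < N' → polygonWeight N l r c ≋ polygonWeight N' l r c
  polygonWeight-ambient N N' l r c rN rN' = ⟪ (λ e → trans (coeff-sumL (colouredWeight l r c) (colouredSublists (trianglesInside N l r)) e)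
    (trans (colouredSublists-↭ perm (All-Ordered-trianglesInside N l r) (λ z → coeff (colouredWeight l r c z) e) (colouredWeight-↭ l r c e))
    (sym (coeff-sumL (colouredWeight l r c) (colouredSublists (trianglesInside N' l r)) e)))) ⟫
    where
    cnts : ∀ x → TriMult.count x (trianglesInside N l r) ≡ TriMult.count x (trianglesInside N' l r)
    cnts (a , b , c') with insideᵇ l r (a , b , c') in v
    ... | true = let (la , ab , bc , cr) = insideᵇ-elim l r _ v in
      trans (TriMult.count-filter-true (insideᵇ l r) _ (allTris N) v) (trans (count-allTris a b c' N ab bc (ℕP.≤-<-trans cr rN))
        (sym (trans (TriMult.count-filter-true (insideᵇ l r) _ (allTris N') v) (count-allTris a b c' N' ab bc (ℕP.≤-<-trans cr rN')))))
    ... | false = trans (TriMult.count-filter-false (insideᵇ l r) _ (allTris N) v) (sym (TriMult.count-filter-false (insideᵇ l r) _ (allTris N') v))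
    perm = TriMult.count⇒↭ (trianglesInside N l r) (trianglesInside N' l r) cnts

  private module L = CommutativeRing LaurentRing

  -- Strong induction on the size d of the polygon, through the recurrence; the weight
  -- depends neither on the position l nor on the root colour c.
  module Translation (N : ℕ) where
    polygonWeight-translate : ∀ n d → d ≤ n → ∀ l r c → r ≡ l + suc d → r < N → polygonWeight N l r c ≋ polygonWeight N 0 (suc d) true
    polygonWeight-translate n zero _ l r c refl r<N =
      L.trans (subst (λ r' → polygonWeight N l r' c ≋ 1L) (sym (ℕP.+-comm l 1)) (polygonWeight-edge N l c)) (L.sym (polygonWeight-edge N 0 true))
    polygonWeight-translate (suc n) (suc d) (s≤s d≤n) l _ c refl r<N =
      L.trans (polygonWeight-recurrence N l r c lr r<N)
      (L.trans (L.*-cong {tL} L.refl (L.trans (L.reflexive (cong (λ m → sumL (map f (upTo m))) size-lr)) (sumL-upTo-cong (suc d) f≈g)))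
      (L.sym (polygonWeight-recurrence N 0 (suc (suc d)) true (s≤s (s≤s z≤n)) d<N)))
      where
      r = l + suc (suc d)
      lr : suc (suc l) ≤ r
      lr = subst (suc (suc l) ≤_) (sym (trans (ℕP.+-suc l (suc d)) (cong suc (ℕP.+-suc l d)))) (s≤s (s≤s (ℕP.m≤m+n l d)))
      size-lr : size l r ≡ suc d
      size-lr = cong (_∸ 1) (ℕP.m+n∸m≡n l (suc (suc d)))
      d<N : suc (suc d) < N
      d<N = ℕP.≤-<-trans (ℕP.m≤n+m (suc (suc d)) l) r<N
      f g : ℕ → Laurent
      f j = invT (polygonWeight N l (suc l + j) (not c)) *L invT (polygonWeight N (suc l + j) r (not c))
      g j = invT (polygonWeight N 0 (suc j) false) *L invT (polygonWeight N (suc j) (suc (suc d)) false)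
      f≈g : ∀ j → j < suc d → f j ≋ g j
      f≈g j j<d = L.*-cong
        (invT-cong (L.trans (polygonWeight-translate n j j≤n l (suc l + j) (not c) (sym (ℕP.+-suc l j))
                              (ℕP.<-trans (ℕP.+-monoʳ-< (suc l) j<d) (subst (_< N) (ℕP.+-suc l (suc d)) r<N)))
                            (L.sym (polygonWeight-translate n j j≤n 0 (suc j) false refl (ℕP.<-trans (s≤s j<d) d<N)))))
        (invT-cong (L.trans (polygonWeight-translate n (d ∸ j) d-j≤n (suc l + j) r (not c) r-split r<N)
                            (L.sym (polygonWeight-translate n (d ∸ j) d-j≤n (suc j) (suc (suc d)) false (sym (cong suc d-split)) d<N))))
        where
        j≤n : j ≤ n
        j≤n = ℕP.≤-trans (ℕP.≤-pred j<d) d≤n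
        d-j≤n : d ∸ j ≤ n
        d-j≤n = ℕP.≤-trans (ℕP.m∸n≤m d j) d≤n
        d-split : j + suc (d ∸ j) ≡ suc d
        d-split = trans (ℕP.+-suc j (d ∸ j)) (cong suc (ℕP.m+[n∸m]≡n (ℕP.≤-pred j<d)))
        r-split : r ≡ (suc l + j) + suc (d ∸ j)
        r-split = sym (trans (cong suc (ℕP.+-assoc l j _)) (trans (cong (λ m → suc (l + m)) d-split) (sym (ℕP.+-suc l (suc d)))))


module TriangulationWeight where

  open LaurentPolynomial
  open LaurentSums
  open BoolReflection
  open BooleanListPredicates
  open TriangleGeometry
  open ColouredSublists
  open ColouredTriangulation
  open TriangleMultiplicity
  open RootDecomposition
  open RootSplitting
  open PolygonWeight
  open import Data.Bool using (Bool; true; false; _∧_; _∨_; not; if_then_else_)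
  open import Data.Nat as ℕ using (ℕ; zero; suc; _≤_; _<_; _+_; _∸_; z≤n; s≤s; _≡ᵇ_; _<ᵇ_)
  import Data.Nat.Properties as ℕP
  open import Data.Integer as ℤ using (ℤ; -_; -[1+_])
  import Data.Integer.Properties as ℤP
  import Data.List.Properties as ListP
  import Data.List.Relation.Unary.All.Properties as AllP
  open import Data.List using (List; []; _∷_; map; length; upTo; zip)
  open import Data.List.Relation.Unary.All using (All; []; _∷_)
  import Data.List.Relation.Unary.All as All
  open import Data.Product using (_,_; proj₁; proj₂)
  open import Relation.Binary.PropositionalEquality hiding ([_])
  open import Algebra.Bundles using (CommutativeRing)

  private module L = CommutativeRing LaurentRing

  allTris-valid : ∀ n → All (λ T → insideᵇ 0 (suc n) T ≡ true) (allTris (suc (suc n)))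
  allTris-valid n =
    AllP.concat⁺ (AllP.map⁺ (All.map (λ {a} _ →
      AllP.concat⁺ (AllP.map⁺ (All.map (λ {b} (_ , ab) →
        AllP.map⁺ (All.map (λ {c} (cm , bc) → ∧-intro ab (∧-intro bc (≤ᵇ-intro (ℕP.≤-pred cm))))
          (All-filterB⁺ (λ c → b <ᵇ c) (upTo m) (AllP.all-upTo m))))
        (All-filterB⁺ (λ b → a <ᵇ b) (upTo m) (AllP.all-upTo m)))))
      (AllP.all-upTo m)))
    where m = suc (suc n)

  zip-map-proj : ∀ (z : List CTri) → zip (map proj₁ z) (map proj₂ z) ≡ z
  zip-map-proj [] = refl
  zip-map-proj (x ∷ z) = cong (x ∷_) (zip-map-proj z)

  blackMinusWhite-sumZ : ∀ cs → blackMinusWhite cs ≡ sumZ sgn cs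
  blackMinusWhite-sumZ [] = refl
  blackMinusWhite-sumZ (true ∷ cs) = trans (ℤP.+-assoc (ℤ.+ 1) (ℤ.+ countB (λ b → b) cs) (- ℤ.+ countB not cs)) (cong (ℤ._+_ (ℤ.+ 1)) (blackMinusWhite-sumZ cs))
  blackMinusWhite-sumZ (false ∷ cs) = trans (minus-suc (countB (λ b → b) cs) (countB not cs)) (cong (ℤ._+_ -[1+ 0 ]) (blackMinusWhite-sumZ cs))
    where
    minus-suc : ∀ t f → ℤ.+ t ℤ.- ℤ.+ suc f ≡ -[1+ 0 ] ℤ.+ (ℤ.+ t ℤ.- ℤ.+ f)
    minus-suc t f = trans (cong (λ u → ℤ.+ t ℤ.+ - u) (refl {x = ℤ.+ 1 ℤ.+ ℤ.+ f}))
      (solve 2 (λ a b → a :+ :- (con (ℤ.+ 1) :+ b) := con -[1+ 0 ] :+ (a :+ :- b)) refl (ℤ.+ t) (ℤ.+ f))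
      where open import Data.Integer.Solver using (module +-*-Solver)
            open +-*-Solver

  ∧-reassoc₄ : ∀ a b c d → ((a ∧ b) ∧ (c ∧ d)) ≡ (a ∧ (b ∧ (c ∧ (d ∧ true))))
  ∧-reassoc₄ true true true true = refl
  ∧-reassoc₄ true true true false = refl
  ∧-reassoc₄ true true false d = refl
  ∧-reassoc₄ true false c d = refl
  ∧-reassoc₄ false b c d = refl

  -- containsMarkedEdge n is isRoot 0 (suc n), and the adjacency test of isCheckerboard is compatible.
  colouredWeight-link : ∀ n e (z : List CTri) → All (λ x → insideᵇ 0 (suc n) (proj₁ x) ≡ true) z →
    coeff (if isTriangulation n (map proj₁ z) ∧ isCheckerboard n (zip (map proj₁ z) (map proj₂ z)) then mono (ℤ.+ 1) (blackMinusWhite (map proj₂ z)) else 0L) e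
    ≡ coeff (colouredWeight 0 (suc n) true z) e
  colouredWeight-link n e z vz rewrite zip-map-proj z = cong₂ (λ b x → coeff (if b then mono (ℤ.+ 1) x else 0L) e) bools
    (trans (blackMinusWhite-sumZ (map proj₂ z)) (sumZ-map sgn proj₂ z))
    where
    bools : isTriangulation n (map proj₁ z) ∧ isCheckerboard n z ≡ isColouredTriangulation 0 (suc n) true z
    bools = trans (cong₂ (λ u v → ((u ℕ.≡ᵇ n) ∧ v) ∧ (all (λ { (T , col) → not (containsMarkedEdge n T) ∨ col }) z ∧ pairwiseB (λ { (T₁ , c₁) (T₂ , c₂) → not (shareEdge T₁ T₂) ∨ differentB c₁ c₂ }) z))
                         (ListP.length-map proj₁ z) (sym (pairwiseB-nonOverlappingᶜ z)))
            (trans (cong₂ (λ u v → ((length z ℕ.≡ᵇ n) ∧ pairwiseB nonOverlappingᶜ z) ∧ (u ∧ v))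
                         (all-cong z (λ { ((a , b , c) , col) → refl })) (pairwiseB-cong z (λ { ((a , b , c) , c1) ((x , y , w) , c2) → refl })))
            (trans (∧-reassoc₄ (length z ℕ.≡ᵇ n) (pairwiseB nonOverlappingᶜ z) (all (rootColour 0 (suc n) true) z) (pairwiseB compatible z))
            (cong (λ u → (length z ℕ.≡ᵇ n) ∧ (pairwiseB nonOverlappingᶜ z ∧ (all (rootColour 0 (suc n) true) z ∧ (pairwiseB compatible z ∧ u))))
              (sym (All⇒all _ z vz)))))

  wPos-polygonWeight : ∀ n → wPos n ≋ polygonWeight (suc (suc n)) 0 (suc n) true
  wPos-polygonWeight n = ⟪ (λ e →
    trans (coeff-sumL (λ τ → sumL (map (H τ) (boolLists (length τ)))) (sublists X) e)
    (trans (sumZ-cong (sublists X) (λ τ → coeff-sumL (H τ) (boolLists (length τ)) e))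
    (trans (sublists-colourings (λ τ cols → coeff (H τ cols) e) X)
    (trans (colouredSublists-cong X (allTris-valid n) _ _ (λ z vz → colouredWeight-link n e z vz))
    (trans (cong (λ L → sumZ (λ z → coeff (colouredWeight 0 (suc n) true z) e) (colouredSublists L)) (sym (filterB-all (insideᵇ 0 (suc n)) X (allTris-valid n))))
    (sym (coeff-sumL (colouredWeight 0 (suc n) true) (colouredSublists (trianglesInside (suc (suc n)) 0 (suc n))) e))))))) ⟫
    where
    X = allTris (suc (suc n))
    H : List Tri → List Bool → Laurent
    H τ cols = if isTriangulation n τ ∧ isCheckerboard n (zip τ cols) then mono (ℤ.+ 1) (blackMinusWhite cols) else 0L

  w-polygonWeight : ∀ j → w j ≋ polygonWeight (suc (suc j)) 0 (suc j) true
  w-polygonWeight zero = L.sym (polygonWeight-edge 2 0 true)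
  w-polygonWeight (suc j) = wPos-polygonWeight (suc j)

  polygonWeight≈w : ∀ N l r d c → r ≡ l + suc d → r < N → polygonWeight N l r c ≋ w d
  polygonWeight≈w N l r d c r≡ r<N =
    L.trans (Translation.polygonWeight-translate N d d ℕP.≤-refl l r c r≡ r<N)
      (L.trans (polygonWeight-ambient N (suc (suc d)) 0 (suc d) true d<N ℕP.≤-refl) (L.sym (w-polygonWeight d)))
    where
    d<N : suc d < N
    d<N = ℕP.≤-<-trans (subst (suc d ≤_) (sym r≡) (ℕP.m≤n+m (suc d) l)) r<N

  w-recurrence : ∀ n → w (suc n) ≈L tL *L sumL (map (λ k → invT (w k) *L invT (w (n ∸ k))) (upTo (suc n)))
  w-recurrence n = ≋→ (L.trans (w-polygonWeight (suc n))
    (L.trans (polygonWeight-recurrence N 0 (suc (suc n)) true (s≤s (s≤s z≤n)) ℕP.≤-refl)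
      (L.*-cong {tL} L.refl (sumL-upTo-cong (suc n) pieces))))
    where
    N = suc (suc (suc n))
    pieces : ∀ j → j < suc n →
      invT (polygonWeight N 0 (suc j) false) *L invT (polygonWeight N (suc j) (suc (suc n)) false) ≋ invT (w j) *L invT (w (n ∸ j))
    pieces j j≤n = L.*-cong (invT-cong (polygonWeight≈w N 0 (suc j) j false refl (s≤s (ℕP.<-trans j≤n ℕP.≤-refl))))
                            (invT-cong (polygonWeight≈w N (suc j) (suc (suc n)) (n ∸ j) false split ℕP.≤-refl))
      where
      split : suc (suc n) ≡ suc j + suc (n ∸ j)
      split = sym (cong suc (trans (ℕP.+-suc j (n ∸ j)) (cong suc (ℕP.m+[n∸m]≡n (ℕP.≤-pred j≤n)))))


open import Data.Nat using (suc; _∸_)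
open import Data.Integer using (+_)
open import Data.List using (map; upTo)
open import Data.Product using (_×_; _,_)
open import Relation.Binary.PropositionalEquality using (refl)
open TriangulationWeight using (w-recurrence)
open FunctionalEquation using (module FromRecurrence)

theorem2p1 : (w 0 ≈L 1L
    × (∀ n → w (suc n) ≈L tL *L sumL (map (λ k → invT (w k) *L invT (w (n ∸ k))) (upTo (suc n)))))
    × (constS tL *S (constS 1L +S constS tL *S xS)
    +S (-S (constS tL *S W))
    +S constS (mono (+ 2) (+ 1)) *S xS *S xS *S W *S W
    +S xS *S xS *S xS *S W *S W *S W *S W
    ≈S constS 0L)
theorem2p1 = (w-0 , w-recurrence) , FromRecurrence.quartic-coefficients w w-0 w-recurrence
  where
  w-0 : w 0 ≈L 1L
  w-0 _ = refl
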